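{- Let $p(x)$ be a gap-free polynomial and $a,b$ positive integers. Let $L_{p,1}$ be the list of coefficients of $(a+bx)p(x)$, from the constant term to the leading term, with $1$ added to its first and last entries. Define $L_{p,2}$ in the same way from $(b+ax)p(x)$. Then the caterpillars $C_{p,1}=\mathrm{Cat}(L_{p,1})$ and $C_{p,2}=\mathrm{Cat}(L_{p,2})$ have the same subtree polynomial.
   Context: A polynomial is gap-free if all its coefficients are $0$ or $1$, its constant and leading coefficients are $1$, and no two consecutive coefficients are both $0$. For a sequence $(c_1,\dots,c_k)$ of positive integers with $c_1,c_k\ge2$, the caterpillar $\mathrm{Cat}(c_1,\dots,c_k)$ is the tree consisting of a path $v_1,\dots,v_k$ in which each $v_i$ is additionally adjacent to $c_i-1$ leaves. For a tree $T$, a subtree is a connected subgraph with nonempty vertex set. For a subtree $S$, let $e(S)$ be its number of edges and $\ell(S)$ the number of its edges having at least one endpoint that is a leaf of $S$. The subtree polynomial is $\sum_S q^{e(S)}r^{\ell(S)}$ over all subtrees $S$ of $T$. -}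

module Defs where

open import Data.Nat using (ℕ; zero; suc; _+_; _*_; _∸_; _≤_; _≡ᵇ_)
open import Data.Bool using (Bool; true; false; _∧_; _∨_; not; if_then_else_)
open import Data.List using (List; []; _∷_; _++_; _∷ʳ_; map; zipWith; upTo; length; reverse; foldr; concatMap)
open import Data.Nat.ListAction using (sum)
open import Data.Bool.ListAction using (all; any)
open import Data.List.Relation.Unary.All using (All)
open import Data.Product using (_×_; _,_; ∃)
open import Data.Sum using (_⊎_)
open import Relation.Binary.PropositionalEquality using (_≡_)
open import Relation.Nullary using (¬_)

-- Polynomials with natural-number coefficients are represented by their
-- coefficient list, constant term first.

record GapFree (p : List ℕ) : Set where
  field
    zeroOne    : All (λ c → c ≡ 0 ⊎ c ≡ 1) p
    constOne   : ∃ λ xs → p ≡ 1 ∷ xs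
    leadingOne : ∃ λ xs → p ≡ xs ∷ʳ 1
    noGap      : ∀ xs ys → ¬ (p ≡ xs ++ (0 ∷ 0 ∷ ys))

-- coefficient list of (a + b x) p(x)
mulLin : ℕ → ℕ → List ℕ → List ℕ
mulLin a b p = zipWith _+_ (map (a *_) p ∷ʳ 0) (0 ∷ map (b *_) p)

incHead : List ℕ → List ℕ
incHead []       = []
incHead (x ∷ xs) = suc x ∷ xs

incLast : List ℕ → List ℕ
incLast xs = reverse (incHead (reverse xs))

addEnds : List ℕ → List ℕ
addEnds xs = incLast (incHead xs)

L₁ L₂ : ℕ → ℕ → List ℕ → List ℕ
L₁ a b p = addEnds (mulLin a b p)
L₂ a b p = addEnds (mulLin b a p)

-- Finite simple graphs: vertices 0 … n-1, list of edges.

record Graph : Set where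
  constructor graph
  field
    nV    : ℕ
    edges : List (ℕ × ℕ)
open Graph public

record IsCatSeq (cs : List ℕ) : Set where
  field
    positive : All (1 ≤_) cs
    firstBig : ∃ λ c → ∃ λ xs → cs ≡ c ∷ xs × 2 ≤ c
    lastBig  : ∃ λ c → ∃ λ xs → cs ≡ xs ∷ʳ c × 2 ≤ c

-- Cat(c_1,…,c_k): path vertices 0,…,k-1 (vertex i-1 is v_i), leaves k, k+1, …
catLeafEdges : ℕ → ℕ → List ℕ → List (ℕ × ℕ)
catLeafEdges i f []       = []
catLeafEdges i f (c ∷ cs) =
  map (λ j → (i , f + j)) (upTo (c ∸ 1)) ++ catLeafEdges (suc i) (f + (c ∸ 1)) cs

Cat : List ℕ → Graph
Cat cs = graph (k + sum (map (λ c → c ∸ 1) cs))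
               (map (λ i → (i , suc i)) (upTo (k ∸ 1)) ++ catLeafEdges 0 k cs)
  where k = length cs

-- Subgraphs: a vertex subset (ℕ → Bool, relevant on 0 … n-1) and an edge
-- subset (a list of Bools aligned with the edge list).

allBools : ℕ → List (List Bool)
allBools zero    = [] ∷ []
allBools (suc k) = concatMap (λ bs → (false ∷ bs) ∷ (true ∷ bs) ∷ []) (allBools k)

at : List Bool → ℕ → Bool
at []       _       = false
at (b ∷ bs) zero    = b
at (b ∷ bs) (suc i) = at bs i

selEdges : List (ℕ × ℕ) → List Bool → List (ℕ × ℕ)
selEdges []       _              = []
selEdges (_ ∷ _)  []             = []
selEdges (e ∷ es) (true  ∷ bs)   = e ∷ selEdges es bs
selEdges (e ∷ es) (false ∷ bs)   = selEdges es bs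

reachStep : List (ℕ × ℕ) → (ℕ → Bool) → (ℕ → Bool)
reachStep E R w = R w ∨ any (λ { (u , v) → ((u ≡ᵇ w) ∧ R v) ∨ ((v ≡ᵇ w) ∧ R u) }) E

iter : ℕ → (A : Set) → (A → A) → A → A
iter zero    A f x = x
iter (suc k) A f x = f (iter k A f x)

reach : ℕ → List (ℕ × ℕ) → ℕ → (ℕ → Bool)
reach n E u = iter n (ℕ → Bool) (reachStep E) (λ w → u ≡ᵇ w)

isSubtree : Graph → List Bool → List Bool → Bool
isSubtree G vs es =
  any (at vs) (upTo (nV G))
  ∧ all (λ { (u , v) → at vs u ∧ at vs v }) E
  ∧ all (λ u → not (at vs u) ∨
          all (λ w → not (at vs w) ∨ reach (nV G) E u w) (upTo (nV G)))
        (upTo (nV G))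
  where E = selEdges (edges G) es

deg : List (ℕ × ℕ) → ℕ → ℕ
deg E w = sum (map (λ { (u , v) → (if u ≡ᵇ w then 1 else 0) + (if v ≡ᵇ w then 1 else 0) }) E)

eS : List (ℕ × ℕ) → ℕ
eS E = length E

ℓS : List (ℕ × ℕ) → ℕ
ℓS E = sum (map (λ { (u , v) → if (deg E u ≡ᵇ 1) ∨ (deg E v ≡ᵇ 1) then 1 else 0 }) E)

subtreeCoeff : Graph → ℕ → ℕ → ℕ
subtreeCoeff G i j =
  sum (concatMap (λ vs → map (λ es →
         if isSubtree G vs es ∧ (eS (E es) ≡ᵇ i) ∧ (ℓS (E es) ≡ᵇ j) then 1 else 0)
       (allBools (length (edges G))))
     (allBools (nV G)))
  where E = selEdges (edges G)

SameSubtreePoly : Graph → Graph → Set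
SameSubtreePoly G H = ∀ i j → subtreeCoeff G i j ≡ subtreeCoeff H i j

module Submission where

open import Defs
open import Data.Nat using (ℕ; _≤_)
open import Data.List using (List)
open import Data.Product using (_×_)

-- Both caterpillars have the same numbers of vertices and edges, so it suffices that their subtree
-- polynomials agree at all natural numbers q = Q, r = R: at q = B ^ K, r = B with B large enough the
-- coefficients become base-B digits.
--
-- Writing p as 1 followed by blocks 1 and 0 1, L₁ is a + 1, then a + b for each block 1 and b, a
-- for each block 0 1, then b + 1; L₂ is the same with a and b exchanged.  Apart from single
-- vertices, a subtree of a caterpillar is a spine interval with some of the pendant edges at it.
-- Reading the spine from left to right, the weighted count of these subtrees is, up to a term that
-- only depends on the length, the entry γ of a product of transfer matrices E(Yᵢ), where
-- Yᵢ = (1 + QR)^(cᵢ - 1), in a monoid of upper triangular 3 × 3 matrices.  An anti-automorphism φ of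
-- this monoid preserves γ of products whose factors have proportional entries (α, β).  With w = 1 + QR,
-- x = w ^ (a - 1) and z = w ^ (b - 1), the entries of L₁ have Y = w x at the start, w z at the end,
-- and w x z (for a + b) or z, x (for b, a) in between.  Peeling off the factors w at the ends and
-- conjugating turns every E(t) into a φ-symmetric V(t), and the product splits into blocks
-- V(x) V(w x z)ⁿ V(z) with proportional (α, β); φ maps the block for (x, z) to the block for (z, x),
-- and these make up the product for L₂.

module Booleans where

  open import Data.Bool using (Bool; true; false; _∧_; _∨_; not; if_then_else_)
  open import Data.Bool.Properties using (¬-not; T-≡)
  open import Function.Bundles using (module Equivalence)
  open import Data.Bool.ListAction using (all; any)
  open import Data.List using ([]; _∷_)
  open import Data.List.Membership.Propositional using (_∈_)
  open import Data.List.Relation.Unary.Any using (here; there)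
  open import Data.Nat using (ℕ; zero; suc; _+_; _≡ᵇ_; _≤ᵇ_; _≤_; _<_)
  open import Data.Nat.Properties using (suc-injective; ≤ᵇ⇒≤; ≤⇒≤ᵇ; <⇒≱; <⇒≢; >⇒≢)
  open import Data.Product using (Σ-syntax; _×_; _,_)
  open import Data.Sum using (_⊎_; inj₁; inj₂)
  open import Relation.Binary.PropositionalEquality
  open import Relation.Nullary using (¬_)

  ind : Bool → ℕ
  ind b = if b then 1 else 0

  ∨-introˡ : ∀ {a b} → a ≡ true → a ∨ b ≡ true
  ∨-introˡ refl = refl

  ∨-introʳ : ∀ {a b} → b ≡ true → a ∨ b ≡ true
  ∨-introʳ {true}  _ = refl
  ∨-introʳ {false} p = p

  ∨-elim : ∀ {a b} → a ∨ b ≡ true → a ≡ true ⊎ b ≡ true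
  ∨-elim {true}  _ = inj₁ refl
  ∨-elim {false} p = inj₂ p

  ∧-intro : ∀ {a b} → a ≡ true → b ≡ true → a ∧ b ≡ true
  ∧-intro refl refl = refl

  ∧-elimˡ : ∀ {a b} → a ∧ b ≡ true → a ≡ true
  ∧-elimˡ {true} _ = refl

  ∧-elimʳ : ∀ {a b} → a ∧ b ≡ true → b ≡ true
  ∧-elimʳ {true} p = p

  ⇒ᵇ-intro : ∀ {a b} → (a ≡ true → b ≡ true) → not a ∨ b ≡ true
  ⇒ᵇ-intro {true}  f = f refl
  ⇒ᵇ-intro {false} _ = refl

  ⇒ᵇ-elim : ∀ {a b} → not a ∨ b ≡ true → a ≡ true → b ≡ true
  ⇒ᵇ-elim h refl = h

  bool-ext : ∀ {a b} → (a ≡ true → b ≡ true) → (b ≡ true → a ≡ true) → a ≡ b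
  bool-ext {true}  {true}  _ _ = refl
  bool-ext {true}  {false} f _ = sym (f refl)
  bool-ext {false} {true}  _ g = g refl
  bool-ext {false} {false} _ _ = refl

  ≡ᵇ-true⇒≡ : ∀ m n → (m ≡ᵇ n) ≡ true → m ≡ n
  ≡ᵇ-true⇒≡ zero    zero    _ = refl
  ≡ᵇ-true⇒≡ (suc m) (suc n) p = cong suc (≡ᵇ-true⇒≡ m n p)

  ≡⇒≡ᵇ-true : ∀ m n → m ≡ n → (m ≡ᵇ n) ≡ true
  ≡⇒≡ᵇ-true zero    zero    _ = refl
  ≡⇒≡ᵇ-true (suc m) (suc n) p = ≡⇒≡ᵇ-true m n (suc-injective p)

  ≡ᵇ-refl : ∀ m → (m ≡ᵇ m) ≡ true
  ≡ᵇ-refl m = ≡⇒≡ᵇ-true m m refl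

  ≢⇒≡ᵇ-false : ∀ m n → ¬ (m ≡ n) → (m ≡ᵇ n) ≡ false
  ≢⇒≡ᵇ-false m n m≢n = ¬-not (λ eq → m≢n (≡ᵇ-true⇒≡ m n eq))

  ≤⇒≤ᵇ-true : ∀ {m n} → m ≤ n → (m ≤ᵇ n) ≡ true
  ≤⇒≤ᵇ-true m≤n = Equivalence.to T-≡ (≤⇒≤ᵇ m≤n)

  >⇒≤ᵇ-false : ∀ {m n} → n < m → (m ≤ᵇ n) ≡ false
  >⇒≤ᵇ-false {m} {n} n<m = ¬-not λ m≤ᵇn → <⇒≱ n<m (≤ᵇ⇒≤ m n (Equivalence.from T-≡ m≤ᵇn))

  <⇒≡ᵇ-false : ∀ {m n} → m < n → (m ≡ᵇ n) ≡ false
  <⇒≡ᵇ-false m<n = ≢⇒≡ᵇ-false _ _ (<⇒≢ m<n)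

  >⇒≡ᵇ-false : ∀ {m n} → n < m → (m ≡ᵇ n) ≡ false
  >⇒≡ᵇ-false n<m = ≢⇒≡ᵇ-false _ _ (>⇒≢ n<m)

  ≡ᵇ-+ : ∀ i m → (i ≡ᵇ i + m) ≡ (m ≡ᵇ 0)
  ≡ᵇ-+ zero    zero    = refl
  ≡ᵇ-+ zero    (suc m) = refl
  ≡ᵇ-+ (suc i) m       = ≡ᵇ-+ i m

  module _ {A : Set} {p : A → Bool} where

    any⁺ : ∀ {x xs} → x ∈ xs → p x ≡ true → any p xs ≡ true
    any⁺ (here refl) px = ∨-introˡ px
    any⁺ (there x∈)  px = ∨-introʳ (any⁺ x∈ px)

    any⁻ : ∀ xs → any p xs ≡ true → Σ[ x ∈ A ] x ∈ xs × p x ≡ true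
    any⁻ (x ∷ xs) h with ∨-elim {p x} h
    ... | inj₁ px = x , here refl , px
    ... | inj₂ r with any⁻ xs r
    ...   | y , y∈ , py = y , there y∈ , py

    all⁺ : ∀ xs → (∀ {x} → x ∈ xs → p x ≡ true) → all p xs ≡ true
    all⁺ []       _ = refl
    all⁺ (x ∷ xs) f = ∧-intro (f (here refl)) (all⁺ xs (λ x∈ → f (there x∈)))

    all⁻ : ∀ {x xs} → all p xs ≡ true → x ∈ xs → p x ≡ true
    all⁻ h (here refl) = ∧-elimˡ h
    all⁻ {xs = y ∷ ys} h (there x∈) = all⁻ (∧-elimʳ {p y} h) x∈

module Sums where

  open import Data.Bool using (Bool; true; false)
  open import Data.List using (List; []; _∷_; _++_; map; concatMap; length)
  open import Data.List.Properties using (map-++; map-cong)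
  open import Data.Nat using (ℕ; zero; suc; _+_; _*_)
  open import Data.Nat.ListAction using (sum)
  open import Data.Nat.ListAction.Properties using (sum-++)
  open import Data.Nat.Properties using (+-identityʳ; *-zeroʳ; *-comm; *-distribˡ-+; +-commutativeSemigroup)
  open import Algebra.Properties.CommutativeSemigroup +-commutativeSemigroup using (interchange)
  open import Relation.Binary.PropositionalEquality
  open ≡-Reasoning
  open import Defs using (allBools)

  module _ {A : Set} where

    sum-map-++ : ∀ (f : A → ℕ) xs ys → sum (map f (xs ++ ys)) ≡ sum (map f xs) + sum (map f ys)
    sum-map-++ f xs ys = trans (cong sum (map-++ f xs ys)) (sum-++ (map f xs) (map f ys))

    sum-map-+ : ∀ (f g : A → ℕ) xs → sum (map (λ x → f x + g x) xs) ≡ sum (map f xs) + sum (map g xs)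
    sum-map-+ f g []       = refl
    sum-map-+ f g (x ∷ xs) = trans (cong (f x + g x +_) (sum-map-+ f g xs))
                                   (interchange (f x) (g x) (sum (map f xs)) (sum (map g xs)))

    sum-map-*ˡ : ∀ c (f : A → ℕ) xs → sum (map (λ x → c * f x) xs) ≡ c * sum (map f xs)
    sum-map-*ˡ c f []       = sym (*-zeroʳ c)
    sum-map-*ˡ c f (x ∷ xs) = trans (cong (c * f x +_) (sum-map-*ˡ c f xs))
                                    (sym (*-distribˡ-+ c (f x) (sum (map f xs))))

    sum-map-0 : ∀ (xs : List A) → sum (map (λ _ → 0) xs) ≡ 0
    sum-map-0 []       = refl
    sum-map-0 (x ∷ xs) = sum-map-0 xs

  sum-map-concatMap : ∀ {A B : Set} (f : B → ℕ) (g : A → List B) xs →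
    sum (map f (concatMap g xs)) ≡ sum (map (λ x → sum (map f (g x))) xs)
  sum-map-concatMap f g []       = refl
  sum-map-concatMap f g (x ∷ xs) =
    trans (sum-map-++ f (g x) (concatMap g xs)) (cong (sum (map f (g x)) +_) (sum-map-concatMap f g xs))

  sum-map-swap : ∀ {A B : Set} (f : A → B → ℕ) xs ys →
    sum (map (λ x → sum (map (f x) ys)) xs) ≡ sum (map (λ y → sum (map (λ x → f x y) xs)) ys)
  sum-map-swap f []       ys = sym (sum-map-0 ys)
  sum-map-swap f (x ∷ xs) ys = trans (cong (sum (map (f x) ys) +_) (sum-map-swap f xs ys))
                                     (sym (sum-map-+ (f x) (λ y → sum (map (λ x → f x y) xs)) ys))

  sumBools : ℕ → (List Bool → ℕ) → ℕ
  sumBools n f = sum (map f (allBools n))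

  sumBools-suc : ∀ n f → sumBools (suc n) f ≡ sumBools n (λ bs → f (false ∷ bs) + f (true ∷ bs))
  sumBools-suc n f =
    trans (sum-map-concatMap f (λ bs → (false ∷ bs) ∷ (true ∷ bs) ∷ []) (allBools n))
          (cong sum (map-cong (λ bs → cong (f (false ∷ bs) +_) (+-identityʳ (f (true ∷ bs)))) (allBools n)))

  sumBools-cong : ∀ n {f g} → (∀ bs → length bs ≡ n → f bs ≡ g bs) → sumBools n f ≡ sumBools n g
  sumBools-cong zero    f≗g = cong (_+ 0) (f≗g [] refl)
  sumBools-cong (suc n) {f} {g} f≗g = begin
    sumBools (suc n) f                                     ≡⟨ sumBools-suc n f ⟩
    sumBools n (λ bs → f (false ∷ bs) + f (true ∷ bs))
      ≡⟨ sumBools-cong n (λ bs eq → cong₂ _+_ (f≗g (false ∷ bs) (cong suc eq)) (f≗g (true ∷ bs) (cong suc eq))) ⟩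
    sumBools n (λ bs → g (false ∷ bs) + g (true ∷ bs))     ≡⟨ sumBools-suc n g ⟨
    sumBools (suc n) g                                     ∎

  sumBools-+ : ∀ n f g → sumBools n (λ bs → f bs + g bs) ≡ sumBools n f + sumBools n g
  sumBools-+ n f g = sum-map-+ f g (allBools n)

  sumBools-*ˡ : ∀ n c f → sumBools n (λ bs → c * f bs) ≡ c * sumBools n f
  sumBools-*ˡ n c f = sum-map-*ˡ c f (allBools n)

  sumBools-*ʳ : ∀ n f c → sumBools n (λ bs → f bs * c) ≡ sumBools n f * c
  sumBools-*ʳ n f c = trans (sumBools-cong n (λ bs _ → *-comm (f bs) c))
                            (trans (sumBools-*ˡ n c f) (*-comm c (sumBools n f)))

  sumBools-0 : ∀ n → sumBools n (λ _ → 0) ≡ 0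
  sumBools-0 n = sum-map-0 (allBools n)

  sumBools-++ : ∀ m n f → sumBools (m + n) f ≡ sumBools m (λ xs → sumBools n (λ ys → f (xs ++ ys)))
  sumBools-++ zero    n f = sym (+-identityʳ _)
  sumBools-++ (suc m) n f = begin
    sumBools (suc (m + n)) f                                   ≡⟨ sumBools-suc (m + n) f ⟩
    sumBools (m + n) (λ bs → f (false ∷ bs) + f (true ∷ bs))   ≡⟨ sumBools-++ m n _ ⟩
    sumBools m (λ xs → sumBools n (λ ys → f (false ∷ xs ++ ys) + f (true ∷ xs ++ ys)))
      ≡⟨ sumBools-cong m (λ xs _ → sumBools-+ n (λ ys → f (false ∷ xs ++ ys)) (λ ys → f (true ∷ xs ++ ys))) ⟩
    sumBools m (λ xs → sumBools n (λ ys → f (false ∷ xs ++ ys)) + sumBools n (λ ys → f (true ∷ xs ++ ys)))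
      ≡⟨ sumBools-suc m _ ⟨
    sumBools (suc m) (λ xs → sumBools n (λ ys → f (xs ++ ys))) ∎

  sumBools-swap : ∀ m n (f : List Bool → List Bool → ℕ) →
    sumBools m (λ xs → sumBools n (f xs)) ≡ sumBools n (λ ys → sumBools m (λ xs → f xs ys))
  sumBools-swap m n f = sum-map-swap f (allBools m) (allBools n)

module Reachability where

  open import Data.Bool using (Bool; true; _∨_)
  open import Data.Bool.ListAction using (any)
  open import Data.List using (List)
  open import Data.List.Membership.Propositional using (_∈_)
  open import Data.Nat using (ℕ; zero; suc; _≤_; _≡ᵇ_; z≤n; s≤s)
  open import Data.Nat.Properties using (m≤n⇒m<n∨m≡n)
  open import Data.Product using (_×_; _,_)
  open import Data.Sum using (inj₁; inj₂)
  open import Relation.Binary.PropositionalEquality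
  open import Defs using (reach)
  open Booleans

  module _ (E : List (ℕ × ℕ)) where

    reach-suc : ∀ n u w → reach n E u w ≡ true → reach (suc n) E u w ≡ true
    reach-suc n u w = ∨-introˡ

    reach-mono : ∀ {m n} u w → m ≤ n → reach m E u w ≡ true → reach n E u w ≡ true
    reach-mono {n = zero} u w z≤n h = h
    reach-mono {m} {suc n} u w m≤1+n h with m≤n⇒m<n∨m≡n m≤1+n
    ... | inj₂ refl      = h
    ... | inj₁ (s≤s m≤n) = reach-suc n u w (reach-mono u w m≤n h)

    reach-refl : ∀ n u → reach n E u u ≡ true
    reach-refl zero    u = ≡ᵇ-refl u
    reach-refl (suc n) u = reach-suc n u u (reach-refl n u)

    reach-fwd : ∀ n u v x → reach n E u v ≡ true → (v , x) ∈ E → reach (suc n) E u x ≡ true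
    reach-fwd n u v x h e = ∨-introʳ (any⁺ e (∨-introʳ (∧-intro (≡ᵇ-refl x) h)))

    reach-bwd : ∀ n u v x → reach n E u v ≡ true → (x , v) ∈ E → reach (suc n) E u x ≡ true
    reach-bwd n u v x h e = ∨-introʳ (any⁺ e (∨-introˡ (∧-intro (≡ᵇ-refl x) h)))

    reach-invariant : ∀ (C : ℕ → Bool) → (∀ {a b} → (a , b) ∈ E → C a ≡ C b) →
                      ∀ n u w → C u ≡ true → reach n E u w ≡ true → C w ≡ true
    reach-invariant C closed zero u w Cu h rewrite ≡ᵇ-true⇒≡ u w h = Cu
    reach-invariant C closed (suc n) u w Cu h with ∨-elim {reach n E u w} h
    ... | inj₁ r = reach-invariant C closed n u w Cu r
    ... | inj₂ r with any⁻ E r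
    ...   | (a , b) , e , q with ∨-elim q
    ...     | inj₁ q₁ rewrite sym (≡ᵇ-true⇒≡ a w (∧-elimˡ q₁)) =
      trans (closed e) (reach-invariant C closed n u b Cu (∧-elimʳ q₁))
    ...     | inj₂ q₂ rewrite sym (≡ᵇ-true⇒≡ b w (∧-elimˡ q₂)) =
      trans (sym (closed e)) (reach-invariant C closed n u a Cu (∧-elimʳ q₂))

  touches : List (ℕ × ℕ) → ℕ → Bool
  touches S w = any (λ { (a , b) → (a ≡ᵇ w) ∨ (b ≡ᵇ w) }) S

  touches-fst : ∀ {S a b} → (a , b) ∈ S → touches S a ≡ true
  touches-fst {a = a} e = any⁺ e (∨-introˡ (≡ᵇ-refl a))

  touches-snd : ∀ {S a b} → (a , b) ∈ S → touches S b ≡ true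
  touches-snd {a = a} {b} e = any⁺ e (∨-introʳ {a ≡ᵇ b} (≡ᵇ-refl b))

  reach⇒touches : ∀ S n u w → reach n S u w ≡ true → (u ≡ᵇ w) ∨ touches S w ≡ true
  reach⇒touches S n u w =
    reach-invariant S (λ v → (u ≡ᵇ v) ∨ touches S v)
      (λ {a} {b} e → trans (∨-introʳ {u ≡ᵇ a} (touches-fst e)) (sym (∨-introʳ {u ≡ᵇ b} (touches-snd e))))
      n u w (∨-introˡ (≡ᵇ-refl u))

module VertexSets where

  open import Data.Bool using (Bool; true; false; _∧_; _∨_; not; if_then_else_)
  open import Data.Bool.ListAction using (all; any)
  open import Data.Bool.Properties using (not-¬; ¬-not; ∧-identityʳ; ∧-zeroʳ)
  open import Data.Empty using (⊥-elim)
  open import Data.List using (List; []; _∷_; upTo; length)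
  open import Data.List.Membership.Propositional using (_∈_)
  open import Data.List.Membership.Propositional.Properties using (∈-upTo⁺; ∈-upTo⁻)
  open import Data.Nat using (ℕ; zero; suc; _+_; _<_; _≡ᵇ_; z≤n; s≤s)
  open import Data.Nat.Properties using (+-identityʳ; +-comm; suc-injective; 0≢1+n)
  open import Data.Product using (Σ-syntax; _×_; _,_; proj₁; proj₂)
  open import Data.Sum using (inj₁; inj₂)
  open import Relation.Binary.PropositionalEquality
  open import Defs using (at; reach)
  open Booleans
  open Reachability
  open Sums

  AllReachable : ℕ → List (ℕ × ℕ) → (ℕ → Bool) → Bool
  AllReachable N S P = all (λ u → not (P u) ∨ all (λ w → not (P w) ∨ reach N S u w) (upTo N)) (upTo N)

  -- `isSubtree G vs es` unfolds to `isSubtreeOn (nV G) (selEdges (edges G) es) vs`.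
  isSubtreeOn : ℕ → List (ℕ × ℕ) → List Bool → Bool
  isSubtreeOn N S vs = any (at vs) (upTo N) ∧ all (λ { (u , v) → at vs u ∧ at vs v }) S ∧ AllReachable N S (at vs)

  isConnected : ℕ → List (ℕ × ℕ) → Bool
  isConnected N S = AllReachable N S (touches S)

  EdgesBelow : ℕ → List (ℕ × ℕ) → Set
  EdgesBelow N S = ∀ {a b} → (a , b) ∈ S → a < N × b < N

  module _ (N : ℕ) (S : List (ℕ × ℕ)) (P : ℕ → Bool) where

    allReachable⁻ : AllReachable N S P ≡ true → ∀ {u w} → u < N → w < N →
                    P u ≡ true → P w ≡ true → reach N S u w ≡ true
    allReachable⁻ h u<N w<N Pu = ⇒ᵇ-elim (all⁻ (⇒ᵇ-elim (all⁻ h (∈-upTo⁺ u<N)) Pu) (∈-upTo⁺ w<N))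

    allReachable⁺ : (∀ {u w} → u < N → w < N → P u ≡ true → P w ≡ true → reach N S u w ≡ true) →
                    AllReachable N S P ≡ true
    allReachable⁺ f = all⁺ (upTo N) λ u∈ → ⇒ᵇ-intro λ Pu →
                      all⁺ (upTo N) λ w∈ → ⇒ᵇ-intro (f (∈-upTo⁻ u∈) (∈-upTo⁻ w∈) Pu)

  at⇒<length : ∀ vs w → at vs w ≡ true → w < length vs
  at⇒<length (b ∷ vs) zero    _ = s≤s z≤n
  at⇒<length (b ∷ vs) (suc w) h = s≤s (at⇒<length vs w h)

  _==_ : Bool → Bool → Bool
  true  == b = b
  false == b = not b

  ==⇒≡ : ∀ a b → a == b ≡ true → a ≡ b
  ==⇒≡ true  true  _ = refl
  ==⇒≡ false false _ = refl

  ≡⇒== : ∀ a b → a ≡ b → a == b ≡ true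
  ≡⇒== true  .true  refl = refl
  ≡⇒== false .false refl = refl

  agrees : List Bool → (ℕ → Bool) → Bool
  agrees []       f = true
  agrees (b ∷ bs) f = (b == f 0) ∧ agrees bs (λ w → f (suc w))

  agrees⇒ : ∀ vs f → agrees vs f ≡ true → ∀ w → w < length vs → at vs w ≡ f w
  agrees⇒ (b ∷ bs) f h zero    _         = ==⇒≡ b (f 0) (∧-elimˡ h)
  agrees⇒ (b ∷ bs) f h (suc w) (s≤s w<) = agrees⇒ bs (λ w → f (suc w)) (∧-elimʳ {b == f 0} h) w w<

  ⇒agrees : ∀ vs f → (∀ w → w < length vs → at vs w ≡ f w) → agrees vs f ≡ true
  ⇒agrees []       f h = refl
  ⇒agrees (b ∷ bs) f h = ∧-intro (≡⇒== b (f 0) (h 0 (s≤s z≤n)))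
                                 (⇒agrees bs (λ w → f (suc w)) (λ w w< → h (suc w) (s≤s w<)))

  noneTrue : List Bool → Bool
  noneTrue []       = true
  noneTrue (b ∷ bs) = not b ∧ noneTrue bs

  oneTrue : List Bool → Bool
  oneTrue []       = false
  oneTrue (b ∷ bs) = if b then noneTrue bs else oneTrue bs

  count-agrees : ∀ n f → sumBools n (λ vs → ind (agrees vs f)) ≡ 1
  count-agrees zero    f = refl
  count-agrees (suc n) f =
    trans (sumBools-suc n _) (trans (sumBools-cong n split) (count-agrees n (λ w → f (suc w))))
    where
    split : ∀ bs → length bs ≡ n → ind (not (f 0) ∧ agrees bs (λ w → f (suc w))) + ind (f 0 ∧ agrees bs (λ w → f (suc w)))
                                   ≡ ind (agrees bs (λ w → f (suc w)))
    split bs _ with f 0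
    ... | true  = refl
    ... | false = +-identityʳ _

  count-noneTrue : ∀ n → sumBools n (λ vs → ind (noneTrue vs)) ≡ 1
  count-noneTrue zero    = refl
  count-noneTrue (suc n) = trans (sumBools-suc n _) (trans (sumBools-cong n (λ bs _ → +-identityʳ _)) (count-noneTrue n))

  count-oneTrue : ∀ n → sumBools n (λ vs → ind (oneTrue vs)) ≡ n
  count-oneTrue zero    = refl
  count-oneTrue (suc n) = begin
    sumBools (suc n) (λ vs → ind (oneTrue vs))                           ≡⟨ sumBools-suc n _ ⟩
    sumBools n (λ bs → ind (oneTrue bs) + ind (noneTrue bs))             ≡⟨ sumBools-+ n _ _ ⟩
    sumBools n (λ bs → ind (oneTrue bs)) + sumBools n (λ bs → ind (noneTrue bs))
      ≡⟨ cong₂ _+_ (count-oneTrue n) (count-noneTrue n) ⟩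
    n + 1                                                                ≡⟨ +-comm n 1 ⟩
    suc n                                                                ∎
    where open ≡-Reasoning

  noneTrue⇒ : ∀ vs → noneTrue vs ≡ true → ∀ w → at vs w ≡ false
  noneTrue⇒ []           _ w       = refl
  noneTrue⇒ (false ∷ vs) _ zero    = refl
  noneTrue⇒ (false ∷ vs) h (suc w) = noneTrue⇒ vs h w

  ⇒noneTrue : ∀ vs → (∀ w → at vs w ≡ false) → noneTrue vs ≡ true
  ⇒noneTrue []           _ = refl
  ⇒noneTrue (true ∷ vs)  h = ⊥-elim (not-¬ refl (h 0))
  ⇒noneTrue (false ∷ vs) h = ⇒noneTrue vs (λ w → h (suc w))

  Unique : List Bool → Set
  Unique vs = ∀ u w → at vs u ≡ true → at vs w ≡ true → u ≡ w

  oneTrue⇒ : ∀ vs → oneTrue vs ≡ true → (Σ[ u ∈ ℕ ] at vs u ≡ true) × Unique vs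
  oneTrue⇒ (true ∷ vs) h = (0 , refl) , unique
    where
    unique : Unique (true ∷ vs)
    unique zero    zero    _ _ = refl
    unique zero    (suc w) _ e = ⊥-elim (not-¬ e (noneTrue⇒ vs h w))
    unique (suc u) _       e _ = ⊥-elim (not-¬ e (noneTrue⇒ vs h u))
  oneTrue⇒ (false ∷ vs) h with oneTrue⇒ vs h
  ... | (u , e) , unique = (suc u , e) , λ { (suc u) (suc w) e e′ → cong suc (unique u w e e′) }

  ⇒oneTrue : ∀ vs → Σ[ u ∈ ℕ ] at vs u ≡ true → Unique vs → oneTrue vs ≡ true
  ⇒oneTrue (true ∷ vs)  _             unique = ⇒noneTrue vs λ w → ¬-not λ e → 0≢1+n (unique 0 (suc w) refl e)
  ⇒oneTrue (false ∷ vs) (suc u , e) unique = ⇒oneTrue vs (u , e) λ u w e e′ → suc-injective (unique (suc u) (suc w) e e′)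

  isSubtreeOn-[] : ∀ N vs → length vs ≡ N → isSubtreeOn N [] vs ≡ oneTrue vs
  isSubtreeOn-[] N vs len = bool-ext to from
    where
    <N : ∀ {w} → at vs w ≡ true → w < N
    <N {w} e = subst (w <_) len (at⇒<length vs w e)
    reach-[] : ∀ {u w} → reach N [] u w ≡ true → u ≡ w
    reach-[] {u} {w} r with ∨-elim {u ≡ᵇ w} (reach⇒touches [] N u w r)
    ... | inj₁ e = ≡ᵇ-true⇒≡ u w e
    to : isSubtreeOn N [] vs ≡ true → oneTrue vs ≡ true
    to h with any⁻ (upTo N) (∧-elimˡ h)
    ... | u , _ , vs-u = ⇒oneTrue vs (u , vs-u) λ u′ w′ e e′ →
      reach-[] (allReachable⁻ N [] (at vs) (∧-elimʳ (∧-elimʳ {any (at vs) (upTo N)} h))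
                              (<N e) (<N e′) e e′)
    from : oneTrue vs ≡ true → isSubtreeOn N [] vs ≡ true
    from h with oneTrue⇒ vs h
    ... | (u , vs-u) , unique =
      ∧-intro (any⁺ (∈-upTo⁺ (<N vs-u)) vs-u)
              (∧-intro refl (allReachable⁺ N [] (at vs) λ {u′} {w′} _ _ e e′ →
                subst (λ w → reach N [] u′ w ≡ true) (unique u′ w′ e e′) (reach-refl [] N u′)))

  isSubtreeOn-nonempty : ∀ N S vs {a₀ b₀} → (a₀ , b₀) ∈ S → EdgesBelow N S → length vs ≡ N →
                         isSubtreeOn N S vs ≡ agrees vs (touches S) ∧ isConnected N S
  isSubtreeOn-nonempty N S vs {a₀} e₀ below len = bool-ext to from
    where
    a₀<N : a₀ < N
    a₀<N = proj₁ (below e₀)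
    to : isSubtreeOn N S vs ≡ true → agrees vs (touches S) ∧ isConnected N S ≡ true
    to h = ∧-intro (⇒agrees vs (touches S) λ w w< → bool-ext (touched w (subst (w <_) len w<)) (inVs w))
                   (allReachable⁺ N S (touches S) λ u<N w<N tu tw → allReachable⁻ N S (at vs) reachable u<N w<N (inVs _ tu) (inVs _ tw))
      where
      pairs : all (λ { (u , v) → at vs u ∧ at vs v }) S ≡ true
      pairs = ∧-elimˡ (∧-elimʳ {any (at vs) (upTo N)} h)
      reachable : AllReachable N S (at vs) ≡ true
      reachable = ∧-elimʳ (∧-elimʳ {any (at vs) (upTo N)} h)
      inVs : ∀ w → touches S w ≡ true → at vs w ≡ true
      inVs w t with any⁻ S t
      ... | (a , b) , e , q with ∨-elim {a ≡ᵇ w} q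
      ...   | inj₁ a≡w = subst (λ z → at vs z ≡ true) (≡ᵇ-true⇒≡ a w a≡w) (∧-elimˡ (all⁻ pairs e))
      ...   | inj₂ b≡w = subst (λ z → at vs z ≡ true) (≡ᵇ-true⇒≡ b w b≡w) (∧-elimʳ {at vs a} (all⁻ pairs e))
      touched : ∀ w → w < N → at vs w ≡ true → touches S w ≡ true
      touched w w<N vs-w with ∨-elim {a₀ ≡ᵇ w} (reach⇒touches S N a₀ w
                                (allReachable⁻ N S (at vs) reachable a₀<N w<N (inVs _ (touches-fst e₀)) vs-w))
      ... | inj₁ a₀≡w rewrite sym (≡ᵇ-true⇒≡ a₀ w a₀≡w) = touches-fst e₀
      ... | inj₂ t = t
    from : agrees vs (touches S) ∧ isConnected N S ≡ true → isSubtreeOn N S vs ≡ true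
    from h = ∧-intro (any⁺ (∈-upTo⁺ a₀<N) (trans (agree a₀ a₀<N) (touches-fst e₀)))
                     (∧-intro (all⁺ S λ {(a , b)} e → ∧-intro (trans (agree a (proj₁ (below e))) (touches-fst e))
                                                              (trans (agree b (proj₂ (below e))) (touches-snd e)))
                              (allReachable⁺ N S (at vs) λ u<N w<N vs-u vs-w →
                                allReachable⁻ N S (touches S) (∧-elimʳ {agrees vs (touches S)} h) u<N w<N
                                  (trans (sym (agree _ u<N)) vs-u) (trans (sym (agree _ w<N)) vs-w)))
      where
      agree : ∀ w → w < N → at vs w ≡ touches S w
      agree w w<N = agrees⇒ vs (touches S) (∧-elimˡ h) w (subst (w <_) (sym len) w<N)

  countVertexSets : ℕ → List (ℕ × ℕ) → ℕ
  countVertexSets N S = sumBools N (λ vs → ind (isSubtreeOn N S vs))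

  countVertexSets-[] : ∀ N → countVertexSets N [] ≡ N
  countVertexSets-[] N = trans (sumBools-cong N (λ vs len → cong ind (isSubtreeOn-[] N vs len))) (count-oneTrue N)

  countVertexSets-∷ : ∀ N e S → EdgesBelow N (e ∷ S) → countVertexSets N (e ∷ S) ≡ ind (isConnected N (e ∷ S))
  countVertexSets-∷ N e S below =
    trans (sumBools-cong N (λ vs len → cong ind (isSubtreeOn-nonempty N (e ∷ S) vs (here refl) below len)))
          (by-connectivity (isConnected N (e ∷ S)))
    where
    open import Data.List.Relation.Unary.Any using (here)
    by-connectivity : ∀ c → sumBools N (λ vs → ind (agrees vs (touches (e ∷ S)) ∧ c)) ≡ ind c
    by-connectivity true  = trans (sumBools-cong N (λ vs _ → cong ind (∧-identityʳ _))) (count-agrees N _)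
    by-connectivity false = trans (sumBools-cong N (λ vs _ → cong ind (∧-zeroʳ _))) (sumBools-0 N)

module Automaton where

  open import Data.Bool using (Bool; true; false; _∧_; _∨_; not; if_then_else_)
  open import Data.Bool.ListAction using (or)
  open import Data.Bool.Properties using (not-¬; ¬-not; ∨-identityʳ)
  open import Data.Empty using (⊥-elim)
  open import Data.List using (List; []; _∷_; length)
  open import Data.Nat using (ℕ; zero; suc; _+_; _*_; _≤_; _<_; _≡ᵇ_; _^_; z≤n; s≤s)
  open import Data.Nat.Properties using (+-identityʳ; *-identityˡ; *-identityʳ; *-zeroʳ; *-assoc; ^-distribˡ-+-*; *-commutativeSemigroup)
  open import Algebra.Properties.CommutativeSemigroup *-commutativeSemigroup using (interchange)
  open import Data.Nat.Tactic.RingSolver using (solve-∀)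
  open import Data.Product using (Σ-syntax; _×_; _,_; proj₂)
  open import Relation.Binary.PropositionalEquality
  open Booleans

  #trues : List Bool → ℕ
  #trues []       = 0
  #trues (b ∷ bs) = ind b + #trues bs

  or-false⇒#trues≡0 : ∀ bs → or bs ≡ false → #trues bs ≡ 0
  or-false⇒#trues≡0 []           _ = refl
  or-false⇒#trues≡0 (false ∷ bs) h = or-false⇒#trues≡0 bs h

  #trues≡ᵇ0 : ∀ bs → (#trues bs ≡ᵇ 0) ≡ not (or bs)
  #trues≡ᵇ0 []           = refl
  #trues≡ᵇ0 (true ∷ bs)  = refl
  #trues≡ᵇ0 (false ∷ bs) = #trues≡ᵇ0 bs

  -- A slice describes the selected edges at one spine vertex of a caterpillar: whether the spine
  -- edge to the next spine vertex is selected, and which of its pendant edges are.  The Boolean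
  -- argument `inc` below records whether the spine edge coming from the previous vertex is selected.
  Slice : Set
  Slice = Bool × List Bool

  Config : Set
  Config = List Slice

  headDegree : Bool → Config → ℕ
  headDegree inc []             = 0
  headDegree inc ((s , L) ∷ _) = ind s + ind inc + #trues L

  headTouched : Bool → Config → Bool
  headTouched inc []             = false
  headTouched inc ((s , L) ∷ _) = inc ∨ s ∨ or L

  degreeAt : Bool → Config → ℕ → ℕ
  degreeAt inc cfg            zero    = headDegree inc cfg
  degreeAt inc []             (suc m) = 0
  degreeAt inc ((s , L) ∷ cs) (suc m) = degreeAt s cs m

  touchedAt : Bool → Config → ℕ → Bool
  touchedAt inc cfg            zero    = headTouched inc cfg
  touchedAt inc []             (suc m) = false
  touchedAt inc ((s , L) ∷ cs) (suc m) = touchedAt s cs m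

  spineBitAt : Config → ℕ → Bool
  spineBitAt []             _       = false
  spineBitAt ((s , L) ∷ _)  zero    = s
  spineBitAt (_ ∷ cs)       (suc m) = spineBitAt cs m

  leafBitsAt : Config → ℕ → List Bool
  leafBitsAt []             _       = []
  leafBitsAt ((s , L) ∷ _)  zero    = L
  leafBitsAt (_ ∷ cs)       (suc m) = leafBitsAt cs m

  #edges : Config → ℕ
  #edges []             = 0
  #edges ((s , L) ∷ cs) = ind s + #trues L + #edges cs

  -- Pendant edges always end in a leaf; the spine edge after a vertex does when one of its two
  -- endpoints has degree 1.
  #leafEdges : Bool → Config → ℕ
  #leafEdges inc []             = 0
  #leafEdges inc ((s , L) ∷ cs) =
    #trues L + ind s * ind ((headDegree inc ((s , L) ∷ cs) ≡ᵇ 1) ∨ (headDegree s cs ≡ᵇ 1)) + #leafEdges s cs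

  -- The last vertex has no spine edge after it.
  rightClosed : Config → Bool
  rightClosed []                 = true
  rightClosed ((s , L) ∷ [])     = not s
  rightClosed (_ ∷ cs@(_ ∷ _))   = rightClosed cs

  rightClosed-tail : ∀ x cs → rightClosed (x ∷ cs) ≡ true → rightClosed cs ≡ true
  rightClosed-tail x []       _ = refl
  rightClosed-tail x (_ ∷ cs) h = h

  -- A left-to-right automaton accepting the configurations whose selected edges form a nonempty
  -- subtree.  Inside the subtree, `inside d` remembers whether the last spine vertex had degree 1.
  data Phase : Set where
    before after : Phase
    inside       : Bool → Phase

  next : Phase → Bool → List Bool → Phase
  next before     false L = if or L then after else before
  next before     true  L = inside (not (or L))
  next (inside d) false L = after
  next (inside d) true  L = inside false
  next after      _     _ = after

  allowed : Phase → Bool → List Bool → Bool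
  allowed after s L = not s ∧ not (or L)
  allowed _     _ _ = true

  accepts : Phase → Config → Bool
  accepts before     []             = false
  accepts (inside d) []             = false
  accepts after      []             = true
  accepts ph         ((s , L) ∷ cs) = allowed ph s L ∧ accepts (next ph s L) cs

  record Interval (inc : Bool) (cfg : Config) (i j : ℕ) : Set where
    field
      i≤j        : i ≤ j
      j<length   : j < length cfg
      touched⇒∈  : ∀ m → touchedAt inc cfg m ≡ true → i ≤ m × m ≤ j
      ∈⇒touched  : ∀ m → i ≤ m → m ≤ j → touchedAt inc cfg m ≡ true
      spine      : ∀ t → i ≤ t → t < j → spineBitAt cfg t ≡ true

  accepts-after⇒untouched : ∀ cfg → accepts after cfg ≡ true → ∀ m → touchedAt false cfg m ≡ false
  accepts-after⇒untouched []                 h zero    = refl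
  accepts-after⇒untouched []                 h (suc m) = refl
  accepts-after⇒untouched ((false , L) ∷ cs) h m with or L in eq
  accepts-after⇒untouched ((false , L) ∷ cs) h zero    | false = eq
  accepts-after⇒untouched ((false , L) ∷ cs) h (suc m) | false = accepts-after⇒untouched cs h m

  untouched⇒accepts-after : ∀ cfg → (∀ m → touchedAt false cfg m ≡ false) → accepts after cfg ≡ true
  untouched⇒accepts-after []                 _ = refl
  untouched⇒accepts-after ((true , L) ∷ cs)  h = ⊥-elim (not-¬ refl (h 0))
  untouched⇒accepts-after ((false , L) ∷ cs) h with or L in eq
  ... | true  = ⊥-elim (not-¬ eq (h 0))
  ... | false = untouched⇒accepts-after cs (λ m → h (suc m))

  private
    singleton : ∀ {inc L cs} → headTouched inc ((false , L) ∷ cs) ≡ true → accepts after cs ≡ true →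
                Interval inc ((false , L) ∷ cs) 0 0
    singleton {cs = cs} touched h = record
      { i≤j = z≤n ; j<length = s≤s z≤n
      ; touched⇒∈ = λ { zero _ → z≤n , z≤n ; (suc m) e → ⊥-elim (not-¬ e (accepts-after⇒untouched cs h m)) }
      ; ∈⇒touched = λ { zero _ _ → touched }
      ; spine = λ _ _ () }

    extend : ∀ {inc L cs j} → Interval true cs 0 j → Interval inc ((true , L) ∷ cs) 0 (suc j)
    extend I = record
      { i≤j = z≤n ; j<length = s≤s j<length
      ; touched⇒∈ = λ { zero _ → z≤n , z≤n ; (suc m) e → z≤n , s≤s (proj₂ (touched⇒∈ m e)) }
      ; ∈⇒touched = λ { zero _ _ → ∨-introʳ refl ; (suc m) _ (s≤s m≤j) → ∈⇒touched m z≤n m≤j }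
      ; spine = λ { zero _ _ → refl ; (suc t) _ (s≤s t<j) → spine t z≤n t<j } }
      where open Interval I

    shift : ∀ {L cs i j} → or L ≡ false → Interval false cs i j → Interval false ((false , L) ∷ cs) (suc i) (suc j)
    shift untouched I = record
      { i≤j = s≤s i≤j ; j<length = s≤s j<length
      ; touched⇒∈ = λ { zero    e → ⊥-elim (not-¬ e untouched)
                      ; (suc m) e → let i≤m , m≤j = touched⇒∈ m e in s≤s i≤m , s≤s m≤j }
      ; ∈⇒touched = λ { (suc m) (s≤s i≤m) (s≤s m≤j) → ∈⇒touched m i≤m m≤j }
      ; spine = λ { (suc t) (s≤s i≤t) (s≤s t<j) → spine t i≤t t<j } }
      where open Interval I

  accepts-inside⇒interval : ∀ d cfg → accepts (inside d) cfg ≡ true → Σ[ j ∈ ℕ ] Interval true cfg 0 j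
  accepts-inside⇒interval d ((false , L) ∷ cs) h = 0 , singleton refl h
  accepts-inside⇒interval d ((true  , L) ∷ cs) h =
    let j , I = accepts-inside⇒interval false cs h in suc j , extend I

  accepts⇒interval : ∀ cfg → accepts before cfg ≡ true → Σ[ i ∈ ℕ ] Σ[ j ∈ ℕ ] Interval false cfg i j
  accepts⇒interval ((true , L) ∷ cs) h =
    let j , I = accepts-inside⇒interval (not (or L)) cs h in 0 , suc j , extend I
  accepts⇒interval ((false , L) ∷ cs) h with or L in eq
  ... | true  = 0 , 0 , singleton eq h
  ... | false = let i , j , I = accepts⇒interval cs h in suc i , suc j , shift eq I

  SpineConnected : Bool → Config → Set
  SpineConnected inc cfg = ∀ m m′ t → touchedAt inc cfg m ≡ true → touchedAt inc cfg m′ ≡ true →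
                           m ≤ t → t < m′ → spineBitAt cfg t ≡ true

  private
    connected⇒accepts-inside : ∀ d cfg → rightClosed cfg ≡ true → 0 < length cfg → SpineConnected true cfg →
                               accepts (inside d) cfg ≡ true
    connected⇒accepts-inside d ((false , L) ∷ cs) _ _ conn =
      untouched⇒accepts-after cs λ m → ¬-not λ e → not-¬ (conn 0 (suc m) 0 refl e z≤n (s≤s z≤n)) refl
    connected⇒accepts-inside d ((true , L) ∷ cs@(_ ∷ _)) closed _ conn =
      connected⇒accepts-inside false cs closed (s≤s z≤n)
        λ m m′ t e e′ m≤t t<m′ → conn (suc m) (suc m′) (suc t) e e′ (s≤s m≤t) (s≤s t<m′)

  connected⇒accepts : ∀ cfg → rightClosed cfg ≡ true → Σ[ m ∈ ℕ ] touchedAt false cfg m ≡ true →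
                      SpineConnected false cfg → accepts before cfg ≡ true
  connected⇒accepts [] _ (zero  , ()) _
  connected⇒accepts [] _ (suc _ , ()) _
  connected⇒accepts ((true , L) ∷ cs@(_ ∷ _)) closed _ conn =
    connected⇒accepts-inside (not (or L)) cs closed (s≤s z≤n)
      λ m m′ t e e′ m≤t t<m′ → conn (suc m) (suc m′) (suc t) e e′ (s≤s m≤t) (s≤s t<m′)
  connected⇒accepts ((false , L) ∷ cs) closed touched conn with or L in eq
  ... | true  = untouched⇒accepts-after cs λ m → ¬-not λ e → not-¬ (conn 0 (suc m) 0 eq e z≤n (s≤s z≤n)) refl
  ... | false = connected⇒accepts cs (rightClosed-tail _ cs closed) (tail-touched touched)
                  λ m m′ t e e′ m≤t t<m′ → conn (suc m) (suc m′) (suc t) e e′ (s≤s m≤t) (s≤s t<m′)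
    where
    tail-touched : Σ[ m ∈ ℕ ] touchedAt false ((false , L) ∷ cs) m ≡ true → Σ[ m ∈ ℕ ] touchedAt false cs m ≡ true
    tail-touched (zero  , e) = ⊥-elim (not-¬ e eq)
    tail-touched (suc m , e) = m , e

  module Weights (Q R : ℕ) where

    q : ℕ
    q = Q * R

    leafFactor : Bool → ℕ
    leafFactor true  = R
    leafFactor false = 1

    -- A pendant edge ends in a leaf, so it weighs q = Q R; a spine edge weighs Q, and R more when one
    -- of its ends has degree 1, which is known once the vertex after it has been read.
    stepWeight : Phase → Bool → List Bool → ℕ
    stepWeight before     false L = q ^ #trues L
    stepWeight before     true  L = Q * q ^ #trues L
    stepWeight (inside d) false L = (if or L then leafFactor d else R) * q ^ #trues L
    stepWeight (inside d) true  L = leafFactor d * Q * q ^ #trues L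
    stepWeight after      _     _ = 1

    runWeight : Phase → Config → ℕ
    runWeight ph []             = ind (accepts ph [])
    runWeight ph ((s , L) ∷ cs) = (if allowed ph s L then stepWeight ph s L else 0) * runWeight (next ph s L) cs

    ⟦_,_⟧ : ℕ → ℕ → ℕ
    ⟦ e , l ⟧ = Q ^ e * R ^ l

    ⟦⟧-* : ∀ e l e′ l′ → ⟦ e , l ⟧ * ⟦ e′ , l′ ⟧ ≡ ⟦ e + e′ , l + l′ ⟧
    ⟦⟧-* e l e′ l′ = trans (interchange (Q ^ e) (R ^ l) (Q ^ e′) (R ^ l′))
                           (sym (cong₂ _*_ (^-distribˡ-+-* Q e e′) (^-distribˡ-+-* R l l′)))

    Q≡⟦1,0⟧ : Q ≡ ⟦ 1 , 0 ⟧
    Q≡⟦1,0⟧ = sym (trans (*-identityʳ (Q * 1)) (*-identityʳ Q))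

    R≡⟦0,1⟧ : R ≡ ⟦ 0 , 1 ⟧
    R≡⟦0,1⟧ = sym (trans (*-identityˡ (R * 1)) (*-identityʳ R))

    q≡⟦1,1⟧ : q ≡ ⟦ 1 , 1 ⟧
    q≡⟦1,1⟧ = cong₂ _*_ (sym (*-identityʳ Q)) (sym (*-identityʳ R))

    q^≡⟦⟧ : ∀ p → q ^ p ≡ ⟦ p , p ⟧
    q^≡⟦⟧ zero    = refl
    q^≡⟦⟧ (suc p) = trans (cong₂ _*_ q≡⟦1,1⟧ (q^≡⟦⟧ p)) (⟦⟧-* 1 1 p p)

    Q*q^≡⟦⟧ : ∀ p → Q * q ^ p ≡ ⟦ 1 + p , p ⟧
    Q*q^≡⟦⟧ p = trans (cong₂ _*_ Q≡⟦1,0⟧ (q^≡⟦⟧ p)) (⟦⟧-* 1 0 p p)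

    leafFactor-* : ∀ d e l → leafFactor d * ⟦ e , l ⟧ ≡ ⟦ e , ind d + l ⟧
    leafFactor-* true  e l = trans (cong (_* ⟦ e , l ⟧) R≡⟦0,1⟧) (⟦⟧-* 0 1 e l)
    leafFactor-* false e l = +-identityʳ _

    leafEdgesFrom : Phase → Config → ℕ
    leafEdgesFrom before     cfg = #leafEdges false cfg
    leafEdgesFrom (inside d) cfg = ind (d ∨ (headDegree true cfg ≡ᵇ 1)) + #leafEdges true cfg
    leafEdgesFrom after      cfg = 0

    accepts-after⇒empty : ∀ cfg → accepts after cfg ≡ true →
                          #edges cfg ≡ 0 × #leafEdges false cfg ≡ 0 × runWeight after cfg ≡ 1
    accepts-after⇒empty []                 h = refl , refl , refl
    accepts-after⇒empty ((false , L) ∷ cs) h with or L in eq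
    ... | false = let e≡0 , l≡0 , w≡1 = accepts-after⇒empty cs h
                      L≡0 = or-false⇒#trues≡0 L eq
                  in cong₂ _+_ L≡0 e≡0 , cong₂ _+_ (trans (+-identityʳ _) L≡0) l≡0 , trans (+-identityʳ _) w≡1

    private
      combine : ∀ e₁ l₁ e₂ l₂ {w X E Λ} → w ≡ ⟦ e₁ , l₁ ⟧ → X ≡ ⟦ e₂ , l₂ ⟧ →
                e₁ + e₂ ≡ E → l₁ + l₂ ≡ Λ → w * X ≡ ⟦ E , Λ ⟧
      combine e₁ l₁ e₂ l₂ refl refl refl refl = ⟦⟧-* e₁ l₁ e₂ l₂

    runWeight-accepts : ∀ ph cfg → accepts ph cfg ≡ true → runWeight ph cfg ≡ ⟦ #edges cfg , leafEdgesFrom ph cfg ⟧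
    runWeight-accepts after cfg h =
      let e≡0 , _ , w≡1 = accepts-after⇒empty cfg h in trans w≡1 (cong ⟦_, 0 ⟧ (sym e≡0))
    runWeight-accepts before ((false , L) ∷ cs) h with or L in eq
    ... | false = combine (#trues L) (#trues L) _ _ (q^≡⟦⟧ (#trues L)) (runWeight-accepts before cs h) refl
                          (cong (_+ #leafEdges false cs) (sym (+-identityʳ (#trues L))))
    ... | true  = let e≡0 , l≡0 , w≡1 = accepts-after⇒empty cs h in
                  combine (#trues L) (#trues L) 0 0 (q^≡⟦⟧ (#trues L)) w≡1 (cong (#trues L +_) (sym e≡0))
                          (sym (trans (cong (#trues L + 0 +_) l≡0) (+-identityʳ _)))
    runWeight-accepts before ((true , L) ∷ cs) h =
      combine (1 + #trues L) (#trues L) _ _ (Q*q^≡⟦⟧ (#trues L))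
              (runWeight-accepts (inside (not (or L))) cs h) refl
              (trans (rearrange (#trues L) _ _)
                     (cong (λ b → #trues L + 1 * ind (b ∨ (headDegree true cs ≡ᵇ 1)) + #leafEdges true cs) (sym (#trues≡ᵇ0 L))))
      where
      rearrange : ∀ a b c → a + (b + c) ≡ a + 1 * b + c
      rearrange = solve-∀
    runWeight-accepts (inside d) ((false , L) ∷ cs) h =
      let e≡0 , l≡0 , w≡1 = accepts-after⇒empty cs h in
      combine (#trues L) (ind (d ∨ not (or L)) + #trues L) 0 0
              (trans (cong₂ _*_ (endFactor d (or L)) (q^≡⟦⟧ (#trues L))) (leafFactor-* (d ∨ not (or L)) (#trues L) (#trues L)))
              w≡1 (cong (#trues L +_) (sym e≡0))
              (trans (rearrange (ind (d ∨ not (or L))) (#trues L))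
                     (cong₂ (λ b l → ind (d ∨ b) + (#trues L + 0 + l)) (sym (#trues≡ᵇ0 L)) (sym l≡0)))
      where
      rearrange : ∀ a b → a + b + 0 ≡ a + (b + 0 + 0)
      rearrange = solve-∀
      endFactor : ∀ d o → (if o then leafFactor d else R) ≡ leafFactor (d ∨ not o)
      endFactor true  true  = refl
      endFactor false true  = refl
      endFactor true  false = refl
      endFactor false false = refl
    runWeight-accepts (inside d) ((true , L) ∷ cs) h =
      combine (1 + #trues L) (ind d + #trues L) _ _
              (trans (*-assoc (leafFactor d) Q _)
                     (trans (cong (leafFactor d *_) (Q*q^≡⟦⟧ (#trues L))) (leafFactor-* d (1 + #trues L) (#trues L))))
              (runWeight-accepts (inside false) cs h) refl
              (trans (rearrange (ind d) (#trues L) _ _) (cong (λ b → ind b + _) (sym (∨-identityʳ d))))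
      where
      rearrange : ∀ a b c e → a + b + (c + e) ≡ a + (b + 1 * c + e)
      rearrange = solve-∀

    runWeight-rejects : ∀ ph cfg → accepts ph cfg ≡ false → runWeight ph cfg ≡ 0
    runWeight-rejects before     []             _ = refl
    runWeight-rejects (inside d) []             _ = refl
    runWeight-rejects before     ((s , L) ∷ cs) h =
      trans (cong (stepWeight before s L *_) (runWeight-rejects (next before s L) cs h)) (*-zeroʳ (stepWeight before s L))
    runWeight-rejects (inside d) ((s , L) ∷ cs) h =
      trans (cong (stepWeight (inside d) s L *_) (runWeight-rejects (next (inside d) s L) cs h)) (*-zeroʳ (stepWeight (inside d) s L))
    runWeight-rejects after      ((s , L) ∷ cs) h with not s ∧ not (or L)
    ... | false = refl
    ... | true  = cong (_+ 0) (runWeight-rejects after cs h)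

    runWeight≡ : ∀ ph cfg → runWeight ph cfg ≡ ind (accepts ph cfg) * ⟦ #edges cfg , leafEdgesFrom ph cfg ⟧
    runWeight≡ ph cfg with accepts ph cfg in acc
    ... | true  = trans (runWeight-accepts ph cfg acc) (sym (+-identityʳ _))
    ... | false = runWeight-rejects ph cfg acc

module TransferSums where

  open import Data.Bool using (Bool; true; false; if_then_else_)
  open import Data.Bool.ListAction using (or)
  open import Data.List using (List; []; _∷_; _++_; map; length; take; drop)
  open import Data.Nat using (ℕ; zero; suc; _+_; _*_; _∸_; _^_)
  open import Data.Nat.ListAction using (sum)
  open import Data.Product using (_,_)
  open import Data.Nat.Properties using (+-identityʳ; *-identityʳ; *-zeroʳ; *-comm; suc-injective)
  open import Data.Nat.Tactic.RingSolver using (solve-∀)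
  open import Relation.Binary.PropositionalEquality
  open ≡-Reasoning
  open import Defs using (at)
  open Booleans
  open Sums
  open Automaton

  #pendants : List ℕ → ℕ
  #pendants cs = sum (map (λ c → c ∸ 1) cs)

  toConfig : List ℕ → List Bool → List Bool → Config
  toConfig []       sp lf = []
  toConfig (c ∷ cs) sp lf = (at sp 0 , take (c ∸ 1) lf) ∷ toConfig cs (drop 1 sp) (drop (c ∸ 1) lf)

  take-++ : ∀ {A : Set} (xs ys : List A) n → length xs ≡ n → take n (xs ++ ys) ≡ xs
  take-++ []       ys zero    _  = refl
  take-++ (x ∷ xs) ys (suc n) eq = cong (x ∷_) (take-++ xs ys n (suc-injective eq))

  drop-++ : ∀ {A : Set} (xs ys : List A) n → length xs ≡ n → drop n (xs ++ ys) ≡ ys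
  drop-++ []       ys zero    _  = refl
  drop-++ (x ∷ xs) ys (suc n) eq = drop-++ xs ys n (suc-injective eq)

  module Evaluation (Q R : ℕ) where
    open Weights Q R

    y : ℕ
    y = 1 + q

    allPendants somePendants : ℕ → ℕ
    allPendants  c = y ^ (c ∸ 1)
    somePendants c = sumBools (c ∸ 1) (λ L → if or L then q ^ #trues L else 0)

    sumBools-q^ : ∀ d → sumBools d (λ L → q ^ #trues L) ≡ y ^ d
    sumBools-q^ zero    = refl
    sumBools-q^ (suc d) = begin
      sumBools (suc d) (λ L → q ^ #trues L)                                         ≡⟨ sumBools-suc d _ ⟩
      sumBools d (λ L → q ^ #trues L + q * q ^ #trues L)                            ≡⟨ sumBools-+ d _ _ ⟩
      sumBools d (λ L → q ^ #trues L) + sumBools d (λ L → q * q ^ #trues L)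
        ≡⟨ cong (sumBools d (λ L → q ^ #trues L) +_) (sumBools-*ˡ d q _) ⟩
      sumBools d (λ L → q ^ #trues L) + q * sumBools d (λ L → q ^ #trues L)
        ≡⟨ cong₂ (λ s t → s + q * t) (sumBools-q^ d) (sumBools-q^ d) ⟩
      y ^ d + q * y ^ d                                                             ∎

    sumBools-if-none : ∀ d Y → sumBools d (λ L → if or L then 0 else Y) ≡ Y
    sumBools-if-none zero    Y = +-identityʳ Y
    sumBools-if-none (suc d) Y = trans (sumBools-suc d _)
                                       (trans (sumBools-cong d (λ L _ → +-identityʳ _)) (sumBools-if-none d Y))

    sumBools-if-or : ∀ d X Y → sumBools d (λ L → if or L then q ^ #trues L * X else Y)
                             ≡ sumBools d (λ L → if or L then q ^ #trues L else 0) * X + Y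
    sumBools-if-or d X Y = begin
      sumBools d (λ L → if or L then q ^ #trues L * X else Y)
        ≡⟨ sumBools-cong d (λ L _ → split (or L) (q ^ #trues L)) ⟩
      sumBools d (λ L → (if or L then q ^ #trues L else 0) * X + (if or L then 0 else Y))
        ≡⟨ sumBools-+ d _ _ ⟩
      sumBools d (λ L → (if or L then q ^ #trues L else 0) * X) + sumBools d (λ L → if or L then 0 else Y)
        ≡⟨ cong₂ _+_ (sumBools-*ʳ d _ X) (sumBools-if-none d Y) ⟩
      sumBools d (λ L → if or L then q ^ #trues L else 0) * X + Y ∎
      where
      split : ∀ o a → (if o then a * X else Y) ≡ (if o then a else 0) * X + (if o then 0 else Y)
      split true  a = sym (+-identityʳ _)
      split false a = refl

    allPendants≡somePendants+1 : ∀ c → allPendants c ≡ somePendants c + 1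
    allPendants≡somePendants+1 c = begin
      y ^ (c ∸ 1)                                                      ≡⟨ sumBools-q^ (c ∸ 1) ⟨
      sumBools (c ∸ 1) (λ L → q ^ #trues L)                            ≡⟨ sumBools-cong (c ∸ 1) (λ L _ → by-or L) ⟩
      sumBools (c ∸ 1) (λ L → if or L then q ^ #trues L * 1 else 1)    ≡⟨ sumBools-if-or (c ∸ 1) 1 1 ⟩
      somePendants c * 1 + 1                                           ≡⟨ cong (_+ 1) (*-identityʳ _) ⟩
      somePendants c + 1                                               ∎
      where
      by-or : ∀ L → q ^ #trues L ≡ (if or L then q ^ #trues L * 1 else 1)
      by-or L with or L in eq
      ... | true  = sym (*-identityʳ _)
      ... | false = cong (q ^_) (or-false⇒#trues≡0 L eq)

    allowedWeight : Phase → Bool → List Bool → ℕ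
    allowedWeight ph s L = if allowed ph s L then stepWeight ph s L else 0

    weightSum : Phase → List ℕ → ℕ
    weightSum ph cs = sumBools (length cs ∸ 1) λ sp → sumBools (#pendants cs) λ lf → runWeight ph (toConfig cs sp lf)

    sliceSum : Phase → Bool → ℕ → List ℕ → ℕ
    sliceSum ph s c cs = sumBools (c ∸ 1) λ L → allowedWeight ph s L * weightSum (next ph s L) cs

    private
      peel : ∀ ph s c cs sp →
        sumBools (#pendants (c ∷ cs)) (λ lf → runWeight ph (toConfig (c ∷ cs) (s ∷ sp) lf))
        ≡ sumBools (c ∸ 1) λ L → allowedWeight ph s L * sumBools (#pendants cs) λ lf → runWeight (next ph s L) (toConfig cs sp lf)
      peel ph s c cs sp = trans (sumBools-++ (c ∸ 1) (#pendants cs) _) (sumBools-cong (c ∸ 1) λ L len →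
        trans (sumBools-cong (#pendants cs) λ lf _ →
                 cong₂ (λ L′ lf′ → allowedWeight ph s L′ * runWeight (next ph s L′) (toConfig cs sp lf′))
                       (take-++ L lf (c ∸ 1) len) (drop-++ L lf (c ∸ 1) len))
              (sumBools-*ˡ (#pendants cs) (allowedWeight ph s L) _))

    weightSum-∷ : ∀ ph c cs → weightSum ph (c ∷ cs) ≡ sliceSum ph false c cs + sliceSum ph true c cs
    weightSum-∷ ph c cs@(_ ∷ cs′) = begin
      sumBools (suc (length cs′)) W                                   ≡⟨ sumBools-suc (length cs′) W ⟩
      sumBools (length cs′) (λ sp → W (false ∷ sp) + W (true ∷ sp))   ≡⟨ sumBools-+ (length cs′) _ _ ⟩
      sumBools (length cs′) (λ sp → W (false ∷ sp)) + sumBools (length cs′) (λ sp → W (true ∷ sp))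
        ≡⟨ cong₂ _+_ (first-spine-bit false) (first-spine-bit true) ⟩
      sliceSum ph false c cs + sliceSum ph true c cs                  ∎
      where
      W = λ sp → sumBools (#pendants (c ∷ cs)) λ lf → runWeight ph (toConfig (c ∷ cs) sp lf)
      first-spine-bit : ∀ s → sumBools (length cs′) (λ sp → W (s ∷ sp)) ≡ sliceSum ph s c cs
      first-spine-bit s = begin
        sumBools (length cs′) (λ sp → W (s ∷ sp))
          ≡⟨ sumBools-cong (length cs′) (λ sp _ → peel ph s c cs sp) ⟩
        sumBools (length cs′) (λ sp → sumBools (c ∸ 1) λ L → allowedWeight ph s L * _)
          ≡⟨ sumBools-swap (length cs′) (c ∸ 1) _ ⟩
        sumBools (c ∸ 1) (λ L → sumBools (length cs′) λ sp → allowedWeight ph s L * _)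
          ≡⟨ sumBools-cong (c ∸ 1) (λ L _ → sumBools-*ˡ (length cs′) (allowedWeight ph s L) _) ⟩
        sliceSum ph s c cs ∎
    weightSum-∷ ph c [] = begin
      sumBools (c ∸ 1 + 0) (λ lf → runWeight ph (toConfig (c ∷ []) [] lf)) + 0   ≡⟨ +-identityʳ _ ⟩
      sumBools (c ∸ 1 + 0) (λ lf → runWeight ph (toConfig (c ∷ []) [] lf))       ≡⟨ peel ph false c [] [] ⟩
      sumBools (c ∸ 1) (λ L → allowedWeight ph false L * (runWeight (next ph false L) [] + 0))
        ≡⟨ sumBools-cong (c ∸ 1) (λ L _ → cong (allowedWeight ph false L *_) (sym (+-identityʳ _))) ⟩
      sliceSum ph false c []                                                     ≡⟨ +-identityʳ _ ⟨
      sliceSum ph false c [] + 0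
        ≡⟨ cong (sliceSum ph false c [] +_) (no-spine-edge ph) ⟨
      sliceSum ph false c [] + sliceSum ph true c []                             ∎
      where
      no-spine-edge : ∀ ph → sliceSum ph true c [] ≡ 0
      no-spine-edge before     = trans (sumBools-cong (c ∸ 1) λ L _ → *-zeroʳ (allowedWeight before true L)) (sumBools-0 (c ∸ 1))
      no-spine-edge (inside d) = trans (sumBools-cong (c ∸ 1) λ L _ → *-zeroʳ (allowedWeight (inside d) true L)) (sumBools-0 (c ∸ 1))
      no-spine-edge after      = sumBools-0 (c ∸ 1)

    openSum : Bool → List ℕ → ℕ
    openSum d []       = 0
    openSum d (c ∷ cs) = somePendants c * leafFactor d + R + allPendants c * leafFactor d * Q * openSum false cs

    subtreeSum⁺ : List ℕ → ℕ
    subtreeSum⁺ []       = 0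
    subtreeSum⁺ (c ∷ cs) = subtreeSum⁺ cs + somePendants c + Q * openSum true cs + Q * somePendants c * openSum false cs

    weightSum-after : ∀ cs → weightSum after cs ≡ 1
    weightSum-after []       = refl
    weightSum-after (c ∷ cs) = begin
      weightSum after (c ∷ cs)                                          ≡⟨ weightSum-∷ after c cs ⟩
      sliceSum after false c cs + sumBools (c ∸ 1) (λ _ → 0)
        ≡⟨ cong₂ _+_ (sumBools-cong (c ∸ 1) λ L _ → by-or L)
                                                                                     (sumBools-0 (c ∸ 1)) ⟩
      sumBools (c ∸ 1) (λ L → if or L then 0 else 1) + 0                ≡⟨ cong (_+ 0) (sumBools-if-none (c ∸ 1) 1) ⟩
      1                                                                 ∎
      where
      by-or : ∀ L → allowedWeight after false L * weightSum after cs ≡ (if or L then 0 else 1)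
      by-or L rewrite weightSum-after cs with or L
      ... | true  = refl
      ... | false = refl

    weightSum-inside : ∀ d cs → weightSum (inside d) cs ≡ openSum d cs
    weightSum-inside d []       = refl
    weightSum-inside d (c ∷ cs) = begin
      weightSum (inside d) (c ∷ cs)                                     ≡⟨ weightSum-∷ (inside d) c cs ⟩
      sliceSum (inside d) false c cs + sliceSum (inside d) true c cs
        ≡⟨ cong₂ _+_ (trans (sumBools-cong (c ∸ 1) λ L _ → ends L) (sumBools-if-or (c ∸ 1) _ _))
                     (trans (sumBools-cong (c ∸ 1) λ L _ → continues L) (sumBools-if-or (c ∸ 1) _ _)) ⟩
      A * leafFactor d + R + (A * (leafFactor d * Q * o) + leafFactor d * Q * o)
        ≡⟨ regroup A (leafFactor d) R Q o ⟩
      A * leafFactor d + R + (A + 1) * leafFactor d * Q * o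
        ≡⟨ cong (λ Y → A * leafFactor d + R + Y * leafFactor d * Q * o) (sym (allPendants≡somePendants+1 c)) ⟩
      openSum d (c ∷ cs)                                                ∎
      where
      A = somePendants c
      o = openSum false cs
      regroup : ∀ a f r Q o → a * f + r + (a * (f * Q * o) + f * Q * o) ≡ a * f + r + (a + 1) * f * Q * o
      regroup = solve-∀
      ends : ∀ L → allowedWeight (inside d) false L * weightSum after cs ≡ (if or L then q ^ #trues L * leafFactor d else R)
      ends L rewrite weightSum-after cs with or L in eq
      ... | true  = trans (*-identityʳ _) (*-comm (leafFactor d) _)
      ... | false = trans (*-identityʳ _) (trans (cong (λ n → R * q ^ n) (or-false⇒#trues≡0 L eq)) (*-identityʳ R))
      continues : ∀ L → allowedWeight (inside d) true L * weightSum (inside false) cs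
                        ≡ (if or L then q ^ #trues L * (leafFactor d * Q * o) else leafFactor d * Q * o)
      continues L rewrite weightSum-inside false cs with or L in eq
      ... | true  = shuffle (leafFactor d) Q (q ^ #trues L) o
        where
        shuffle : ∀ f Q x o → f * Q * x * o ≡ x * (f * Q * o)
        shuffle = solve-∀
      ... | false = trans (cong (λ n → leafFactor d * Q * q ^ n * o) (or-false⇒#trues≡0 L eq))
                          (cong (_* o) (*-identityʳ (leafFactor d * Q)))

    weightSum-before : ∀ cs → weightSum before cs ≡ subtreeSum⁺ cs
    weightSum-before []       = refl
    weightSum-before (c ∷ cs) = begin
      weightSum before (c ∷ cs)                                         ≡⟨ weightSum-∷ before c cs ⟩
      sliceSum before false c cs + sliceSum before true c cs
        ≡⟨ cong₂ _+_ (trans (sumBools-cong (c ∸ 1) λ L _ → starts-or-skips L) (sumBools-if-or (c ∸ 1) _ _))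
                     (trans (sumBools-cong (c ∸ 1) λ L _ → opens L) (sumBools-if-or (c ∸ 1) _ _)) ⟩
      A * 1 + weightSum before cs + (A * (Q * openSum false cs) + Q * openSum true cs)
        ≡⟨ cong (λ b → A * 1 + b + (A * (Q * openSum false cs) + Q * openSum true cs)) (weightSum-before cs) ⟩
      A * 1 + subtreeSum⁺ cs + (A * (Q * openSum false cs) + Q * openSum true cs)
        ≡⟨ regroup A (subtreeSum⁺ cs) Q (openSum false cs) (openSum true cs) ⟩
      subtreeSum⁺ (c ∷ cs)                                              ∎
      where
      A = somePendants c
      regroup : ∀ a b Q o o′ → a * 1 + b + (a * (Q * o) + Q * o′) ≡ b + a + Q * o′ + Q * a * o
      regroup = solve-∀
      starts-or-skips : ∀ L → allowedWeight before false L * weightSum (next before false L) cs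
                              ≡ (if or L then q ^ #trues L * 1 else weightSum before cs)
      starts-or-skips L with or L in eq
      ... | true  = cong (q ^ #trues L *_) (weightSum-after cs)
      ... | false = trans (cong (λ n → q ^ n * weightSum before cs) (or-false⇒#trues≡0 L eq)) (+-identityʳ _)
      opens : ∀ L → allowedWeight before true L * weightSum (next before true L) cs
                    ≡ (if or L then q ^ #trues L * (Q * openSum false cs) else Q * openSum true cs)
      opens L with or L in eq
      ... | true  = trans (cong (Q * q ^ #trues L *_) (weightSum-inside false cs)) (shuffle Q (q ^ #trues L) _)
        where
        shuffle : ∀ Q x o → Q * x * o ≡ x * (Q * o)
        shuffle = solve-∀
      ... | false = trans (cong₂ (λ n w → Q * q ^ n * w) (or-false⇒#trues≡0 L eq) (weightSum-inside true cs))
                          (cong (_* openSum true cs) (*-identityʳ Q))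

module SelectedEdges where

  open import Data.Bool using (Bool; true; false; _∧_; _∨_; not)
  open import Data.Bool.ListAction using (all; or)
  open import Data.Bool.Properties using (not-¬; ∨-identityʳ; ∨-zeroʳ; not-involutive)
  open import Data.Empty using (⊥-elim)
  open import Data.List using (List; []; _∷_; _++_; map; length; upTo; applyUpTo; take; drop; null)
  open import Data.List.Membership.Propositional using (_∈_)
  open import Data.List.Membership.Propositional.Properties using (∈-++⁻; ∈-++⁺ˡ)
  open import Data.List.Properties using (length-map; length-drop; length-take; length-++; length-upTo; take++drop≡id)
  open import Data.List.Relation.Unary.Any using (here; there)
  open import Data.Nat using (ℕ; zero; suc; _+_; _*_; _∸_; _≤_; _<_; _≡ᵇ_; _≤ᵇ_; z≤n; s≤s; z<s)
  open import Data.Nat.ListAction using (sum)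
  open import Data.Nat.Properties
  open import Algebra.Properties.CommutativeSemigroup +-commutativeSemigroup using (x∙yz≈y∙xz; interchange)
  open import Data.Product using (Σ-syntax; _×_; _,_; proj₁; proj₂)
  open import Data.Sum using (_⊎_; inj₁; inj₂)
  open import Function using (_∘_; id)
  open import Relation.Binary.PropositionalEquality
  open import Relation.Nullary using (yes; no)
  open import Defs
  open Booleans
  open Sums
  open Reachability
  open VertexSets using (isConnected; EdgesBelow; allReachable⁻; allReachable⁺)
  open Automaton
  open TransferSums using (#pendants; toConfig)

  -- The selected edges of a configuration, numbered as in `Cat`: spine vertices from `i`, the
  -- pendant vertices of the first slice from `f`.
  spineEdges : ℕ → Config → List (ℕ × ℕ)
  spineEdges i []                  = []
  spineEdges i ((true  , L) ∷ cfg) = (i , suc i) ∷ spineEdges (suc i) cfg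
  spineEdges i ((false , L) ∷ cfg) = spineEdges (suc i) cfg

  pendantBlock : ℕ → ℕ → List Bool → List (ℕ × ℕ)
  pendantBlock i f []          = []
  pendantBlock i f (true  ∷ L) = (i , f) ∷ pendantBlock i (suc f) L
  pendantBlock i f (false ∷ L) = pendantBlock i (suc f) L

  pendantEdges : ℕ → ℕ → Config → List (ℕ × ℕ)
  pendantEdges i f []             = []
  pendantEdges i f ((s , L) ∷ cfg) = pendantBlock i f L ++ pendantEdges (suc i) (f + length L) cfg

  selEdges-++ : ∀ (xs ys : List (ℕ × ℕ)) bs bs′ → length bs ≡ length xs →
                selEdges (xs ++ ys) (bs ++ bs′) ≡ selEdges xs bs ++ selEdges ys bs′
  selEdges-++ []       ys []           bs′ _   = refl
  selEdges-++ (x ∷ xs) ys (true  ∷ bs) bs′ len = cong (x ∷_) (selEdges-++ xs ys bs bs′ (suc-injective len))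
  selEdges-++ (x ∷ xs) ys (false ∷ bs) bs′ len = selEdges-++ xs ys bs bs′ (suc-injective len)

  length-take-≤ : ∀ {A : Set} n (xs : List A) → n ≤ length xs → length (take n xs) ≡ n
  length-take-≤ n xs n≤ = trans (length-take n xs) (m≤n⇒m⊓n≡m n≤)

  private
    length-map-upTo : ∀ {A : Set} (f : ℕ → A) n → length (map f (upTo n)) ≡ n
    length-map-upTo f n = trans (length-map f (upTo n)) (length-upTo n)

    -- `upTo` is generalised to `applyUpTo g` with `g` a shift, so that the induction goes through.
    selEdges-spine : ∀ cs sp lf i (g : ℕ → ℕ) → (∀ j → g j ≡ i + j) → length sp ≡ length cs ∸ 1 →
      selEdges (map (λ v → (v , suc v)) (applyUpTo g (length cs ∸ 1))) sp ≡ spineEdges i (toConfig cs sp lf)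
    selEdges-spine []           []           lf i g g≗ _   = refl
    selEdges-spine (c ∷ [])     []           lf i g g≗ _   = refl
    selEdges-spine (c ∷ c′ ∷ cs) (true ∷ sp) lf i g g≗ len =
      cong₂ _∷_ (cong (λ v → (v , suc v)) (trans (g≗ 0) (+-identityʳ i)))
                (selEdges-spine (c′ ∷ cs) sp (drop (c ∸ 1) lf) (suc i) (g ∘ suc)
                                (λ j → trans (g≗ (suc j)) (+-suc i j)) (suc-injective len))
    selEdges-spine (c ∷ c′ ∷ cs) (false ∷ sp) lf i g g≗ len =
      selEdges-spine (c′ ∷ cs) sp (drop (c ∸ 1) lf) (suc i) (g ∘ suc) (λ j → trans (g≗ (suc j)) (+-suc i j)) (suc-injective len)

    selEdges-block : ∀ i f f′ (g : ℕ → ℕ) n L → (∀ j → f + g j ≡ f′ + j) → length L ≡ n →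
      selEdges (map (λ j → (i , f + j)) (applyUpTo g n)) L ≡ pendantBlock i f′ L
    selEdges-block i f f′ g zero    []          g≗ _   = refl
    selEdges-block i f f′ g (suc n) (true ∷ L)  g≗ len =
      cong₂ _∷_ (cong (i ,_) (trans (g≗ 0) (+-identityʳ f′)))
                (selEdges-block i f (suc f′) (g ∘ suc) n L (λ j → trans (g≗ (suc j)) (+-suc f′ j)) (suc-injective len))
    selEdges-block i f f′ g (suc n) (false ∷ L) g≗ len =
      selEdges-block i f (suc f′) (g ∘ suc) n L (λ j → trans (g≗ (suc j)) (+-suc f′ j)) (suc-injective len)

    selEdges-pendants : ∀ cs sp lf i f → length lf ≡ #pendants cs →
                        selEdges (catLeafEdges i f cs) lf ≡ pendantEdges i f (toConfig cs sp lf)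
    selEdges-pendants []       sp lf i f _   = refl
    selEdges-pendants (c ∷ cs) sp lf i f len = begin
      selEdges (block ++ rest) lf
        ≡⟨ cong (selEdges (block ++ rest)) (take++drop≡id d lf) ⟨
      selEdges (block ++ rest) (take d lf ++ drop d lf)                 ≡⟨ selEdges-++ block rest (take d lf) (drop d lf)
                                                                             (trans len-take (sym (length-map-upTo _ d))) ⟩
      selEdges block (take d lf) ++ selEdges rest (drop d lf)
        ≡⟨ cong₂ _++_ (selEdges-block i f f id d (take d lf) (λ _ → refl) len-take)
                      (trans (selEdges-pendants cs (drop 1 sp) (drop d lf) (suc i) (f + d) len-drop)
                             (cong (λ n → pendantEdges (suc i) (f + n) (toConfig cs (drop 1 sp) (drop d lf))) (sym len-take))) ⟩
      pendantBlock i f (take d lf) ++ pendantEdges (suc i) (f + length (take d lf)) (toConfig cs (drop 1 sp) (drop d lf)) ∎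
      where
      open ≡-Reasoning
      d     = c ∸ 1
      block = map (λ j → (i , f + j)) (upTo d)
      rest  = catLeafEdges (suc i) (f + d) cs
      len-take : length (take d lf) ≡ d
      len-take = length-take-≤ d lf (subst (d ≤_) (sym len) (m≤m+n d (#pendants cs)))
      len-drop : length (drop d lf) ≡ #pendants cs
      len-drop = trans (length-drop d lf) (trans (cong (_∸ d) len) (m+n∸m≡n d (#pendants cs)))

  selEdges-Cat : ∀ cs sp lf → length sp ≡ length cs ∸ 1 → length lf ≡ #pendants cs →
    selEdges (edges (Cat cs)) (sp ++ lf) ≡ spineEdges 0 (toConfig cs sp lf) ++ pendantEdges 0 (length cs) (toConfig cs sp lf)
  selEdges-Cat cs sp lf len-sp len-lf =
    trans (selEdges-++ spine (catLeafEdges 0 (length cs) cs) sp lf (trans len-sp (sym (length-map-upTo _ _))))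
          (cong₂ _++_ (selEdges-spine cs sp lf 0 id (λ _ → refl) len-sp) (selEdges-pendants cs sp lf 0 (length cs) len-lf))
    where
    spine = map (λ v → (v , suc v)) (upTo (length cs ∸ 1))

  length-edges-Cat : ∀ cs → length (edges (Cat cs)) ≡ (length cs ∸ 1) + #pendants cs
  length-edges-Cat cs = trans (length-++ (map (λ v → (v , suc v)) (upTo (length cs ∸ 1))))
                              (cong₂ _+_ (length-map-upTo _ _) (length-leaves 0 (length cs) cs))
    where
    length-leaves : ∀ i f cs → length (catLeafEdges i f cs) ≡ #pendants cs
    length-leaves i f []       = refl
    length-leaves i f (c ∷ cs) = trans (length-++ (map (λ j → (i , f + j)) (upTo (c ∸ 1))))
                                       (cong₂ _+_ (length-map-upTo _ _) (length-leaves (suc i) (f + (c ∸ 1)) cs))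

  toConfig-rightClosed : ∀ cs sp lf → length sp ≡ length cs ∸ 1 → rightClosed (toConfig cs sp lf) ≡ true
  toConfig-rightClosed []           sp       lf _   = refl
  toConfig-rightClosed (c ∷ [])     []       lf _   = refl
  toConfig-rightClosed (c ∷ c′ ∷ cs) (_ ∷ sp) lf len = toConfig-rightClosed (c′ ∷ cs) sp (drop (c ∸ 1) lf) (suc-injective len)

  length-toConfig : ∀ cs sp lf → length (toConfig cs sp lf) ≡ length cs
  length-toConfig []       sp lf = refl
  length-toConfig (c ∷ cs) sp lf = cong suc (length-toConfig cs (drop 1 sp) (drop (c ∸ 1) lf))

  incomingAt : Bool → Config → ℕ → Bool
  incomingAt inc cfg             zero    = inc
  incomingAt inc []              (suc m) = false
  incomingAt inc ((s , L) ∷ cfg) (suc m) = incomingAt s cfg m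

  incomingAt-true : ∀ cfg m → ind (incomingAt true cfg m) ≡ ind (m ≡ᵇ 0) + ind (incomingAt false cfg m)
  incomingAt-true cfg             zero    = refl
  incomingAt-true []              (suc m) = refl
  incomingAt-true ((s , L) ∷ cfg) (suc m) = refl

  degreeAt-slice : ∀ inc cfg m → m < length cfg →
                   degreeAt inc cfg m ≡ ind (spineBitAt cfg m) + ind (incomingAt inc cfg m) + #trues (leafBitsAt cfg m)
  degreeAt-slice inc ((s , L) ∷ cfg) zero    _         = refl
  degreeAt-slice inc ((s , L) ∷ cfg) (suc m) (s≤s m<) = degreeAt-slice s cfg m m<

  offset : ℕ → Config → ℕ → ℕ
  offset f cfg             zero    = f
  offset f []              (suc t) = f
  offset f ((s , L) ∷ cfg) (suc t) = offset (f + length L) cfg t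

  offset-≥ : ∀ f cfg t → f ≤ offset f cfg t
  offset-≥ f cfg             zero    = ≤-refl
  offset-≥ f []              (suc t) = ≤-refl
  offset-≥ f ((s , L) ∷ cfg) (suc t) = ≤-trans (m≤m+n f (length L)) (offset-≥ (f + length L) cfg t)

  offset-mono : ∀ f cfg t t′ → t ≤ t′ → offset f cfg t ≤ offset f cfg t′
  offset-mono f cfg             zero    t′       _         = offset-≥ f cfg t′
  offset-mono f []              (suc t) (suc t′) _         = ≤-refl
  offset-mono f ((s , L) ∷ cfg) (suc t) (suc t′) (s≤s t≤) = offset-mono (f + length L) cfg t t′ t≤

  #slots : Config → ℕ
  #slots []              = 0
  #slots ((s , L) ∷ cfg) = length L + #slots cfg

  offset-≤ : ∀ f cfg t → offset f cfg t ≤ f + #slots cfg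
  offset-≤ f cfg             zero    = m≤m+n f (#slots cfg)
  offset-≤ f []              (suc t) = m≤m+n f 0
  offset-≤ f ((s , L) ∷ cfg) (suc t) =
    subst (offset (f + length L) cfg t ≤_) (+-assoc f (length L) (#slots cfg)) (offset-≤ (f + length L) cfg t)

  #pendantEdges : Config → ℕ
  #pendantEdges []              = 0
  #pendantEdges ((s , L) ∷ cfg) = #trues L + #pendantEdges cfg

  ∈-pendantBlock : ∀ i f L {a b} → (a , b) ∈ pendantBlock i f L → a ≡ i × f ≤ b × b < f + length L
  ∈-pendantBlock i f (true ∷ L) (here refl) = refl , ≤-refl , subst (f <_) (sym (+-suc f (length L))) (s≤s (m≤m+n f (length L)))
  ∈-pendantBlock i f (true ∷ L) {b = b} (there e) with ∈-pendantBlock i (suc f) L e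
  ... | a≡i , f<b , b< = a≡i , <⇒≤ f<b , subst (b <_) (sym (+-suc f (length L))) b<
  ∈-pendantBlock i f (false ∷ L) {b = b} e with ∈-pendantBlock i (suc f) L e
  ... | a≡i , f<b , b< = a≡i , <⇒≤ f<b , subst (b <_) (sym (+-suc f (length L))) b<

  ∈-pendantEdges : ∀ i f cfg {a b} → (a , b) ∈ pendantEdges i f cfg →
    Σ[ t ∈ ℕ ] a ≡ i + t × t < length cfg × offset f cfg t ≤ b × b < offset f cfg (suc t)
  ∈-pendantEdges i f ((s , L) ∷ cfg) e with ∈-++⁻ (pendantBlock i f L) e
  ... | inj₁ e′ = let a≡i , f≤b , b< = ∈-pendantBlock i f L e′ in 0 , trans a≡i (sym (+-identityʳ i)) , s≤s z≤n , f≤b , b<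
  ... | inj₂ e′ with ∈-pendantEdges (suc i) (f + length L) cfg e′
  ...   | t , a≡ , t< , o≤b , b<o = suc t , trans a≡ (sym (+-suc i t)) , s≤s t< , o≤b , b<o

  ∈-spineEdges : ∀ i cfg {a b} → (a , b) ∈ spineEdges i cfg → Σ[ t ∈ ℕ ] a ≡ i + t × b ≡ suc a × spineBitAt cfg t ≡ true
  ∈-spineEdges i ((true , L) ∷ cfg) (here refl) = 0 , sym (+-identityʳ i) , refl , refl
  ∈-spineEdges i ((true , L) ∷ cfg) (there e) with ∈-spineEdges (suc i) cfg e
  ... | t , a≡ , b≡ , s = suc t , trans a≡ (sym (+-suc i t)) , b≡ , s
  ∈-spineEdges i ((false , L) ∷ cfg) e with ∈-spineEdges (suc i) cfg e
  ... | t , a≡ , b≡ , s = suc t , trans a≡ (sym (+-suc i t)) , b≡ , s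

  spineEdges-∈ : ∀ i cfg t → spineBitAt cfg t ≡ true → (i + t , suc (i + t)) ∈ spineEdges i cfg
  spineEdges-∈ i ((true  , L) ∷ cfg) zero    _ rewrite +-identityʳ i = here refl
  spineEdges-∈ i ((true  , L) ∷ cfg) (suc t) h rewrite +-suc i t = there (spineEdges-∈ (suc i) cfg t h)
  spineEdges-∈ i ((false , L) ∷ cfg) (suc t) h rewrite +-suc i t = spineEdges-∈ (suc i) cfg t h

  spineBit⇒<length : ∀ cfg t → rightClosed cfg ≡ true → spineBitAt cfg t ≡ true → suc t < length cfg
  spineBit⇒<length ((true , L) ∷ [])   zero    ()     _
  spineBit⇒<length ((s , L) ∷ [])      (suc t) _      ()
  spineBit⇒<length ((s , L) ∷ _ ∷ _)   zero    _      _ = s≤s (s≤s z≤n)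
  spineBit⇒<length ((s , L) ∷ x ∷ cfg) (suc t) closed h = s≤s (spineBit⇒<length (x ∷ cfg) t closed h)

  incidence : ℕ → ℕ × ℕ → ℕ
  incidence w (u , v) = ind (u ≡ᵇ w) + ind (v ≡ᵇ w)

  deg-++ : ∀ E E′ w → deg (E ++ E′) w ≡ deg E w + deg E′ w
  deg-++ E E′ w = sum-map-++ (incidence w) E E′

  deg-absent : ∀ E v → (∀ {a b} → (a , b) ∈ E → a ≢ v × b ≢ v) → deg E v ≡ 0
  deg-absent []            v _      = refl
  deg-absent ((a , b) ∷ E) v absent
    rewrite ≢⇒≡ᵇ-false a v (proj₁ (absent (here refl))) | ≢⇒≡ᵇ-false b v (proj₂ (absent (here refl))) =
    deg-absent E v (λ e → absent (there e))

  deg-spine-below : ∀ i cfg w → w < i → deg (spineEdges i cfg) w ≡ 0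
  deg-spine-below i cfg w w<i = deg-absent (spineEdges i cfg) w absent
    where
    absent : ∀ {a b} → (a , b) ∈ spineEdges i cfg → a ≢ w × b ≢ w
    absent e with ∈-spineEdges i cfg e
    ... | t , refl , refl , _ = >⇒≢ (≤-trans w<i (m≤m+n i t)) , >⇒≢ (≤-trans w<i (m≤n⇒m≤1+n (m≤m+n i t)))

  deg-spine : ∀ i cfg m → deg (spineEdges i cfg) (i + m) ≡ ind (spineBitAt cfg m) + ind (incomingAt false cfg m)
  deg-spine i []                 zero    = refl
  deg-spine i []                 (suc m) = refl
  deg-spine i ((true , L) ∷ cfg) zero rewrite +-identityʳ i =
    trans (cong₂ (λ x y → ind x + ind y + deg (spineEdges (suc i) cfg) i) (≡ᵇ-refl i) (>⇒≡ᵇ-false (n<1+n i)))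
          (cong suc (deg-spine-below (suc i) cfg i (n<1+n i)))
  deg-spine i ((false , L) ∷ cfg) zero rewrite +-identityʳ i = deg-spine-below (suc i) cfg i (n<1+n i)
  deg-spine i ((true , L) ∷ cfg) (suc m) rewrite +-suc i m | <⇒≡ᵇ-false (s≤s (m≤m+n i m)) | ≡ᵇ-+ i m = begin
    ind (m ≡ᵇ 0) + deg (spineEdges (suc i) cfg) (suc i + m)
      ≡⟨ cong (ind (m ≡ᵇ 0) +_) (deg-spine (suc i) cfg m) ⟩
    ind (m ≡ᵇ 0) + (ind (spineBitAt cfg m) + ind (incomingAt false cfg m))
      ≡⟨ x∙yz≈y∙xz (ind (m ≡ᵇ 0)) (ind (spineBitAt cfg m)) (ind (incomingAt false cfg m)) ⟩
    ind (spineBitAt cfg m) + (ind (m ≡ᵇ 0) + ind (incomingAt false cfg m))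
      ≡⟨ cong (ind (spineBitAt cfg m) +_) (incomingAt-true cfg m) ⟨
    ind (spineBitAt cfg m) + ind (incomingAt true cfg m)                     ∎
    where open ≡-Reasoning
  deg-spine i ((false , L) ∷ cfg) (suc m) rewrite +-suc i m = deg-spine (suc i) cfg m

  deg-spine-above : ∀ i cfg v → rightClosed cfg ≡ true → i + length cfg ≤ v → deg (spineEdges i cfg) v ≡ 0
  deg-spine-above i cfg v closed i+k≤v = deg-absent (spineEdges i cfg) v absent
    where
    absent : ∀ {a b} → (a , b) ∈ spineEdges i cfg → a ≢ v × b ≢ v
    absent e with ∈-spineEdges i cfg e
    ... | t , refl , refl , s = <⇒≢ (<-trans (n<1+n _) b<v) , <⇒≢ b<v
      where
      b<v : suc (i + t) < v
      b<v = <-≤-trans (subst (_< i + length cfg) (+-suc i t) (+-monoʳ-< i (spineBit⇒<length cfg t closed s))) i+k≤v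

  deg-pendantBlock : ∀ i f L w → w < f → deg (pendantBlock i f L) w ≡ ind (i ≡ᵇ w) * #trues L
  deg-pendantBlock i f []          w w<f = sym (*-zeroʳ (ind (i ≡ᵇ w)))
  deg-pendantBlock i f (true ∷ L)  w w<f rewrite >⇒≡ᵇ-false w<f = begin
    ind (i ≡ᵇ w) + 0 + deg (pendantBlock i (suc f) L) w
      ≡⟨ cong₂ _+_ (+-identityʳ _) (deg-pendantBlock i (suc f) L w (m<n⇒m<1+n w<f)) ⟩
    ind (i ≡ᵇ w) + ind (i ≡ᵇ w) * #trues L                ≡⟨ *-suc (ind (i ≡ᵇ w)) (#trues L) ⟨
    ind (i ≡ᵇ w) * suc (#trues L)                         ∎
    where open ≡-Reasoning
  deg-pendantBlock i f (false ∷ L) w w<f = deg-pendantBlock i (suc f) L w (m<n⇒m<1+n w<f)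

  deg-pendants-below : ∀ i f cfg w → w < i → w < f → deg (pendantEdges i f cfg) w ≡ 0
  deg-pendants-below i f cfg w w<i w<f = deg-absent (pendantEdges i f cfg) w absent
    where
    absent : ∀ {a b} → (a , b) ∈ pendantEdges i f cfg → a ≢ w × b ≢ w
    absent e with ∈-pendantEdges i f cfg e
    ... | t , refl , _ , o≤b , _ = >⇒≢ (≤-trans w<i (m≤m+n i t)) , >⇒≢ (≤-trans w<f (≤-trans (offset-≥ f cfg t) o≤b))

  -- The invariant `i + length cfg ≤ f` says that pendant vertices are numbered after all spine vertices.
  deg-pendants : ∀ i f cfg m → i + length cfg ≤ f → m < length cfg → deg (pendantEdges i f cfg) (i + m) ≡ #trues (leafBitsAt cfg m)
  deg-pendants i f ((s , L) ∷ cfg) zero i+k≤f _ rewrite +-identityʳ i = begin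
    deg (pendantBlock i f L ++ pendantEdges (suc i) (f + length L) cfg) i
      ≡⟨ deg-++ (pendantBlock i f L) _ i ⟩
    deg (pendantBlock i f L) i + deg (pendantEdges (suc i) (f + length L) cfg) i
      ≡⟨ cong₂ _+_ (deg-pendantBlock i f L i i<f)
                   (deg-pendants-below (suc i) (f + length L) cfg i (n<1+n i) (≤-trans i<f (m≤m+n f (length L)))) ⟩
    ind (i ≡ᵇ i) * #trues L + 0
      ≡⟨ cong (λ b → ind b * #trues L + 0) (≡ᵇ-refl i) ⟩
    1 * #trues L + 0
      ≡⟨ trans (+-identityʳ _) (*-identityˡ (#trues L)) ⟩
    #trues L ∎
    where
    open ≡-Reasoning
    i<f : i < f
    i<f = <-≤-trans (m<m+n i z<s) i+k≤f
  deg-pendants i f ((s , L) ∷ cfg) (suc m) i+k≤f (s≤s m<) rewrite +-suc i m = begin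
    deg (pendantBlock i f L ++ pendantEdges (suc i) (f + length L) cfg) (suc i + m)
      ≡⟨ deg-++ (pendantBlock i f L) _ (suc i + m) ⟩
    deg (pendantBlock i f L) (suc i + m) + deg (pendantEdges (suc i) (f + length L) cfg) (suc i + m)
      ≡⟨ cong₂ _+_ (deg-pendantBlock i f L (suc i + m)
                     (<-≤-trans (subst (_< i + length ((s , L) ∷ cfg)) (+-suc i m) (+-monoʳ-< i (s≤s m<))) i+k≤f))
                   (deg-pendants (suc i) (f + length L) cfg m
                     (subst (_≤ f + length L) (+-suc i (length cfg)) (≤-trans i+k≤f (m≤m+n f (length L)))) m<) ⟩
    ind (i ≡ᵇ suc i + m) * #trues L + #trues (leafBitsAt cfg m)
      ≡⟨ cong (λ b → ind b * #trues L + #trues (leafBitsAt cfg m)) (<⇒≡ᵇ-false (s≤s (m≤m+n i m))) ⟩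
    #trues (leafBitsAt cfg m) ∎
    where open ≡-Reasoning

  deg-pendantBlock-leaf : ∀ i f L {a v} → i < f → (a , v) ∈ pendantBlock i f L → deg (pendantBlock i f L) v ≡ 1
  deg-pendantBlock-leaf i f (true ∷ L) i<f (here refl) =
    trans (cong₂ (λ x y → ind x + ind y + deg (pendantBlock i (suc f) L) f) (<⇒≡ᵇ-false i<f) (≡ᵇ-refl f))
          (cong suc (trans (deg-pendantBlock i (suc f) L f (n<1+n f)) (cong (λ b → ind b * #trues L) (<⇒≡ᵇ-false i<f))))
  deg-pendantBlock-leaf i f (true ∷ L) i<f (there e) with ∈-pendantBlock i (suc f) L e
  ... | _ , f<v , _ rewrite <⇒≡ᵇ-false (<-trans i<f f<v) | <⇒≡ᵇ-false f<v = deg-pendantBlock-leaf i (suc f) L (m<n⇒m<1+n i<f) e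
  deg-pendantBlock-leaf i f (false ∷ L) i<f e = deg-pendantBlock-leaf i (suc f) L (m<n⇒m<1+n i<f) e

  deg-pendants-leaf : ∀ i f cfg {a v} → i + length cfg ≤ f → (a , v) ∈ pendantEdges i f cfg → deg (pendantEdges i f cfg) v ≡ 1
  deg-pendants-leaf i f ((s , L) ∷ cfg) {a} {v} i+k≤f e with ∈-++⁻ (pendantBlock i f L) e
  ... | inj₁ e′ with ∈-pendantBlock i f L e′
  ...   | _ , f≤v , v< = trans (deg-++ (pendantBlock i f L) _ v)
                        (cong₂ _+_ (deg-pendantBlock-leaf i f L i<f e′) (deg-absent (pendantEdges (suc i) (f + length L) cfg) v absent))
    where
    i<f : i < f
    i<f = <-≤-trans (m<m+n i z<s) i+k≤f
    absent : ∀ {a′ b′} → (a′ , b′) ∈ pendantEdges (suc i) (f + length L) cfg → a′ ≢ v × b′ ≢ v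
    absent e″ with ∈-pendantEdges (suc i) (f + length L) cfg e″
    ... | t , refl , t< , o≤b′ , _ =
      <⇒≢ (≤-trans (subst₂ _≤_ (cong suc (+-suc i t)) (sym (+-suc i (length cfg))) (s≤s (+-monoʳ-≤ i t<)))
                   (≤-trans i+k≤f f≤v)) ,
      >⇒≢ (≤-trans v< (≤-trans (offset-≥ (f + length L) cfg t) o≤b′))
  deg-pendants-leaf i f ((s , L) ∷ cfg) {a} {v} i+k≤f e | inj₂ e′ with ∈-pendantEdges (suc i) (f + length L) cfg e′
  ... | t , _ , _ , o≤v , _ =
    trans (deg-++ (pendantBlock i f L) _ v)
          (trans (cong (_+ deg (pendantEdges (suc i) (f + length L) cfg) v) (deg-absent (pendantBlock i f L) v absent))
                 (deg-pendants-leaf (suc i) (f + length L) cfg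
                   (subst (_≤ f + length L) (+-suc i (length cfg)) (≤-trans i+k≤f (m≤m+n f (length L)))) e′))
    where
    fL≤v : f + length L ≤ v
    fL≤v = ≤-trans (offset-≥ (f + length L) cfg t) o≤v
    absent : ∀ {a′ b′} → (a′ , b′) ∈ pendantBlock i f L → a′ ≢ v × b′ ≢ v
    absent e″ with ∈-pendantBlock i f L e″
    ... | refl , _ , b′< = <⇒≢ (<-≤-trans (<-≤-trans (m<m+n i z<s) i+k≤f) (≤-trans (m≤m+n f (length L)) fL≤v)) ,
                           <⇒≢ (<-≤-trans b′< fL≤v)

  touches≡deg≢0 : ∀ E w → touches E w ≡ not (deg E w ≡ᵇ 0)
  touches≡deg≢0 []            w = refl
  touches≡deg≢0 ((a , b) ∷ E) w = step (a ≡ᵇ w) (b ≡ᵇ w) (touches≡deg≢0 E w)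
    where
    step : ∀ x y {t} → t ≡ not (deg E w ≡ᵇ 0) → (x ∨ y) ∨ t ≡ not (ind x + ind y + deg E w ≡ᵇ 0)
    step true  y     _ = refl
    step false true  _ = refl
    step false false t = t

  touchedAt≡degreeAt≢0 : ∀ inc cfg m → m < length cfg → touchedAt inc cfg m ≡ not (degreeAt inc cfg m ≡ᵇ 0)
  touchedAt≡degreeAt≢0 inc   ((s     , L) ∷ cfg) (suc m) (s≤s m<) = touchedAt≡degreeAt≢0 s cfg m m<
  touchedAt≡degreeAt≢0 true  ((true  , L) ∷ cfg) zero    _ = refl
  touchedAt≡degreeAt≢0 true  ((false , L) ∷ cfg) zero    _ = refl
  touchedAt≡degreeAt≢0 false ((true  , L) ∷ cfg) zero    _ = refl
  touchedAt≡degreeAt≢0 false ((false , L) ∷ cfg) zero    _ = trans (sym (not-involutive (or L))) (cong not (sym (#trues≡ᵇ0 L)))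

  leafIndicator : (ℕ → ℕ) → ℕ × ℕ → ℕ
  leafIndicator D (u , v) = ind ((D u ≡ᵇ 1) ∨ (D v ≡ᵇ 1))

  #leafSpineEdges : Bool → Config → ℕ
  #leafSpineEdges inc []             = 0
  #leafSpineEdges inc ((s , L) ∷ cfg) =
    ind s * ind ((headDegree inc ((s , L) ∷ cfg) ≡ᵇ 1) ∨ (headDegree s cfg ≡ᵇ 1)) + #leafSpineEdges s cfg

  #leafEdges-split : ∀ inc cfg → #leafEdges inc cfg ≡ #pendantEdges cfg + #leafSpineEdges inc cfg
  #leafEdges-split inc []              = refl
  #leafEdges-split inc ((s , L) ∷ cfg) =
    trans (cong (#trues L + x +_) (#leafEdges-split s cfg)) (interchange (#trues L) x (#pendantEdges cfg) _)
    where
    x : ℕ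
    x = ind s * ind ((headDegree inc ((s , L) ∷ cfg) ≡ᵇ 1) ∨ (headDegree s cfg ≡ᵇ 1))

  -- `D` is the degree function of the whole selected subgraph.
  leafSpineEdges : ∀ i inc cfg (D : ℕ → ℕ) → rightClosed cfg ≡ true →
                   (∀ t → t < length cfg → D (i + t) ≡ degreeAt inc cfg t) →
                   sum (map (leafIndicator D) (spineEdges i cfg)) ≡ #leafSpineEdges inc cfg
  leafSpineEdges i inc []                          D _      _   = refl
  leafSpineEdges i inc ((true , L) ∷ cfg@(_ ∷ _)) D closed D≡ =
    cong₂ _+_ (trans (cong₂ (λ u v → ind ((u ≡ᵇ 1) ∨ (v ≡ᵇ 1))) (trans (cong D (sym (+-identityʳ i))) (D≡ 0 (s≤s z≤n)))
                                                                (trans (cong D (sym (trans (+-suc i 0) (cong suc (+-identityʳ i))))) (D≡ 1 (s≤s (s≤s z≤n)))))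
                     (sym (+-identityʳ _)))
              (leafSpineEdges (suc i) true cfg D closed (λ t t< → trans (cong D (sym (+-suc i t))) (D≡ (suc t) (s≤s t<))))
  leafSpineEdges i inc ((false , L) ∷ cfg) D closed D≡ =
    leafSpineEdges (suc i) false cfg D (rightClosed-tail _ cfg closed) (λ t t< → trans (cong D (sym (+-suc i t))) (D≡ (suc t) (s≤s t<)))

  length-pendantBlock : ∀ i f L → length (pendantBlock i f L) ≡ #trues L
  length-pendantBlock i f []          = refl
  length-pendantBlock i f (true  ∷ L) = cong suc (length-pendantBlock i (suc f) L)
  length-pendantBlock i f (false ∷ L) = length-pendantBlock i (suc f) L

  length-pendantEdges : ∀ i f cfg → length (pendantEdges i f cfg) ≡ #pendantEdges cfg
  length-pendantEdges i f []              = refl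
  length-pendantEdges i f ((s , L) ∷ cfg) =
    trans (length-++ (pendantBlock i f L)) (cong₂ _+_ (length-pendantBlock i f L) (length-pendantEdges (suc i) (f + length L) cfg))

  length-spineEdges : ∀ i cfg → length (spineEdges i cfg) + #pendantEdges cfg ≡ #edges cfg
  length-spineEdges i []                  = refl
  length-spineEdges i ((true  , L) ∷ cfg) =
    cong suc (trans (x∙yz≈y∙xz (length (spineEdges (suc i) cfg)) (#trues L) (#pendantEdges cfg))
                    (cong (#trues L +_) (length-spineEdges (suc i) cfg)))
  length-spineEdges i ((false , L) ∷ cfg) =
    trans (x∙yz≈y∙xz (length (spineEdges (suc i) cfg)) (#trues L) (#pendantEdges cfg))
          (cong (#trues L +_) (length-spineEdges (suc i) cfg))

  sum-map-ones : ∀ {A : Set} (g : A → ℕ) xs → (∀ {x} → x ∈ xs → g x ≡ 1) → sum (map g xs) ≡ length xs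
  sum-map-ones g []       _   = refl
  sum-map-ones g (x ∷ xs) g≡1 = cong₂ _+_ (g≡1 (here refl)) (sum-map-ones g xs (λ x∈ → g≡1 (there x∈)))

  module Selected (cfg : Config) (closedRight : rightClosed cfg ≡ true) where

    k N : ℕ
    k = length cfg
    N = k + #slots cfg

    SP LF S : List (ℕ × ℕ)
    SP = spineEdges 0 cfg
    LF = pendantEdges 0 k cfg
    S  = SP ++ LF

    deg-selected : ∀ m → m < k → deg S m ≡ degreeAt false cfg m
    deg-selected m m<k = begin
      deg (SP ++ LF) m                                        ≡⟨ deg-++ SP LF m ⟩
      deg SP m + deg LF m
        ≡⟨ cong₂ _+_ (deg-spine 0 cfg m) (deg-pendants 0 k cfg m ≤-refl m<k) ⟩
      ind (spineBitAt cfg m) + ind (incomingAt false cfg m) + #trues (leafBitsAt cfg m)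
        ≡⟨ degreeAt-slice false cfg m m<k ⟨
      degreeAt false cfg m                                    ∎
      where open ≡-Reasoning

    touches-selected : ∀ m → m < k → touches S m ≡ touchedAt false cfg m
    touches-selected m m<k = trans (touches≡deg≢0 S m)
      (trans (cong (λ d → not (d ≡ᵇ 0)) (deg-selected m m<k)) (sym (touchedAt≡degreeAt≢0 false cfg m m<k)))

    deg-selected-leaf : ∀ {a v} → (a , v) ∈ LF → deg S v ≡ 1
    deg-selected-leaf {a} {v} e =
      trans (deg-++ SP LF v) (cong₂ _+_ (deg-spine-above 0 cfg v closedRight k≤v) (deg-pendants-leaf 0 k cfg ≤-refl e))
      where
      k≤v : k ≤ v
      k≤v with ∈-pendantEdges 0 k cfg e
      ... | t , _ , _ , o≤v , _ = ≤-trans (offset-≥ k cfg t) o≤v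

    ℓS-selected : ℓS S ≡ #leafEdges false cfg
    ℓS-selected = begin
      sum (map (leafIndicator (deg S)) (SP ++ LF))
        ≡⟨ sum-map-++ (leafIndicator (deg S)) SP LF ⟩
      sum (map (leafIndicator (deg S)) SP) + sum (map (leafIndicator (deg S)) LF)
        ≡⟨ cong₂ _+_ (leafSpineEdges 0 false cfg (deg S) closedRight deg-selected)
                     (trans (sum-map-ones (leafIndicator (deg S)) LF pendant-is-leaf) (length-pendantEdges 0 k cfg)) ⟩
      #leafSpineEdges false cfg + #pendantEdges cfg
        ≡⟨ +-comm (#leafSpineEdges false cfg) _ ⟩
      #pendantEdges cfg + #leafSpineEdges false cfg                                 ≡⟨ #leafEdges-split false cfg ⟨
      #leafEdges false cfg                                                          ∎
      where
      open ≡-Reasoning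
      pendant-is-leaf : ∀ {e} → e ∈ LF → leafIndicator (deg S) e ≡ 1
      pendant-is-leaf {a , v} e rewrite deg-selected-leaf e = cong ind (∨-zeroʳ (deg S a ≡ᵇ 1))

    length-selected : length S ≡ #edges cfg
    length-selected = trans (length-++ SP) (trans (cong (length SP +_) (length-pendantEdges 0 k cfg)) (length-spineEdges 0 cfg))

    ∈-selected : ∀ {a b} → (a , b) ∈ S →
                 a < k × ((b ≡ suc a × spineBitAt cfg a ≡ true) ⊎ (offset k cfg a ≤ b × b < offset k cfg (suc a)))
    ∈-selected e with ∈-++⁻ SP e
    ... | inj₁ e′ with ∈-spineEdges 0 cfg e′
    ...   | t , refl , refl , s = <⇒≤ (spineBit⇒<length cfg t closedRight s) , inj₁ (refl , s)
    ∈-selected e | inj₂ e′ with ∈-pendantEdges 0 k cfg e′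
    ...   | t , refl , t<k , o≤b , b<o = t<k , inj₂ (o≤b , b<o)

    spine-∈-selected : ∀ t → spineBitAt cfg t ≡ true → (t , suc t) ∈ S
    spine-∈-selected t h = ∈-++⁺ˡ (spineEdges-∈ 0 cfg t h)

    spine<N : ∀ {m} → m < k → m < N
    spine<N m<k = ≤-trans m<k (m≤m+n k (#slots cfg))

    selected-below : EdgesBelow N S
    selected-below {a} e with ∈-selected e
    ... | a<k , inj₁ (refl , s)   = spine<N a<k , spine<N (spineBit⇒<length cfg a closedRight s)
    ... | a<k , inj₂ (_ , b<o)    = spine<N a<k , <-≤-trans b<o (offset-≤ k cfg (suc a))

    touchedAt⇒<length : ∀ inc cfg′ m → touchedAt inc cfg′ m ≡ true → m < length cfg′
    touchedAt⇒<length inc ((s , L) ∷ cs) zero    h = s≤s z≤n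
    touchedAt⇒<length inc ((s , L) ∷ cs) (suc m) h = s≤s (touchedAt⇒<length s cs m h)

    -- If the spine edge after vertex t is not selected, nothing connects the vertices up to t,
    -- together with their pendant vertices, to the rest.
    connected⇒spineConnected : isConnected N S ≡ true → SpineConnected false cfg
    connected⇒spineConnected conn m m′ t touched-m touched-m′ m≤t t<m′ with spineBitAt cfg t in eq
    ... | true  = refl
    ... | false = ⊥-elim (not-¬ (reach-invariant S leftOfCut closed N m m′ (∨-introˡ (≤⇒≤ᵇ-true m≤t)) m⇝m′)
                      (trans (leftOfCut-spine m′<k) (>⇒≤ᵇ-false t<m′)))
      where
      m<k : m < k
      m<k = touchedAt⇒<length false cfg m touched-m
      m′<k : m′ < k
      m′<k = touchedAt⇒<length false cfg m′ touched-m′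
      t<k : t < k
      t<k = <-trans t<m′ m′<k
      leftOfCut : ℕ → Bool
      leftOfCut v = (v ≤ᵇ t) ∨ ((k ≤ᵇ v) ∧ (suc v ≤ᵇ offset k cfg (suc t)))
      leftOfCut-spine : ∀ {v} → v < k → leftOfCut v ≡ (v ≤ᵇ t)
      leftOfCut-spine {v} v<k =
        trans (cong (λ b → (v ≤ᵇ t) ∨ (b ∧ (suc v ≤ᵇ offset k cfg (suc t)))) (>⇒≤ᵇ-false v<k)) (∨-identityʳ _)
      leftOfCut-pendant : ∀ a b → offset k cfg a ≤ b → b < offset k cfg (suc a) → leftOfCut b ≡ (a ≤ᵇ t)
      leftOfCut-pendant a b o≤b b<o with a ≤? t
      ... | yes a≤t = trans (cong₂ _∨_ (>⇒≤ᵇ-false (<-≤-trans t<k k≤b)) (cong₂ _∧_ (≤⇒≤ᵇ-true k≤b)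
                        (≤⇒≤ᵇ-true (<-≤-trans b<o (offset-mono k cfg (suc a) (suc t) (s≤s a≤t))))))
                        (sym (≤⇒≤ᵇ-true a≤t))
        where k≤b = ≤-trans (offset-≥ k cfg a) o≤b
      ... | no a≰t  = trans (cong₂ _∨_ (>⇒≤ᵇ-false (<-≤-trans t<k k≤b)) (cong₂ _∧_ (≤⇒≤ᵇ-true k≤b)
                        (>⇒≤ᵇ-false (s≤s (≤-trans (offset-mono k cfg (suc t) a (≰⇒> a≰t)) o≤b)))))
                        (sym (>⇒≤ᵇ-false (≰⇒> a≰t)))
        where k≤b = ≤-trans (offset-≥ k cfg a) o≤b
      ≤ᵇ-suc : ∀ {a} → a ≢ t → (a ≤ᵇ t) ≡ (suc a ≤ᵇ t)
      ≤ᵇ-suc {a} a≢t with a ≤? t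
      ... | yes a≤t = trans (≤⇒≤ᵇ-true a≤t) (sym (≤⇒≤ᵇ-true (≤∧≢⇒< a≤t a≢t)))
      ... | no a≰t  = trans (>⇒≤ᵇ-false (≰⇒> a≰t)) (sym (>⇒≤ᵇ-false (≤-trans (≰⇒> a≰t) (n≤1+n a))))
      closed : ∀ {a b} → (a , b) ∈ S → leftOfCut a ≡ leftOfCut b
      closed {a} {b} e with ∈-selected e
      ... | a<k , inj₁ (refl , s) = trans (leftOfCut-spine a<k) (trans (≤ᵇ-suc a≢t)
                                     (sym (leftOfCut-spine (spineBit⇒<length cfg a closedRight s))))
        where a≢t = λ a≡t → not-¬ s (trans (cong (spineBitAt cfg) a≡t) eq)
      ... | a<k , inj₂ (o≤b , b<o) = trans (leftOfCut-spine a<k) (sym (leftOfCut-pendant a b o≤b b<o))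
      m⇝m′ : reach N S m m′ ≡ true
      m⇝m′ = allReachable⁻ N S (touches S) conn (spine<N m<k) (spine<N m′<k)
               (trans (touches-selected m m<k) touched-m) (trans (touches-selected m′ m′<k) touched-m′)

    edge⇒touched : ∀ {a b} → (a , b) ∈ S → Σ[ m ∈ ℕ ] touchedAt false cfg m ≡ true
    edge⇒touched {a} e = a , trans (sym (touches-selected a (proj₁ (∈-selected e)))) (touches-fst e)

    touched⇒anchor : ∀ u → touches S u ≡ true →
                     Σ[ a ∈ ℕ ] a < k × touchedAt false cfg a ≡ true × (u ≡ a ⊎ (a , u) ∈ S)
    touched⇒anchor u h with any⁻ S h
    ... | (a , b) , e , q = a , a<k , trans (sym (touches-selected a a<k)) (touches-fst e) , side
      where
      a<k : a < k
      a<k = proj₁ (∈-selected e)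
      side : u ≡ a ⊎ (a , u) ∈ S
      side with ∨-elim {a ≡ᵇ u} q
      ... | inj₁ a≡u = inj₁ (sym (≡ᵇ-true⇒≡ a u a≡u))
      ... | inj₂ b≡u rewrite ≡ᵇ-true⇒≡ b u b≡u = inj₂ e

    walk-up : ∀ u d n x → (∀ t → x ≤ t → t < x + d → (t , suc t) ∈ S) →
              reach n S u x ≡ true → reach (n + d) S u (x + d) ≡ true
    walk-up u zero    n x _     r rewrite +-identityʳ n | +-identityʳ x = r
    walk-up u (suc d) n x spine r rewrite +-suc n d | +-suc x d =
      walk-up u d (suc n) (suc x) (λ t x<t t< → spine t (<⇒≤ x<t) t<)
              (reach-fwd S n u x (suc x) r (spine x ≤-refl (s≤s (m≤m+n x d))))

    walk-down : ∀ u d n x → (∀ t → x ≤ t → t < x + d → (t , suc t) ∈ S) →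
                reach n S u (x + d) ≡ true → reach (n + d) S u x ≡ true
    walk-down u zero    n x _     r rewrite +-identityʳ n | +-identityʳ x = r
    walk-down u (suc d) n x spine r rewrite +-suc n d | +-suc x d =
      walk-down u d (suc n) x (λ t x≤t t< → spine t x≤t (m≤n⇒m≤1+n t<))
                (reach-bwd S n u (suc (x + d)) (x + d) r (spine (x + d) (m≤m+n x d) ≤-refl))

    module _ {i j} (I : Interval false cfg i j) (someSlot : 1 ≤ #slots cfg) where
      open Interval I

      along-spine : ∀ u a a′ n → touchedAt false cfg a ≡ true → touchedAt false cfg a′ ≡ true →
                    reach n S u a ≡ true → Σ[ d ∈ ℕ ] d < k × reach (n + d) S u a′ ≡ true
      along-spine u a a′ n touched-a touched-a′ r
        with a ≤? a′ | touched⇒∈ a touched-a | touched⇒∈ a′ touched-a′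
      ... | yes a≤a′ | i≤a , a≤j | i≤a′ , a′≤j =
        a′ ∸ a , ≤-<-trans (m∸n≤m a′ a) (≤-<-trans a′≤j j<length) ,
        subst (λ z → reach (n + (a′ ∸ a)) S u z ≡ true) (m+[n∸m]≡n a≤a′)
          (walk-up u (a′ ∸ a) n a (λ t a≤t t< → spine-∈-selected t (spine t (≤-trans i≤a a≤t)
                     (<-≤-trans (subst (t <_) (m+[n∸m]≡n a≤a′) t<) a′≤j))) r)
      ... | no a≰a′  | i≤a , a≤j | i≤a′ , a′≤j =
        a ∸ a′ , ≤-<-trans (m∸n≤m a a′) (≤-<-trans a≤j j<length) ,
        walk-down u (a ∸ a′) n a′ (λ t a′≤t t< → spine-∈-selected t (spine t (≤-trans i≤a′ a′≤t)
                    (<-≤-trans (subst (t <_) (m+[n∸m]≡n a′≤a) t<) a≤j)))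
                  (subst (λ z → reach n S u z ≡ true) (sym (m+[n∸m]≡n a′≤a)) r)
        where a′≤a = <⇒≤ (≰⇒> a≰a′)

      interval⇒connected : isConnected N S ≡ true
      interval⇒connected = allReachable⁺ N S (touches S) λ {u} {v} _ _ tu tv → path u v tu tv
        where
        k+1≤N : suc k ≤ N
        k+1≤N = subst (_≤ N) (+-comm k 1) (+-monoʳ-≤ k someSlot)
        enter : ∀ u a → u ≡ a ⊎ (a , u) ∈ S → reach 1 S u a ≡ true
        enter u .u (inj₁ refl) = reach-refl S 1 u
        enter u a  (inj₂ e)    = reach-bwd S 0 u u a (reach-refl S 0 u) e
        leave : ∀ u a v n → reach n S u a ≡ true → v ≡ a ⊎ (a , v) ∈ S → reach (suc n) S u v ≡ true
        leave u a .a n r (inj₁ refl) = reach-suc S n u a r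
        leave u a v  n r (inj₂ e)    = reach-fwd S n u a v r e
        path : ∀ u v → touches S u ≡ true → touches S v ≡ true → reach N S u v ≡ true
        path u v tu tv with touched⇒anchor u tu | touched⇒anchor v tv
        ... | a , _ , touched-a , u~a | a′ , _ , touched-a′ , v~a′
          with along-spine u a a′ 1 touched-a touched-a′ (enter u a u~a)
        ...   | d , d<k , r = reach-mono S u v (≤-trans (s≤s d<k) k+1≤N) (leave u a′ v (1 + d) r v~a′)

      interval⇒nonempty : null S ≡ false
      interval⇒nonempty with any⁻ S (trans (touches-selected i (≤-<-trans i≤j j<length)) (∈⇒touched i ≤-refl i≤j))
      ... | _ , e , _ = ∈⇒nonnull e
        where
        ∈⇒nonnull : ∀ {x : ℕ × ℕ} {xs} → x ∈ xs → null xs ≡ false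
        ∈⇒nonnull (here _)  = refl
        ∈⇒nonnull (there _) = refl

    accepts≡connected : 1 ≤ #slots cfg → not (null S) ∧ isConnected N S ≡ accepts before cfg
    accepts≡connected someSlot = bool-ext to from
      where
      to : not (null S) ∧ isConnected N S ≡ true → accepts before cfg ≡ true
      to h with S in eq
      ... | e ∷ _ = connected⇒accepts cfg closedRight (edge⇒touched (subst (e ∈_) (sym eq) (here refl)))
                      (connected⇒spineConnected (subst (λ S′ → isConnected N S′ ≡ true) (sym eq) (∧-elimʳ h)))
      from : accepts before cfg ≡ true → not (null S) ∧ isConnected N S ≡ true
      from acc with accepts⇒interval cfg acc
      ... | i , j , I = ∧-intro (cong not (interval⇒nonempty I someSlot)) (interval⇒connected I someSlot)

module SubtreeWeights where

  open import Data.Bool using (false; _∧_; not)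
  open import Data.List using (List; []; _∷_; _++_; length; drop; null)
  open import Data.List.Properties using (length-drop)
  open import Data.Nat using (ℕ; _+_; _*_; _∸_; _^_; _≤_)
  open import Data.Nat.Properties using (+-identityʳ; *-identityʳ; *-zeroʳ; m≤m+n; m+n∸m≡n)
  open import Data.Product using (_×_; _,_)
  open import Relation.Binary.PropositionalEquality
  open ≡-Reasoning
  open import Defs
  open Booleans
  open Sums
  open VertexSets
  open Automaton
  open TransferSums
  open SelectedEdges

  count-null-selEdges : ∀ E → sumBools (length E) (λ es → ind (null (selEdges E es))) ≡ 1
  count-null-selEdges []      = refl
  count-null-selEdges (e ∷ E) =
    trans (sumBools-suc (length E) _) (trans (sumBools-cong (length E) (λ _ _ → +-identityʳ _)) (count-null-selEdges E))

  #slots-toConfig : ∀ cs sp lf → length lf ≡ #pendants cs → #slots (toConfig cs sp lf) ≡ #pendants cs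
  #slots-toConfig []       sp lf _   = refl
  #slots-toConfig (c ∷ cs) sp lf len =
    cong₂ _+_ (length-take-≤ (c ∸ 1) lf (subst (c ∸ 1 ≤_) (sym len) (m≤m+n (c ∸ 1) (#pendants cs))))
              (#slots-toConfig cs (drop 1 sp) (drop (c ∸ 1) lf)
                (trans (length-drop (c ∸ 1) lf) (trans (cong (_∸ (c ∸ 1)) len) (m+n∸m≡n (c ∸ 1) (#pendants cs)))))

  module _ (Q R : ℕ) where
    open Weights Q R
    open TransferSums.Evaluation Q R

    edgeWeight : List (ℕ × ℕ) → ℕ
    edgeWeight E = Q ^ eS E * R ^ ℓS E

    subtreeWeight : Graph → ℕ
    subtreeWeight G = sumBools (nV G) λ vs → sumBools (length (edges G)) λ es →
                      ind (isSubtree G vs es) * edgeWeight (selEdges (edges G) es)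

    -- A nonempty edge set carries exactly one vertex set, the empty one carries the N single vertices.
    vertexSets-weight : ∀ N S → EdgesBelow N S →
      countVertexSets N S * edgeWeight S ≡ N * ind (null S) + ind (not (null S) ∧ isConnected N S) * edgeWeight S
    vertexSets-weight N []      _     = trans (cong (_* 1) (countVertexSets-[] N)) (sym (+-identityʳ _))
    vertexSets-weight N (e ∷ S) below = begin
      countVertexSets N (e ∷ S) * edgeWeight (e ∷ S)   ≡⟨ cong (_* edgeWeight (e ∷ S)) (countVertexSets-∷ N e S below) ⟩
      ind (isConnected N (e ∷ S)) * edgeWeight (e ∷ S)
        ≡⟨ cong (_+ ind (isConnected N (e ∷ S)) * edgeWeight (e ∷ S)) (*-zeroʳ N) ⟨
      N * 0 + ind (isConnected N (e ∷ S)) * edgeWeight (e ∷ S) ∎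

    module _ (cs : List ℕ) (someSlot : 1 ≤ #pendants cs) where

      k N : ℕ
      k = length cs
      N = k + #pendants cs

      selection-weight : ∀ sp lf → length sp ≡ k ∸ 1 → length lf ≡ #pendants cs →
        let S = selEdges (edges (Cat cs)) (sp ++ lf) in
        countVertexSets N S * edgeWeight S ≡ N * ind (null S) + runWeight before (toConfig cs sp lf)
      selection-weight sp lf len-sp len-lf = subst₂ P (sym N≡) (sym S≡) (begin
        countVertexSets (Sel.N) (Sel.S) * edgeWeight (Sel.S)
          ≡⟨ vertexSets-weight Sel.N Sel.S Sel.selected-below ⟩
        Sel.N * ind (null Sel.S) + ind (not (null Sel.S) ∧ isConnected Sel.N Sel.S) * edgeWeight Sel.S
          ≡⟨ cong₂ (λ a w → Sel.N * ind (null Sel.S) + ind a * w) (Sel.accepts≡connected slot)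
                   (cong₂ ⟦_,_⟧ Sel.length-selected Sel.ℓS-selected) ⟩
        Sel.N * ind (null Sel.S) + ind (accepts before cfg) * ⟦ #edges cfg , #leafEdges false cfg ⟧
          ≡⟨ cong (Sel.N * ind (null Sel.S) +_) (runWeight≡ before cfg) ⟨
        Sel.N * ind (null Sel.S) + runWeight before cfg ∎)
        where
        cfg = toConfig cs sp lf
        module Sel = Selected cfg (toConfig-rightClosed cs sp lf len-sp)
        P : ℕ → List (ℕ × ℕ) → Set
        P n S = countVertexSets n S * edgeWeight S ≡ n * ind (null S) + runWeight before cfg
        S≡ : selEdges (edges (Cat cs)) (sp ++ lf) ≡ Sel.S
        S≡ = trans (selEdges-Cat cs sp lf len-sp len-lf)
                   (cong (λ n → spineEdges 0 cfg ++ pendantEdges 0 n cfg) (sym (length-toConfig cs sp lf)))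
        N≡ : N ≡ Sel.N
        N≡ = cong₂ _+_ (sym (length-toConfig cs sp lf)) (sym (#slots-toConfig cs sp lf len-lf))
        slot : 1 ≤ #slots cfg
        slot = subst (1 ≤_) (sym (#slots-toConfig cs sp lf len-lf)) someSlot

      subtreeWeight-Cat : subtreeWeight (Cat cs) ≡ N + subtreeSum⁺ cs
      subtreeWeight-Cat = begin
        sumBools N (λ vs → sumBools m λ es → ind (isSubtree (Cat cs) vs es) * edgeWeight (sel es))
          ≡⟨ sumBools-swap N m _ ⟩
        sumBools m (λ es → sumBools N λ vs → ind (isSubtree (Cat cs) vs es) * edgeWeight (sel es))
          ≡⟨ sumBools-cong m (λ es _ → sumBools-*ʳ N _ (edgeWeight (sel es))) ⟩
        sumBools m (λ es → countVertexSets N (sel es) * edgeWeight (sel es))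
          ≡⟨ cong (λ n → sumBools n λ es → countVertexSets N (sel es) * edgeWeight (sel es)) (length-edges-Cat cs) ⟩
        sumBools (k ∸ 1 + #pendants cs) (λ es → countVertexSets N (sel es) * edgeWeight (sel es))
          ≡⟨ sumBools-++ (k ∸ 1) (#pendants cs) _ ⟩
        sumBools (k ∸ 1) (λ sp → sumBools (#pendants cs) λ lf → countVertexSets N (sel (sp ++ lf)) * edgeWeight (sel (sp ++ lf)))
          ≡⟨ sumBools-cong (k ∸ 1) (λ sp len-sp →
               sumBools-cong (#pendants cs) (λ lf len-lf → selection-weight sp lf len-sp len-lf)) ⟩
        sumBools (k ∸ 1) (λ sp → sumBools (#pendants cs) λ lf → N * ind (null (sel (sp ++ lf))) + runWeight before (toConfig cs sp lf))
          ≡⟨ sumBools-cong (k ∸ 1) (λ sp _ → sumBools-+ (#pendants cs) _ _) ⟩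
        sumBools (k ∸ 1) (λ sp → sumBools (#pendants cs) (λ lf → N * ind (null (sel (sp ++ lf))))
                                 + sumBools (#pendants cs) λ lf → runWeight before (toConfig cs sp lf))
          ≡⟨ sumBools-+ (k ∸ 1) _ _ ⟩
        sumBools (k ∸ 1) (λ sp → sumBools (#pendants cs) λ lf → N * ind (null (sel (sp ++ lf)))) + weightSum before cs
          ≡⟨ cong₂ _+_ (sym (sumBools-++ (k ∸ 1) (#pendants cs) _)) (weightSum-before cs) ⟩
        sumBools (k ∸ 1 + #pendants cs) (λ es → N * ind (null (sel es))) + subtreeSum⁺ cs
          ≡⟨ cong (λ n → sumBools n (λ es → N * ind (null (sel es))) + subtreeSum⁺ cs) (sym (length-edges-Cat cs)) ⟩
        sumBools m (λ es → N * ind (null (sel es))) + subtreeSum⁺ cs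
          ≡⟨ cong (_+ subtreeSum⁺ cs) (trans (sumBools-*ˡ m N _)
                                             (trans (cong (N *_) (count-null-selEdges (edges (Cat cs)))) (*-identityʳ N))) ⟩
        N + subtreeSum⁺ cs ∎
        where
        m = length (edges (Cat cs))
        sel = selEdges (edges (Cat cs))

module Quads where

  open import Data.Integer using (ℤ; _+_; _*_; 1ℤ; 0ℤ)
  open import Data.Integer.Properties using (*-assoc; *-zeroʳ)
  open import Data.Integer.Tactic.RingSolver using (solve-∀)
  open import Data.List using (List; []; _∷_; _++_; map; foldr)
  open import Data.Nat using (ℕ)
  open import Data.Product using (_×_; _,_; proj₁; proj₂)
  open import Function using (_∘_)
  open import Relation.Binary.PropositionalEquality
  open ≡-Reasoning

  record Quad : Set where
    constructor quad
    field α μ β γ : ℤ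
  open Quad public

  quad-cong : ∀ {a m b g a′ m′ b′ g′} → a ≡ a′ → m ≡ m′ → b ≡ b′ → g ≡ g′ →
              quad a m b g ≡ quad a′ m′ b′ g′
  quad-cong refl refl refl refl = refl

  ε : Quad
  ε = quad 0ℤ 1ℤ 0ℤ 0ℤ

  φ : Quad → Quad
  φ (quad a m b g) = quad b m a g

  -- `quad a m b g` stands for the matrix [[1, Q a, Q g], [0, m, Q b], [0, 0, 1]]; `_∙_` is the matrix
  -- product, and `φ` is the anti-automorphism reflecting in the anti-diagonal.
  module QuadMonoid (Q : ℤ) where

    infixl 7 _∙_
    _∙_ : Quad → Quad → Quad
    quad a m b g ∙ quad a′ m′ b′ g′ = quad (a′ + a * m′) (m * m′) (b + m * b′) (g + g′ + Q * a * b′)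

    ∙-assoc : ∀ A B C → (A ∙ B) ∙ C ≡ A ∙ (B ∙ C)
    ∙-assoc (quad a m b g) (quad a′ m′ b′ g′) (quad a″ m″ b″ g″) =
      quad-cong (α-assoc a m a′ m′ a″ m″) (μ-assoc m m′ m″) (β-assoc m b m′ b′ b″)
                (γ-assoc Q a m b g a′ m′ b′ g′ b″ g″)
      where
      α-assoc : ∀ a m a′ m′ a″ m″ → a″ + (a′ + a * m′) * m″ ≡ (a″ + a′ * m″) + a * (m′ * m″)
      α-assoc = solve-∀
      μ-assoc : ∀ m m′ m″ → (m * m′) * m″ ≡ m * (m′ * m″)
      μ-assoc = solve-∀
      β-assoc : ∀ m b m′ b′ b″ → (b + m * b′) + (m * m′) * b″ ≡ b + m * (b′ + m′ * b″)
      β-assoc = solve-∀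
      γ-assoc : ∀ Q a m b g a′ m′ b′ g′ b″ g″ →
        (g + g′ + Q * a * b′) + g″ + Q * (a′ + a * m′) * b″ ≡ g + (g′ + g″ + Q * a′ * b″) + Q * a * (b′ + m′ * b″)
      γ-assoc = solve-∀

    ∙-identityˡ : ∀ A → ε ∙ A ≡ A
    ∙-identityˡ (quad a m b g) = quad-cong (lemma₁ a m) (lemma₂ m) (lemma₃ b) (lemma₄ Q g b)
      where
      lemma₁ : ∀ a m → a + 0ℤ * m ≡ a
      lemma₁ = solve-∀
      lemma₂ : ∀ m → 1ℤ * m ≡ m
      lemma₂ = solve-∀
      lemma₃ : ∀ b → 0ℤ + 1ℤ * b ≡ b
      lemma₃ = solve-∀
      lemma₄ : ∀ Q g b → 0ℤ + g + Q * 0ℤ * b ≡ g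
      lemma₄ = solve-∀

    ∙-identityʳ : ∀ A → A ∙ ε ≡ A
    ∙-identityʳ (quad a m b g) = quad-cong (lemma₁ a) (lemma₂ m) (lemma₃ b m) (lemma₄ Q g a)
      where
      lemma₁ : ∀ a → 0ℤ + a * 1ℤ ≡ a
      lemma₁ = solve-∀
      lemma₂ : ∀ m → m * 1ℤ ≡ m
      lemma₂ = solve-∀
      lemma₃ : ∀ b m → b + m * 0ℤ ≡ b
      lemma₃ = solve-∀
      lemma₄ : ∀ Q g a → g + 0ℤ + Q * a * 0ℤ ≡ g
      lemma₄ = solve-∀

    φ-anti : ∀ A B → φ (A ∙ B) ≡ φ B ∙ φ A
    φ-anti (quad a m b g) (quad a′ m′ b′ g′) =
      quad-cong (swap b m b′) (*-comm m m′) (swap a′ a m′) (γ-swap Q a b g a′ b′ g′)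
      where
      swap : ∀ b m b′ → b + m * b′ ≡ b + b′ * m
      swap = solve-∀
      *-comm : ∀ m m′ → m * m′ ≡ m′ * m
      *-comm = solve-∀
      γ-swap : ∀ Q a b g a′ b′ g′ → g + g′ + Q * a * b′ ≡ g′ + g + Q * b′ * a
      γ-swap = solve-∀

    ∏ : List Quad → Quad
    ∏ = foldr _∙_ ε

    ∏-++ : ∀ As Bs → ∏ (As ++ Bs) ≡ ∏ As ∙ ∏ Bs
    ∏-++ []       Bs = sym (∙-identityˡ (∏ Bs))
    ∏-++ (A ∷ As) Bs = trans (cong (A ∙_) (∏-++ As Bs)) (sym (∙-assoc A (∏ As) (∏ Bs)))

    -- γ (A₁ ∙ ⋯ ∙ Aₖ) = Σ γ Aᵢ + Q Σ_{i<j} α Aᵢ μ Aᵢ₊₁ ⋯ μ Aⱼ₋₁ β Aⱼ, and φ exchanges α Aᵢ β Aⱼ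
    -- for β Aᵢ α Aⱼ, which are equal when all the pairs (α, β) are proportional.
    private
      β-∏-φ : ∀ (f : ℕ → Quad) a b ns → (∀ n → a * β (f n) ≡ b * α (f n)) →
              a * β (∏ (map f ns)) ≡ b * β (∏ (map (φ ∘ f) ns)) × μ (∏ (map f ns)) ≡ μ (∏ (map (φ ∘ f) ns))
      β-∏-φ f a b []       _    = trans (*-zeroʳ a) (sym (*-zeroʳ b)) , refl
      β-∏-φ f a b (n ∷ ns) prop = (begin
        a * (β (f n) + μ (f n) * β X)           ≡⟨ distrib a (β (f n)) (μ (f n)) (β X) ⟩
        a * β (f n) + μ (f n) * (a * β X)       ≡⟨ cong₂ (λ u v → u + μ (f n) * v) (prop n) (proj₁ ih) ⟩
        b * α (f n) + μ (f n) * (b * β X′)      ≡⟨ distrib b (α (f n)) (μ (f n)) (β X′) ⟨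
        b * (α (f n) + μ (f n) * β X′)          ∎) , cong (μ (f n) *_) (proj₂ ih)
        where
        X  = ∏ (map f ns)
        X′ = ∏ (map (φ ∘ f) ns)
        ih : a * β X ≡ b * β X′ × μ X ≡ μ X′
        ih = β-∏-φ f a b ns prop
        distrib : ∀ a b m x → a * (b + m * x) ≡ a * b + m * (a * x)
        distrib = solve-∀

    γ-∏-φ : ∀ (f : ℕ → Quad) → (∀ n m → α (f n) * β (f m) ≡ β (f n) * α (f m)) →
            ∀ ns → γ (∏ (map f ns)) ≡ γ (∏ (map (φ ∘ f) ns))
    γ-∏-φ f prop []       = refl
    γ-∏-φ f prop (n ∷ ns) =
      cong₂ (λ u v → γ (f n) + u + v) (γ-∏-φ f prop ns)
            (trans (*-assoc Q (α (f n)) _) (trans (cong (Q *_) (proj₁ (β-∏-φ f (α (f n)) (β (f n)) ns (prop n))))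
                   (sym (*-assoc Q (β (f n)) _))))

module CaterpillarQuads where

  open import Data.Bool using (Bool; true; false)
  open import Data.Integer using (ℤ; _+_; _*_; _-_; -_; 1ℤ; 0ℤ)
  open import Data.Integer.Properties using (*-zeroʳ; +-identityʳ)
  open import Data.Integer.Tactic.RingSolver using (solve-∀)
  open import Data.List using (List; []; _∷_; _++_; [_]; map)
  open import Data.List.Properties using (map-++; map-cong)
  open import Data.Nat using (ℕ; zero; suc)
  open import Function using (_∘_)
  open import Relation.Binary.PropositionalEquality using (_≡_; refl; sym; trans; cong; cong₂; module ≡-Reasoning)
  open ≡-Reasoning
  open Quads

  module Transfer (Q R : ℤ) where
    open Quads.QuadMonoid Q

    w : ℤ
    w = 1ℤ + Q * R

    -- The transfer quad of a spine vertex whose pendant subsets have total weight t = (1 + QR)^(c-1).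
    E : ℤ → Quad
    E t = quad (t - 1ℤ + R) (Q * t) (t - 1ℤ + R) (t - 1ℤ)

    -- Adding one pendant vertex at an end of the caterpillar multiplies t by w.
    Lw Rw : Quad
    Lw = quad R w (Q * R * (1ℤ - R)) (Q * R * (1ℤ - R))
    Rw = quad (Q * R * (1ℤ - R)) w R (Q * R * (1ℤ - R))

    E-w*ˡ : ∀ t → E (w * t) ≡ Lw ∙ E t
    E-w*ˡ t = quad-cong (α-eq Q R t) (μ-eq Q R t) (β-eq Q R t) (γ-eq Q R t)
      where
      α-eq : ∀ Q R t → (1ℤ + Q * R) * t - 1ℤ + R ≡ (t - 1ℤ + R) + R * (Q * t)
      α-eq = solve-∀
      μ-eq : ∀ Q R t → Q * ((1ℤ + Q * R) * t) ≡ (1ℤ + Q * R) * (Q * t)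
      μ-eq = solve-∀
      β-eq : ∀ Q R t → (1ℤ + Q * R) * t - 1ℤ + R ≡ Q * R * (1ℤ - R) + (1ℤ + Q * R) * (t - 1ℤ + R)
      β-eq = solve-∀
      γ-eq : ∀ Q R t → (1ℤ + Q * R) * t - 1ℤ ≡ Q * R * (1ℤ - R) + (t - 1ℤ) + Q * R * (t - 1ℤ + R)
      γ-eq = solve-∀

    E-w*ʳ : ∀ t → E (w * t) ≡ E t ∙ Rw
    E-w*ʳ t = quad-cong (α-eq Q R t) (μ-eq Q R t) (β-eq Q R t) (γ-eq Q R t)
      where
      α-eq : ∀ Q R t → (1ℤ + Q * R) * t - 1ℤ + R ≡ Q * R * (1ℤ - R) + (t - 1ℤ + R) * (1ℤ + Q * R)
      α-eq = solve-∀
      μ-eq : ∀ Q R t → Q * ((1ℤ + Q * R) * t) ≡ (Q * t) * (1ℤ + Q * R)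
      μ-eq = solve-∀
      β-eq : ∀ Q R t → (1ℤ + Q * R) * t - 1ℤ + R ≡ (t - 1ℤ + R) + (Q * t) * R
      β-eq = solve-∀
      γ-eq : ∀ Q R t → (1ℤ + Q * R) * t - 1ℤ ≡ (t - 1ℤ) + Q * R * (1ℤ - R) + Q * (t - 1ℤ + R) * R
      γ-eq = solve-∀

    -- Conjugating by P makes the transfer quads symmetric (α = β), i.e. fixed by φ.
    P P⁻¹ : Quad
    P   = quad (- R) 1ℤ R 0ℤ
    P⁻¹ = quad R 1ℤ (- R) (- (Q * R * R))

    P∙P⁻¹ : P ∙ P⁻¹ ≡ ε
    P∙P⁻¹ = quad-cong (α-eq R) refl (β-eq R) (γ-eq Q R)
      where
      α-eq : ∀ R → R + (- R) * 1ℤ ≡ 0ℤ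
      α-eq = solve-∀
      β-eq : ∀ R → R + 1ℤ * (- R) ≡ 0ℤ
      β-eq = solve-∀
      γ-eq : ∀ Q R → 0ℤ + (- (Q * R * R)) + Q * (- R) * (- R) ≡ 0ℤ
      γ-eq = solve-∀

    P⁻¹∙P : P⁻¹ ∙ P ≡ ε
    P⁻¹∙P = quad-cong (α-eq R) refl (β-eq R) (γ-eq Q R)
      where
      α-eq : ∀ R → (- R) + R * 1ℤ ≡ 0ℤ
      α-eq = solve-∀
      β-eq : ∀ R → (- R) + 1ℤ * R ≡ 0ℤ
      β-eq = solve-∀
      γ-eq : ∀ Q R → (- (Q * R * R)) + 0ℤ + Q * R * R ≡ 0ℤ
      γ-eq = solve-∀

    conj : Quad → Quad
    conj M = P⁻¹ ∙ M ∙ P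

    conj-ε : conj ε ≡ ε
    conj-ε = trans (cong (_∙ P) (∙-identityʳ P⁻¹)) P⁻¹∙P

    conj-∙ : ∀ A B → conj (A ∙ B) ≡ conj A ∙ conj B
    conj-∙ A B = sym (begin
      (P⁻¹ ∙ A ∙ P) ∙ (P⁻¹ ∙ B ∙ P)     ≡⟨ ∙-assoc (P⁻¹ ∙ A) P (P⁻¹ ∙ B ∙ P) ⟩
      P⁻¹ ∙ A ∙ (P ∙ (P⁻¹ ∙ B ∙ P))     ≡⟨ cong ((P⁻¹ ∙ A) ∙_) (cong (P ∙_) (∙-assoc P⁻¹ B P)) ⟩
      P⁻¹ ∙ A ∙ (P ∙ (P⁻¹ ∙ (B ∙ P)))   ≡⟨ cong ((P⁻¹ ∙ A) ∙_) (∙-assoc P P⁻¹ (B ∙ P)) ⟨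
      P⁻¹ ∙ A ∙ (P ∙ P⁻¹ ∙ (B ∙ P))     ≡⟨ cong (λ C → (P⁻¹ ∙ A) ∙ (C ∙ (B ∙ P))) P∙P⁻¹ ⟩
      P⁻¹ ∙ A ∙ (ε ∙ (B ∙ P))           ≡⟨ cong ((P⁻¹ ∙ A) ∙_) (∙-identityˡ (B ∙ P)) ⟩
      P⁻¹ ∙ A ∙ (B ∙ P)                 ≡⟨ ∙-assoc (P⁻¹ ∙ A) B P ⟨
      P⁻¹ ∙ A ∙ B ∙ P                   ≡⟨ cong (_∙ P) (∙-assoc P⁻¹ A B) ⟩
      P⁻¹ ∙ (A ∙ B) ∙ P                 ∎)

    δ : ℤ
    δ = Q * R * (1ℤ + 1ℤ - R)

    γ-Lw-Rw : ∀ M → γ (Lw ∙ M ∙ Rw) ≡ γ (conj M) + δ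
    γ-Lw-Rw (quad a m b g) = lemma Q R a m b g
      where
      lemma : ∀ Q R a m b g → (Q * R * (1ℤ - R) + g + Q * R * b) + Q * R * (1ℤ - R) + Q * (a + R * m) * R
                            ≡ ((- (Q * R * R)) + g + Q * R * b) + 0ℤ + Q * (a + R * m) * R + Q * R * (1ℤ + 1ℤ - R)
      lemma = solve-∀

    V : ℤ → Quad
    V t = conj (E t)

    V-form : ∀ t → V t ≡ quad (w * t - 1ℤ) (Q * t) (w * t - 1ℤ) (γ (V t))
    V-form t = quad-cong (α-eq Q R t) (μ-eq Q t) (β-eq Q R t) refl
      where
      α-eq : ∀ Q R t → - R + ((t - 1ℤ + R) + R * (Q * t)) * 1ℤ ≡ (1ℤ + Q * R) * t - 1ℤ
      α-eq = solve-∀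
      μ-eq : ∀ Q t → (1ℤ * (Q * t)) * 1ℤ ≡ Q * t
      μ-eq = solve-∀
      β-eq : ∀ Q R t → ((- R) + 1ℤ * (t - 1ℤ + R)) + (1ℤ * (Q * t)) * R ≡ (1ℤ + Q * R) * t - 1ℤ
      β-eq = solve-∀

    φ-V : ∀ t → φ (V t) ≡ V t
    φ-V t = trans (cong φ (V-form t)) (sym (V-form t))

    ∏E ∏V : List ℤ → Quad
    ∏E ts = ∏ (map E ts)
    ∏V ts = ∏ (map V ts)

    ∏E-++ : ∀ xs ys → ∏E (xs ++ ys) ≡ ∏E xs ∙ ∏E ys
    ∏E-++ xs ys = trans (cong ∏ (map-++ E xs ys)) (∏-++ (map E xs) (map E ys))

    conj-∏E : ∀ ts → conj (∏E ts) ≡ ∏V ts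
    conj-∏E []       = conj-ε
    conj-∏E (t ∷ ts) = trans (conj-∙ (E t) (∏E ts)) (cong (V t ∙_) (conj-∏E ts))

    ∏E-ends : ∀ x y mid → ∏E (w * x ∷ mid ++ [ w * y ]) ≡ Lw ∙ (E x ∙ (∏E mid ∙ E y)) ∙ Rw
    ∏E-ends x y mid = begin
      E (w * x) ∙ ∏E (mid ++ [ w * y ])     ≡⟨ cong (E (w * x) ∙_) (∏E-++ mid [ w * y ]) ⟩
      E (w * x) ∙ (Π ∙ (E (w * y) ∙ ε))
        ≡⟨ cong₂ (λ A B → A ∙ (Π ∙ B)) (E-w*ˡ x) (trans (∙-identityʳ (E (w * y))) (E-w*ʳ y)) ⟩
      Lw ∙ E x ∙ (Π ∙ (E y ∙ Rw))           ≡⟨ ∙-assoc Lw (E x) (Π ∙ (E y ∙ Rw)) ⟩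
      Lw ∙ (E x ∙ (Π ∙ (E y ∙ Rw)))         ≡⟨ cong (λ C → Lw ∙ (E x ∙ C)) (∙-assoc Π (E y) Rw) ⟨
      Lw ∙ (E x ∙ (Π ∙ E y ∙ Rw))           ≡⟨ cong (Lw ∙_) (∙-assoc (E x) (Π ∙ E y) Rw) ⟨
      Lw ∙ (E x ∙ (Π ∙ E y) ∙ Rw)           ≡⟨ ∙-assoc Lw (E x ∙ (Π ∙ E y)) Rw ⟨
      Lw ∙ (E x ∙ (Π ∙ E y)) ∙ Rw           ∎
      where Π = ∏E mid

    γ-∏E-ends : ∀ x y mid → γ (∏E (w * x ∷ mid ++ [ w * y ])) ≡ γ (V x ∙ (∏V mid ∙ V y)) + δ
    γ-∏E-ends x y mid = begin
      γ (∏E (w * x ∷ mid ++ [ w * y ]))            ≡⟨ cong γ (∏E-ends x y mid) ⟩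
      γ (Lw ∙ (E x ∙ (∏E mid ∙ E y)) ∙ Rw)         ≡⟨ γ-Lw-Rw (E x ∙ (∏E mid ∙ E y)) ⟩
      γ (conj (E x ∙ (∏E mid ∙ E y))) + δ          ≡⟨ cong (λ A → γ A + δ) conj-inner ⟩
      γ (V x ∙ (∏V mid ∙ V y)) + δ                 ∎
      where
      conj-inner : conj (E x ∙ (∏E mid ∙ E y)) ≡ V x ∙ (∏V mid ∙ V y)
      conj-inner = trans (conj-∙ (E x) (∏E mid ∙ E y))
                         (cong (V x ∙_) (trans (conj-∙ (∏E mid) (E y)) (cong (_∙ V y) (conj-∏E mid))))

    middle : ℤ → ℤ → ℤ → List Bool → List ℤ
    middle U x y []           = []
    middle U x y (false ∷ ts) = U ∷ middle U x y ts
    middle U x y (true ∷ ts)  = y ∷ x ∷ middle U x y ts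

    runs : ℕ → List Bool → List ℕ
    runs m []           = m ∷ []
    runs m (false ∷ ts) = runs (suc m) ts
    runs m (true ∷ ts)  = m ∷ runs 0 ts

    affine-proportional : ∀ a₀ a₁ b₀ b₁ s s′ → a₀ * b₁ ≡ b₀ * a₁ →
                          (a₀ + a₁ * s) * (b₀ + b₁ * s′) ≡ (b₀ + b₁ * s) * (a₀ + a₁ * s′)
    affine-proportional a₀ a₁ b₀ b₁ s s′ prop = begin
      (a₀ + a₁ * s) * (b₀ + b₁ * s′)                                      ≡⟨ expand a₀ a₁ b₀ b₁ s s′ ⟩
      (b₀ + b₁ * s) * (a₀ + a₁ * s′) + (a₀ * b₁ - b₀ * a₁) * (s′ - s)
        ≡⟨ cong (λ c → (b₀ + b₁ * s) * (a₀ + a₁ * s′) + (c - b₀ * a₁) * (s′ - s)) prop ⟩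
      (b₀ + b₁ * s) * (a₀ + a₁ * s′) + (b₀ * a₁ - b₀ * a₁) * (s′ - s)      ≡⟨ cancel _ (b₀ * a₁) (s′ - s) ⟩
      (b₀ + b₁ * s) * (a₀ + a₁ * s′)                                      ∎
      where
      expand : ∀ a₀ a₁ b₀ b₁ s s′ →
        (a₀ + a₁ * s) * (b₀ + b₁ * s′) ≡ (b₀ + b₁ * s) * (a₀ + a₁ * s′) + (a₀ * b₁ - b₀ * a₁) * (s′ - s)
      expand = solve-∀
      cancel : ∀ p c d → p + (c - c) * d ≡ p
      cancel = solve-∀

    module Blocks (U : ℤ) where

      V^ : ℕ → Quad
      V^ zero    = ε
      V^ (suc n) = V^ n ∙ V U

      V^-comm : ∀ n → V U ∙ V^ n ≡ V^ n ∙ V U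
      V^-comm zero    = trans (∙-identityʳ (V U)) (sym (∙-identityˡ (V U)))
      V^-comm (suc n) = trans (sym (∙-assoc (V U) (V^ n) (V U))) (cong (_∙ V U) (V^-comm n))

      φ-V^ : ∀ n → φ (V^ n) ≡ V^ n
      φ-V^ zero    = refl
      φ-V^ (suc n) = trans (φ-anti (V^ n) (V U)) (trans (cong₂ _∙_ (φ-V U) (φ-V^ n)) (V^-comm n))

      block : ℤ → ℤ → ℕ → Quad
      block x y n = V x ∙ V^ n ∙ V y

      φ-block : ∀ x y n → φ (block x y n) ≡ block y x n
      φ-block x y n = begin
        φ (V x ∙ V^ n ∙ V y)           ≡⟨ φ-anti (V x ∙ V^ n) (V y) ⟩
        φ (V y) ∙ φ (V x ∙ V^ n)       ≡⟨ cong₂ _∙_ (φ-V y) (φ-anti (V x) (V^ n)) ⟩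
        V y ∙ (φ (V^ n) ∙ φ (V x))     ≡⟨ cong (V y ∙_) (cong₂ _∙_ (φ-V^ n) (φ-V x)) ⟩
        V y ∙ (V^ n ∙ V x)             ≡⟨ ∙-assoc (V y) (V^ n) (V x) ⟨
        V y ∙ V^ n ∙ V x               ∎

      ∏-blocks : ∀ x y m ts → V x ∙ V^ m ∙ (∏V (middle U x y ts) ∙ V y) ≡ ∏ (map (block x y) (runs m ts))
      ∏-blocks x y m [] = begin
        V x ∙ V^ m ∙ (ε ∙ V y)             ≡⟨ cong ((V x ∙ V^ m) ∙_) (∙-identityˡ (V y)) ⟩
        block x y m                        ≡⟨ ∙-identityʳ (block x y m) ⟨
        block x y m ∙ ε                    ∎
      ∏-blocks x y m (false ∷ ts) = begin
        V x ∙ V^ m ∙ (V U ∙ Π ∙ V y)       ≡⟨ cong ((V x ∙ V^ m) ∙_) (∙-assoc (V U) Π (V y)) ⟩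
        V x ∙ V^ m ∙ (V U ∙ (Π ∙ V y))     ≡⟨ ∙-assoc (V x ∙ V^ m) (V U) (Π ∙ V y) ⟨
        V x ∙ V^ m ∙ V U ∙ (Π ∙ V y)       ≡⟨ cong (_∙ (Π ∙ V y)) (∙-assoc (V x) (V^ m) (V U)) ⟩
        V x ∙ V^ (suc m) ∙ (Π ∙ V y)       ≡⟨ ∏-blocks x y (suc m) ts ⟩
        ∏ (map (block x y) (runs (suc m) ts)) ∎
        where Π = ∏V (middle U x y ts)
      ∏-blocks x y m (true ∷ ts) = begin
        V x ∙ V^ m ∙ (V y ∙ (V x ∙ Π) ∙ V y)    ≡⟨ cong ((V x ∙ V^ m) ∙_) (∙-assoc (V y) (V x ∙ Π) (V y)) ⟩
        V x ∙ V^ m ∙ (V y ∙ (V x ∙ Π ∙ V y))    ≡⟨ ∙-assoc (V x ∙ V^ m) (V y) (V x ∙ Π ∙ V y) ⟨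
        block x y m ∙ (V x ∙ Π ∙ V y)           ≡⟨ cong (block x y m ∙_) (∙-assoc (V x) Π (V y)) ⟩
        block x y m ∙ (V x ∙ (Π ∙ V y))         ≡⟨ cong (λ A → block x y m ∙ (A ∙ (Π ∙ V y))) (∙-identityʳ (V x)) ⟨
        block x y m ∙ (V x ∙ V^ 0 ∙ (Π ∙ V y))  ≡⟨ cong (block x y m ∙_) (∏-blocks x y 0 ts) ⟩
        block x y m ∙ ∏ (map (block x y) (runs 0 ts)) ∎
        where Π = ∏V (middle U x y ts)

      geom : ℕ → ℤ
      geom zero    = 0ℤ
      geom (suc n) = 1ℤ + Q * U * geom n

      α-V^ : ∀ n → α (V^ n) ≡ (w * U - 1ℤ) * geom n
      α-V^ zero    = sym (*-zeroʳ (w * U - 1ℤ))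
      α-V^ (suc n) = begin
        α (V U) + α (V^ n) * μ (V U)                        ≡⟨ cong (λ A → α A + α (V^ n) * μ A) (V-form U) ⟩
        (w * U - 1ℤ) + α (V^ n) * (Q * U)                   ≡⟨ cong (λ a → (w * U - 1ℤ) + a * (Q * U)) (α-V^ n) ⟩
        (w * U - 1ℤ) + (w * U - 1ℤ) * geom n * (Q * U)      ≡⟨ factor (w * U - 1ℤ) (Q * U) (geom n) ⟩
        (w * U - 1ℤ) * (1ℤ + Q * U * geom n)                ∎
        where
        factor : ∀ a m s → a + a * s * m ≡ a * (1ℤ + m * s)
        factor = solve-∀

      β-V^ : ∀ n → β (V^ n) ≡ (w * U - 1ℤ) * geom n
      β-V^ n = trans (sym (cong β (φ-V^ n))) (α-V^ n)

      μ-V^ : ∀ n → μ (V^ n) ≡ 1ℤ + (Q * U - 1ℤ) * geom n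
      μ-V^ zero    = sym (trans (cong (1ℤ +_) (*-zeroʳ (Q * U - 1ℤ))) (+-identityʳ 1ℤ))
      μ-V^ (suc n) = begin
        μ (V^ n) * μ (V U)                                  ≡⟨ cong₂ (λ m A → m * μ A) (μ-V^ n) (V-form U) ⟩
        (1ℤ + (Q * U - 1ℤ) * geom n) * (Q * U)              ≡⟨ factor (Q * U) (geom n) ⟩
        1ℤ + (Q * U - 1ℤ) * (1ℤ + Q * U * geom n)           ∎
        where
        factor : ∀ m s → (1ℤ + (m - 1ℤ) * s) * m ≡ 1ℤ + (m - 1ℤ) * (1ℤ + m * s)
        factor = solve-∀

      α₀ α₁ β₀ β₁ : ℤ → ℤ → ℤ
      α₀ x y = (w * y - 1ℤ) + (w * x - 1ℤ) * (Q * y)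
      α₁ x y = ((w * U - 1ℤ) + (w * x - 1ℤ) * (Q * U - 1ℤ)) * (Q * y)
      β₀ x y = (w * x - 1ℤ) + Q * x * (w * y - 1ℤ)
      β₁ x y = Q * x * (w * U - 1ℤ) + Q * x * (Q * U - 1ℤ) * (w * y - 1ℤ)

      α-block : ∀ x y n → α (block x y n) ≡ α₀ x y + α₁ x y * geom n
      α-block x y n = begin
        α (V y) + (α (V^ n) + α (V x) * μ (V^ n)) * μ (V y)
          ≡⟨ cong₂ (λ A B → α A + (α (V^ n) + α B * μ (V^ n)) * μ A) (V-form y) (V-form x) ⟩
        (w * y - 1ℤ) + (α (V^ n) + (w * x - 1ℤ) * μ (V^ n)) * (Q * y)
          ≡⟨ cong₂ (λ a m → (w * y - 1ℤ) + (a + (w * x - 1ℤ) * m) * (Q * y)) (α-V^ n) (μ-V^ n) ⟩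
        (w * y - 1ℤ) + ((w * U - 1ℤ) * geom n + (w * x - 1ℤ) * (1ℤ + (Q * U - 1ℤ) * geom n)) * (Q * y)
          ≡⟨ collect Q R x y U (geom n) ⟩
        α₀ x y + α₁ x y * geom n ∎
        where
        collect : ∀ Q R x y U s → let w = 1ℤ + Q * R in
          (w * y - 1ℤ) + ((w * U - 1ℤ) * s + (w * x - 1ℤ) * (1ℤ + (Q * U - 1ℤ) * s)) * (Q * y)
          ≡ ((w * y - 1ℤ) + (w * x - 1ℤ) * (Q * y)) + (((w * U - 1ℤ) + (w * x - 1ℤ) * (Q * U - 1ℤ)) * (Q * y)) * s
        collect = solve-∀

      β-block : ∀ x y n → β (block x y n) ≡ β₀ x y + β₁ x y * geom n
      β-block x y n = begin
        (β (V x) + μ (V x) * β (V^ n)) + μ (V x) * μ (V^ n) * β (V y)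
          ≡⟨ cong₂ (λ A B → (β A + μ A * β (V^ n)) + μ A * μ (V^ n) * β B) (V-form x) (V-form y) ⟩
        (w * x - 1ℤ + Q * x * β (V^ n)) + Q * x * μ (V^ n) * (w * y - 1ℤ)
          ≡⟨ cong₂ (λ b m → (w * x - 1ℤ + Q * x * b) + Q * x * m * (w * y - 1ℤ)) (β-V^ n) (μ-V^ n) ⟩
        (w * x - 1ℤ + Q * x * ((w * U - 1ℤ) * geom n)) + Q * x * (1ℤ + (Q * U - 1ℤ) * geom n) * (w * y - 1ℤ)
          ≡⟨ collect Q R x y U (geom n) ⟩
        β₀ x y + β₁ x y * geom n ∎
        where
        collect : ∀ Q R x y U s → let w = 1ℤ + Q * R in
          (w * x - 1ℤ + Q * x * ((w * U - 1ℤ) * s)) + Q * x * (1ℤ + (Q * U - 1ℤ) * s) * (w * y - 1ℤ)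
          ≡ ((w * x - 1ℤ) + Q * x * (w * y - 1ℤ)) + (Q * x * (w * U - 1ℤ) + Q * x * (Q * U - 1ℤ) * (w * y - 1ℤ)) * s
        collect = solve-∀

    module Proportional (x y : ℤ) where
      open Blocks (w * x * y)

      coefficients-proportional : α₀ x y * β₁ x y ≡ β₀ x y * α₁ x y
      coefficients-proportional = identity Q R x y
        where
        identity : ∀ Q R x y → let w = 1ℤ + Q * R ; U = w * x * y in
          ((w * y - 1ℤ) + (w * x - 1ℤ) * (Q * y)) * (Q * x * (w * U - 1ℤ) + Q * x * (Q * U - 1ℤ) * (w * y - 1ℤ))
          ≡ ((w * x - 1ℤ) + Q * x * (w * y - 1ℤ)) * (((w * U - 1ℤ) + (w * x - 1ℤ) * (Q * U - 1ℤ)) * (Q * y))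
        identity = solve-∀

      block-proportional : ∀ n m → α (block x y n) * β (block x y m) ≡ β (block x y n) * α (block x y m)
      block-proportional n m = begin
        α (block x y n) * β (block x y m)                         ≡⟨ cong₂ _*_ (α-block x y n) (β-block x y m) ⟩
        (α₀ x y + α₁ x y * geom n) * (β₀ x y + β₁ x y * geom m)
          ≡⟨ affine-proportional (α₀ x y) (α₁ x y) (β₀ x y) (β₁ x y) (geom n) (geom m) coefficients-proportional ⟩
        (β₀ x y + β₁ x y * geom n) * (α₀ x y + α₁ x y * geom m)   ≡⟨ cong₂ _*_ (β-block x y n) (α-block x y m) ⟨
        β (block x y n) * α (block x y m)                         ∎

    γ-∏E-swap : ∀ x y ts → γ (∏E (w * x ∷ middle (w * x * y) x y ts ++ [ w * y ]))
                         ≡ γ (∏E (w * y ∷ middle (w * x * y) y x ts ++ [ w * x ]))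
    γ-∏E-swap x y ts = begin
      γ (∏E (w * x ∷ middle U x y ts ++ [ w * y ]))       ≡⟨ γ-∏E-ends x y (middle U x y ts) ⟩
      γ (V x ∙ (∏V (middle U x y ts) ∙ V y)) + δ         ≡⟨ cong (λ A → γ A + δ) (split x y) ⟩
      γ (∏ (map (block x y) (runs 0 ts))) + δ
        ≡⟨ cong (_+ δ) (γ-∏-φ (block x y) block-proportional (runs 0 ts)) ⟩
      γ (∏ (map (φ ∘ block x y) (runs 0 ts))) + δ
        ≡⟨ cong (λ Bs → γ (∏ Bs) + δ) (map-cong (φ-block x y) (runs 0 ts)) ⟩
      γ (∏ (map (block y x) (runs 0 ts))) + δ            ≡⟨ cong (λ A → γ A + δ) (split y x) ⟨
      γ (V y ∙ (∏V (middle U y x ts) ∙ V x)) + δ         ≡⟨ γ-∏E-ends y x (middle U y x ts) ⟨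
      γ (∏E (w * y ∷ middle U y x ts ++ [ w * x ]))       ∎
      where
      U = w * x * y
      open Blocks U
      open Proportional x y using (block-proportional)
      split : ∀ x y → V x ∙ (∏V (middle U x y ts) ∙ V y) ≡ ∏ (map (block x y) (runs 0 ts))
      split x y = trans (cong (_∙ (∏V (middle U x y ts) ∙ V y)) (sym (∙-identityʳ (V x)))) (∏-blocks x y 0 ts)

module SubtreeSumQuads where

  open import Data.Bool using (true; false)
  open import Data.Integer using (ℤ; _+_; _*_; _-_; +_; 1ℤ; 0ℤ)
  open import Data.Integer.Properties using (pos-+; pos-*; +-injective)
  open import Data.Integer.Tactic.RingSolver using (solve-∀)
  open import Data.List using (List; []; _∷_; map; length)
  import Data.Nat as ℕ
  open import Data.Nat using (ℕ)
  open import Data.Nat.Properties using (suc-injective)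
  open import Relation.Binary.PropositionalEquality
  open ≡-Reasoning
  open Quads
  open CaterpillarQuads
  open Automaton using (module Weights)
  open TransferSums using (module Evaluation)

  module SumAsQuad (Q R : ℕ) where
    open Weights Q R using (leafFactor)
    open TransferSums.Evaluation Q R
    open Quads.QuadMonoid (+ Q)
    open CaterpillarQuads.Transfer (+ Q) (+ R)

    Y : ℕ → ℤ
    Y c = + allPendants c

    somePendants≡Y-1 : ∀ c → + somePendants c ≡ Y c - 1ℤ
    somePendants≡Y-1 c = trans (lemma (+ somePendants c))
      (cong (_- 1ℤ) (sym (trans (cong +_ (allPendants≡somePendants+1 c)) (pos-+ (somePendants c) 1))))
      where
      lemma : ∀ a → a ≡ (a + 1ℤ) - 1ℤ
      lemma = solve-∀

    private
      openSum-∷ : ∀ d c cs → + openSum d (c ∷ cs)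
                  ≡ (Y c - 1ℤ) * + leafFactor d + + R + Y c * + leafFactor d * + Q * + openSum false cs
      openSum-∷ d c cs = begin
        + (somePendants c ℕ.* leafFactor d ℕ.+ R ℕ.+ allPendants c ℕ.* leafFactor d ℕ.* Q ℕ.* openSum false cs)
          ≡⟨ pos-+ (somePendants c ℕ.* leafFactor d ℕ.+ R) _ ⟩
        + (somePendants c ℕ.* leafFactor d ℕ.+ R) + + (allPendants c ℕ.* leafFactor d ℕ.* Q ℕ.* openSum false cs)
          ≡⟨ cong₂ _+_ (trans (pos-+ (somePendants c ℕ.* leafFactor d) R) (cong (_+ + R) (pos-* (somePendants c) (leafFactor d))))
                       (trans (pos-* (allPendants c ℕ.* leafFactor d ℕ.* Q) _) (cong (_* + openSum false cs)
                              (trans (pos-* (allPendants c ℕ.* leafFactor d) Q) (cong (_* + Q) (pos-* (allPendants c) (leafFactor d)))))) ⟩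
        + somePendants c * + leafFactor d + + R + Y c * + leafFactor d * + Q * + openSum false cs
          ≡⟨ cong (λ a → a * + leafFactor d + + R + Y c * + leafFactor d * + Q * + openSum false cs) (somePendants≡Y-1 c) ⟩
        (Y c - 1ℤ) * + leafFactor d + + R + Y c * + leafFactor d * + Q * + openSum false cs ∎

    openSum≡β : ∀ cs → + openSum false cs ≡ β (∏E (map Y cs))
    openSum≡β []       = refl
    openSum≡β (c ∷ cs) = begin
      + openSum false (c ∷ cs)                                         ≡⟨ openSum-∷ false c cs ⟩
      (Y c - 1ℤ) * 1ℤ + + R + Y c * 1ℤ * + Q * + openSum false cs
        ≡⟨ cong (λ o → (Y c - 1ℤ) * 1ℤ + + R + Y c * 1ℤ * + Q * o) (openSum≡β cs) ⟩
      (Y c - 1ℤ) * 1ℤ + + R + Y c * 1ℤ * + Q * β (∏E (map Y cs))        ≡⟨ lemma (Y c) (+ R) (+ Q) (β (∏E (map Y cs))) ⟩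
      β (E (Y c) ∙ ∏E (map Y cs))                                      ∎
      where
      lemma : ∀ t r q b → (t - 1ℤ) * 1ℤ + r + t * 1ℤ * q * b ≡ (t - 1ℤ + r) + (q * t) * b
      lemma = solve-∀

    -- The two open sums differ by a term that only depends on whether the list is empty.
    openSumCorrection : List ℕ → ℤ
    openSumCorrection []      = 0ℤ
    openSumCorrection (_ ∷ _) = + R - + R * + R

    openSum-true : ∀ cs → + openSum true cs ≡ + R * + openSum false cs + openSumCorrection cs
    openSum-true []       = lemma (+ R)
      where
      lemma : ∀ r → 0ℤ ≡ r * 0ℤ + 0ℤ
      lemma = solve-∀
    openSum-true (c ∷ cs) = begin
      + openSum true (c ∷ cs)                                                  ≡⟨ openSum-∷ true c cs ⟩
      (Y c - 1ℤ) * + R + + R + Y c * + R * + Q * o                             ≡⟨ lemma (Y c) (+ R) (+ Q) o ⟩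
      + R * ((Y c - 1ℤ) * 1ℤ + + R + Y c * 1ℤ * + Q * o) + (+ R - + R * + R)
        ≡⟨ cong (λ z → + R * z + (+ R - + R * + R)) (openSum-∷ false c cs) ⟨
      + R * + openSum false (c ∷ cs) + openSumCorrection (c ∷ cs)              ∎
      where
      o = + openSum false cs
      lemma : ∀ t r q o → (t - 1ℤ) * r + r + t * r * q * o ≡ r * ((t - 1ℤ) * 1ℤ + r + t * 1ℤ * q * o) + (r - r * r)
      lemma = solve-∀

    subtreeSumCorrection : List ℕ → ℤ
    subtreeSumCorrection []       = 0ℤ
    subtreeSumCorrection (_ ∷ cs) = + Q * openSumCorrection cs + subtreeSumCorrection cs

    subtreeSumCorrection-length : ∀ xs ys → length xs ≡ length ys → subtreeSumCorrection xs ≡ subtreeSumCorrection ys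
    subtreeSumCorrection-length []           []           _   = refl
    subtreeSumCorrection-length (_ ∷ [])     (_ ∷ [])     _   = refl
    subtreeSumCorrection-length (_ ∷ x ∷ xs) (_ ∷ y ∷ ys) len =
      cong (λ k → + Q * (+ R - + R * + R) + k) (subtreeSumCorrection-length (x ∷ xs) (y ∷ ys) (suc-injective len))

    subtreeSum⁺≡γ : ∀ cs → + subtreeSum⁺ cs ≡ γ (∏E (map Y cs)) + subtreeSumCorrection cs
    subtreeSum⁺≡γ []       = refl
    subtreeSum⁺≡γ (c ∷ cs) = begin
      + (subtreeSum⁺ cs ℕ.+ somePendants c ℕ.+ Q ℕ.* openSum true cs ℕ.+ Q ℕ.* somePendants c ℕ.* openSum false cs)
        ≡⟨ trans (pos-+ (subtreeSum⁺ cs ℕ.+ somePendants c ℕ.+ Q ℕ.* openSum true cs) _)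
                 (cong₂ _+_ (trans (pos-+ (subtreeSum⁺ cs ℕ.+ somePendants c) _)
                                   (cong₂ _+_ (pos-+ (subtreeSum⁺ cs) (somePendants c)) (pos-* Q (openSum true cs))))
                            (trans (pos-* (Q ℕ.* somePendants c) (openSum false cs)) (cong (_* + openSum false cs) (pos-* Q (somePendants c))))) ⟩
      + subtreeSum⁺ cs + A + + Q * + openSum true cs + + Q * A * + openSum false cs
        ≡⟨ cong₂ (λ s o₁ → s + A + + Q * o₁ + + Q * A * + openSum false cs) (subtreeSum⁺≡γ cs) (openSum-true cs) ⟩
      (g + k) + A + + Q * (+ R * + openSum false cs + oc) + + Q * A * + openSum false cs
        ≡⟨ cong₂ (λ a o → (g + k) + a + + Q * (+ R * o + oc) + + Q * a * o) (somePendants≡Y-1 c) (openSum≡β cs) ⟩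
      (g + k) + (Y c - 1ℤ) + + Q * (+ R * b + oc) + + Q * (Y c - 1ℤ) * b
        ≡⟨ lemma g k (Y c) (+ Q) (+ R) b oc ⟩
      ((Y c - 1ℤ) + g + + Q * (Y c - 1ℤ + + R) * b) + (+ Q * oc + k)
        ∎
      where
      A  = + somePendants c
      X  = ∏E (map Y cs)
      g  = γ X
      b  = β X
      k  = subtreeSumCorrection cs
      oc = openSumCorrection cs
      lemma : ∀ g k t q r b s → (g + k) + (t - 1ℤ) + q * (r * b + s) + q * (t - 1ℤ) * b
                               ≡ ((t - 1ℤ) + g + q * (t - 1ℤ + r) * b) + (q * s + k)
      lemma = solve-∀

    subtreeSum⁺-cong : ∀ xs ys → length xs ≡ length ys → γ (∏E (map Y xs)) ≡ γ (∏E (map Y ys)) →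
                       subtreeSum⁺ xs ≡ subtreeSum⁺ ys
    subtreeSum⁺-cong xs ys len γ≡ =
      +-injective (trans (subtreeSum⁺≡γ xs) (trans (cong₂ _+_ γ≡ (subtreeSumCorrection-length xs ys len)) (sym (subtreeSum⁺≡γ ys))))

module Tokens where

  open import Data.Bool using (Bool; true; false)
  open import Data.Empty using (⊥-elim)
  open import Data.List using (List; []; _∷_; _++_; _∷ʳ_; [_]; map; zipWith; length; reverse; concatMap)
  open import Data.List.Properties using (reverse-++; unfold-reverse; reverse-involutive; length-++)
  open import Data.List.Relation.Unary.All using (All; []; _∷_)
  open import Data.List.Relation.Unary.All.Properties using (++⁺)
  open import Data.Nat using (ℕ; suc; _+_; _*_; _∸_; _≤_; z≤n; s≤s)
  open import Data.Nat.Properties using (+-identityʳ; *-identityʳ; *-zeroʳ; +-comm; +-assoc; m≤m+n; ≤-trans)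
  open import Function using (_∘_)
  open import Data.Nat.Tactic.RingSolver using (solve-∀)
  open import Data.Product using (Σ-syntax; _,_)
  open import Data.Sum using (_⊎_; inj₁; inj₂)
  open import Relation.Binary.PropositionalEquality using (_≡_; refl; sym; trans; cong; cong₂; subst; module ≡-Reasoning)
  open ≡-Reasoning
  open import Relation.Nullary using (¬_)
  open import Defs
  open Sums using (sum-map-++)
  open TransferSums using (#pendants)

  -- A gap-free polynomial is 1 followed by a word in the blocks 1 (`false`) and 0 1 (`true`).
  tokenCoeffs : Bool → List ℕ
  tokenCoeffs false = 1 ∷ []
  tokenCoeffs true  = 0 ∷ 1 ∷ []

  private
    EmptyOrEndsIn1 : List ℕ → Set
    EmptyOrEndsIn1 xs = xs ≡ [] ⊎ Σ[ zs ∈ List ℕ ] xs ≡ zs ∷ʳ 1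

    tail-endsIn1 : ∀ x xs → EmptyOrEndsIn1 (x ∷ xs) → EmptyOrEndsIn1 xs
    tail-endsIn1 x xs (inj₂ ([]     , refl)) = inj₁ refl
    tail-endsIn1 x xs (inj₂ (z ∷ zs , refl)) = inj₂ (zs , refl)

    tokenise : ∀ xs → All (λ c → c ≡ 0 ⊎ c ≡ 1) xs → (∀ us vs → ¬ (1 ∷ xs ≡ us ++ 0 ∷ 0 ∷ vs)) →
               EmptyOrEndsIn1 xs →
               Σ[ ts ∈ List Bool ] xs ≡ concatMap tokenCoeffs ts
    tokenise []       _                        _     _   = [] , refl
    tokenise (x ∷ xs) (inj₂ refl ∷ bits) noGap end
      with tokenise xs bits (λ us vs eq → noGap (1 ∷ us) vs (cong (1 ∷_) eq)) (tail-endsIn1 x xs end)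
    ... | ts , eq = false ∷ ts , cong (1 ∷_) eq
    tokenise (x ∷ [])     (inj₁ refl ∷ _) _ (inj₂ ([] , ()))
    tokenise (x ∷ [])     (inj₁ refl ∷ _) _ (inj₂ (_ ∷ [] , ()))
    tokenise (x ∷ [])     (inj₁ refl ∷ _) _ (inj₂ (_ ∷ _ ∷ _ , ()))
    tokenise (x ∷ y ∷ xs) (inj₁ refl ∷ inj₁ refl ∷ _) noGap _ = ⊥-elim (noGap (1 ∷ []) xs refl)
    tokenise (x ∷ y ∷ xs) (inj₁ refl ∷ inj₂ refl ∷ bits) noGap end
      with tokenise xs bits (λ us vs eq → noGap (1 ∷ 0 ∷ us) vs (cong (λ zs → 1 ∷ 0 ∷ zs) eq))
                    (tail-endsIn1 y xs (tail-endsIn1 x (y ∷ xs) end))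
    ... | ts , eq = true ∷ ts , cong (λ zs → 0 ∷ 1 ∷ zs) eq

  gapFree⇒tokens : ∀ p → GapFree p → Σ[ ts ∈ List Bool ] p ≡ 1 ∷ concatMap tokenCoeffs ts
  gapFree⇒tokens p gf with GapFree.constOne gf | GapFree.zeroOne gf
  ... | xs , refl | _ ∷ bits with tokenise xs bits (GapFree.noGap gf) (tail-endsIn1 1 xs (inj₂ (GapFree.leadingOne gf)))
  ...   | ts , eq = ts , cong (1 ∷_) eq

  -- The coefficients of (a + b x) p(x) contributed by one block of p.
  tokenEntries : ℕ → ℕ → Bool → List ℕ
  tokenEntries a b false = a + b ∷ []
  tokenEntries a b true  = b ∷ a ∷ []

  catSeq : ℕ → ℕ → List Bool → List ℕ
  catSeq a b ts = suc a ∷ concatMap (tokenEntries a b) ts ++ [ suc b ]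

  private
    -- `mulLin a b` with the carry `h` from the previous coefficient made explicit.
    mulLinFrom : ℕ → ℕ → ℕ → List ℕ → List ℕ
    mulLinFrom a b h []       = h ∷ []
    mulLinFrom a b h (x ∷ xs) = a * x + h ∷ mulLinFrom a b (b * x) xs

    zipWith≡mulLinFrom : ∀ a b h xs → zipWith _+_ (map (a *_) xs ∷ʳ 0) (h ∷ map (b *_) xs) ≡ mulLinFrom a b h xs
    zipWith≡mulLinFrom a b h []       = refl
    zipWith≡mulLinFrom a b h (x ∷ xs) = cong (a * x + h ∷_) (zipWith≡mulLinFrom a b (b * x) xs)

    mulLinFrom-tokens : ∀ a b ts → mulLinFrom a b (b * 1) (concatMap tokenCoeffs ts) ≡ concatMap (tokenEntries a b) ts ++ [ b ]
    mulLinFrom-tokens a b []           = cong [_] (*-identityʳ b)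
    mulLinFrom-tokens a b (false ∷ ts) = cong₂ _∷_ (cong₂ _+_ (*-identityʳ a) (*-identityʳ b)) (mulLinFrom-tokens a b ts)
    mulLinFrom-tokens a b (true ∷ ts)  =
      cong₂ _∷_ (trans (cong (_+ b * 1) (*-zeroʳ a)) (*-identityʳ b))
                (cong₂ _∷_ (trans (cong₂ _+_ (*-identityʳ a) (*-zeroʳ b)) (+-identityʳ a)) (mulLinFrom-tokens a b ts))

    incLast-++ : ∀ xs z → incLast (xs ++ [ z ]) ≡ xs ++ [ suc z ]
    incLast-++ xs z = begin
      reverse (incHead (reverse (xs ++ [ z ])))   ≡⟨ cong (reverse ∘ incHead) (reverse-++ xs [ z ]) ⟩
      reverse (suc z ∷ reverse xs)                ≡⟨ unfold-reverse (suc z) (reverse xs) ⟩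
      reverse (reverse xs) ++ [ suc z ]           ≡⟨ cong (_++ [ suc z ]) (reverse-involutive xs) ⟩
      xs ++ [ suc z ]                             ∎

  L₁-tokens : ∀ a b ts → L₁ a b (1 ∷ concatMap tokenCoeffs ts) ≡ catSeq a b ts
  L₁-tokens a b ts = begin
    addEnds (mulLin a b (1 ∷ concatMap tokenCoeffs ts))
      ≡⟨ cong addEnds (zipWith≡mulLinFrom a b 0 (1 ∷ concatMap tokenCoeffs ts)) ⟩
    addEnds (a * 1 + 0 ∷ mulLinFrom a b (b * 1) (concatMap tokenCoeffs ts))
      ≡⟨ cong addEnds (cong₂ _∷_ (trans (+-identityʳ (a * 1)) (*-identityʳ a)) (mulLinFrom-tokens a b ts)) ⟩
    incLast (suc a ∷ concatMap (tokenEntries a b) ts ++ [ b ])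
      ≡⟨ incLast-++ (suc a ∷ concatMap (tokenEntries a b) ts) b ⟩
    catSeq a b ts ∎

  L₂-tokens : ∀ a b ts → L₂ a b (1 ∷ concatMap tokenCoeffs ts) ≡ catSeq b a ts
  L₂-tokens a b ts = L₁-tokens b a ts

  length-catSeq : ∀ a b ts → length (catSeq a b ts) ≡ length (catSeq b a ts)
  length-catSeq a b ts = cong suc (trans (length-++ (concatMap (tokenEntries a b) ts)) (trans (cong (_+ 1) (entries ts))
                                         (sym (length-++ (concatMap (tokenEntries b a) ts)))))
    where
    entries : ∀ ts → length (concatMap (tokenEntries a b) ts) ≡ length (concatMap (tokenEntries b a) ts)
    entries []           = refl
    entries (false ∷ ts) = cong suc (entries ts)
    entries (true ∷ ts)  = cong (suc ∘ suc) (entries ts)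

  #pendants-catSeq : ∀ a b ts → #pendants (catSeq a b ts) ≡ a + (#pendants (concatMap (tokenEntries a b) ts) + (b + 0))
  #pendants-catSeq a b ts = cong (a +_) (sum-map-++ (λ c → c ∸ 1) (concatMap (tokenEntries a b) ts) [ suc b ])

  #pendants-catSeq-swap : ∀ a b ts → #pendants (catSeq a b ts) ≡ #pendants (catSeq b a ts)
  #pendants-catSeq-swap a b ts = begin
    #pendants (catSeq a b ts)                                  ≡⟨ #pendants-catSeq a b ts ⟩
    a + (#pendants (concatMap (tokenEntries a b) ts) + (b + 0)) ≡⟨ cong (λ n → a + (n + (b + 0))) (entries ts) ⟩
    a + (#pendants (concatMap (tokenEntries b a) ts) + (b + 0))
      ≡⟨ swap a b (#pendants (concatMap (tokenEntries b a) ts)) ⟩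
    b + (#pendants (concatMap (tokenEntries b a) ts) + (a + 0)) ≡⟨ #pendants-catSeq b a ts ⟨
    #pendants (catSeq b a ts)                                  ∎
    where
    swap : ∀ a b n → a + (n + (b + 0)) ≡ b + (n + (a + 0))
    swap = solve-∀
    entries : ∀ ts → #pendants (concatMap (tokenEntries a b) ts) ≡ #pendants (concatMap (tokenEntries b a) ts)
    entries []           = refl
    entries (false ∷ ts) = cong₂ _+_ (cong (_∸ 1) (+-comm a b)) (entries ts)
    entries (true ∷ ts)  = trans (sym (+-assoc (b ∸ 1) (a ∸ 1) _))
                                 (trans (cong₂ _+_ (+-comm (b ∸ 1) (a ∸ 1)) (entries ts)) (+-assoc (a ∸ 1) (b ∸ 1) _))

  #pendants-catSeq-positive : ∀ a b ts → 1 ≤ a → 1 ≤ #pendants (catSeq a b ts)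
  #pendants-catSeq-positive a b ts 1≤a = subst (1 ≤_) (sym (#pendants-catSeq a b ts)) (≤-trans 1≤a (m≤m+n a _))

  isCatSeq-catSeq : ∀ a b ts → 1 ≤ a → 1 ≤ b → IsCatSeq (catSeq a b ts)
  isCatSeq-catSeq a b ts 1≤a 1≤b = record
    { positive = s≤s z≤n ∷ ++⁺ (entries-positive ts) (s≤s z≤n ∷ [])
    ; firstBig = suc a , concatMap (tokenEntries a b) ts ++ [ suc b ] , refl , s≤s 1≤a
    ; lastBig  = suc b , suc a ∷ concatMap (tokenEntries a b) ts , refl , s≤s 1≤b
    }
    where
    entries-positive : ∀ ts → All (1 ≤_) (concatMap (tokenEntries a b) ts)
    entries-positive []           = []
    entries-positive (false ∷ ts) = ≤-trans 1≤a (m≤m+n a b) ∷ entries-positive ts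
    entries-positive (true ∷ ts)  = 1≤b ∷ 1≤a ∷ entries-positive ts

module CatSeqSymmetry where

  open import Data.Bool using (true; false)
  open import Data.Integer using (ℤ; _*_; +_; 1ℤ)
  import Data.Integer as ℤ
  open import Data.Integer.Properties using (pos-+; pos-*)
  open import Data.Integer.Tactic.RingSolver using (solve-∀)
  open import Data.List using ([]; _∷_; _++_; [_]; map; concatMap; length)
  open import Data.List.Properties using (map-++)
  open import Data.Nat using (ℕ; suc; _+_; _∸_; _≤_)
  import Data.Nat as ℕ
  open import Data.Nat.Properties using (+-comm; ^-distribˡ-+-*)
  open import Data.Product using (_×_; _,_; proj₁; proj₂)
  open import Function using (_∘_)
  open import Relation.Binary.PropositionalEquality using (_≡_; refl; trans; cong; cong₂; module ≡-Reasoning)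
  open ≡-Reasoning
  open Quads using (γ)
  open CaterpillarQuads using (module Transfer)
  open SubtreeSumQuads using (module SumAsQuad)
  open Tokens
  open import Defs using (Cat; nV; edges)
  open SelectedEdges using (length-edges-Cat)
  open SubtreeWeights using (subtreeWeight; subtreeWeight-Cat)
  open TransferSums using (#pendants)

  module _ (Q R : ℕ) where
    open TransferSums.Evaluation Q R
    open Transfer (+ Q) (+ R)
    open SumAsQuad Q R

    +y≡w : + y ≡ w
    +y≡w = trans (pos-+ 1 (Q ℕ.* R)) (cong (λ n → 1ℤ ℤ.+ n) (pos-* Q R))

    -- With x = y ^ (a - 1) and z = y ^ (b - 1), the entries a + 1, b + 1 and a + b have Y = w x, w z
    -- and w x z, and the entries a and b have Y = x and z.
    module Ends (a′ b′ : ℕ) where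
      a b : ℕ
      a = suc a′
      b = suc b′

      x z U : ℤ
      x = + (y ℕ.^ a′)
      z = + (y ℕ.^ b′)
      U = w * x * z

      Y-end : ∀ n → Y (suc (suc n)) ≡ w * + (y ℕ.^ n)
      Y-end n = trans (pos-* y (y ℕ.^ n)) (cong (_* + (y ℕ.^ n)) +y≡w)

      Y-inner : Y (a + b) ≡ U
      Y-inner = begin
        + (y ℕ.^ (a′ + suc b′))                ≡⟨ cong +_ (^-distribˡ-+-* y a′ (suc b′)) ⟩
        + (y ℕ.^ a′ ℕ.* (y ℕ.* y ℕ.^ b′))      ≡⟨ trans (pos-* (y ℕ.^ a′) _) (cong (x *_) (Y-end b′)) ⟩
        x * (w * z)                            ≡⟨ rearrange x w z ⟩
        U                                      ∎
        where
        rearrange : ∀ x w z → x * (w * z) ≡ w * x * z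
        rearrange = solve-∀

      Y-entries : ∀ ts → map Y (concatMap (tokenEntries a b) ts) ≡ middle U x z ts
                       × map Y (concatMap (tokenEntries b a) ts) ≡ middle U z x ts
      Y-entries []           = refl , refl
      Y-entries (false ∷ ts) = let l , r = Y-entries ts in
        cong₂ _∷_ Y-inner l , cong₂ _∷_ (trans (cong Y (+-comm b a)) Y-inner) r
      Y-entries (true ∷ ts)  = let l , r = Y-entries ts in cong (λ m → z ∷ x ∷ m) l , cong (λ m → x ∷ z ∷ m) r

      Y-catSeq : ∀ ts → map Y (catSeq a b ts) ≡ w * x ∷ middle U x z ts ++ [ w * z ]
                      × map Y (catSeq b a ts) ≡ w * z ∷ middle U z x ts ++ [ w * x ]
      Y-catSeq ts = let l , r = Y-entries ts in
        cong₂ _∷_ (Y-end a′) (trans (map-++ Y (concatMap (tokenEntries a b) ts) [ suc b ]) (cong₂ _++_ l (cong [_] (Y-end b′)))) ,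
        cong₂ _∷_ (Y-end b′) (trans (map-++ Y (concatMap (tokenEntries b a) ts) [ suc a ]) (cong₂ _++_ r (cong [_] (Y-end a′))))

    subtreeSum⁺-catSeq : ∀ a b ts → 1 ≤ a → 1 ≤ b → subtreeSum⁺ (catSeq a b ts) ≡ subtreeSum⁺ (catSeq b a ts)
    subtreeSum⁺-catSeq (suc a′) (suc b′) ts _ _ =
      subtreeSum⁺-cong (catSeq (suc a′) (suc b′) ts) (catSeq (suc b′) (suc a′) ts) (length-catSeq (suc a′) (suc b′) ts) (begin
      γ (∏E (map Y (catSeq (suc a′) (suc b′) ts)))       ≡⟨ cong (γ ∘ ∏E) l ⟩
      γ (∏E (w * x ∷ middle U x z ts ++ [ w * z ]))     ≡⟨ γ-∏E-swap x z ts ⟩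
      γ (∏E (w * z ∷ middle U z x ts ++ [ w * x ]))     ≡⟨ cong (γ ∘ ∏E) r ⟨
      γ (∏E (map Y (catSeq (suc b′) (suc a′) ts)))       ∎)
      where
      open Ends a′ b′
      l : map Y (catSeq (suc a′) (suc b′) ts) ≡ w * x ∷ middle U x z ts ++ [ w * z ]
      l = proj₁ (Y-catSeq ts)
      r : map Y (catSeq (suc b′) (suc a′) ts) ≡ w * z ∷ middle U z x ts ++ [ w * x ]
      r = proj₂ (Y-catSeq ts)

  nV-Cat-catSeq-swap : ∀ a b ts → nV (Cat (catSeq a b ts)) ≡ nV (Cat (catSeq b a ts))
  nV-Cat-catSeq-swap a b ts = cong₂ _+_ (length-catSeq a b ts) (#pendants-catSeq-swap a b ts)

  #edges-Cat-catSeq-swap : ∀ a b ts → length (edges (Cat (catSeq a b ts))) ≡ length (edges (Cat (catSeq b a ts)))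
  #edges-Cat-catSeq-swap a b ts = begin
    length (edges (Cat (catSeq a b ts)))                         ≡⟨ length-edges-Cat (catSeq a b ts) ⟩
    length (catSeq a b ts) ∸ 1 + #pendants (catSeq a b ts)
      ≡⟨ cong₂ (λ k n → k ∸ 1 + n) (length-catSeq a b ts) (#pendants-catSeq-swap a b ts) ⟩
    length (catSeq b a ts) ∸ 1 + #pendants (catSeq b a ts)       ≡⟨ length-edges-Cat (catSeq b a ts) ⟨
    length (edges (Cat (catSeq b a ts)))                         ∎

  subtreeWeight-catSeq-swap : ∀ Q R a b ts → 1 ≤ a → 1 ≤ b →
                              subtreeWeight Q R (Cat (catSeq a b ts)) ≡ subtreeWeight Q R (Cat (catSeq b a ts))
  subtreeWeight-catSeq-swap Q R a b ts 1≤a 1≤b = begin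
    subtreeWeight Q R (Cat (catSeq a b ts))
      ≡⟨ subtreeWeight-Cat Q R (catSeq a b ts) (#pendants-catSeq-positive a b ts 1≤a) ⟩
    nV (Cat (catSeq a b ts)) + subtreeSum⁺ Q R (catSeq a b ts)
      ≡⟨ cong₂ _+_ (nV-Cat-catSeq-swap a b ts) (subtreeSum⁺-catSeq Q R a b ts 1≤a 1≤b) ⟩
    nV (Cat (catSeq b a ts)) + subtreeSum⁺ Q R (catSeq b a ts)
      ≡⟨ subtreeWeight-Cat Q R (catSeq b a ts) (#pendants-catSeq-positive b a ts 1≤b) ⟨
    subtreeWeight Q R (Cat (catSeq b a ts))                      ∎
    where open TransferSums.Evaluation using (subtreeSum⁺)

module DigitExtraction where

  open import Data.Bool using (Bool; true; false; _∧_)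
  open import Data.List using (List; []; _∷_; map; length)
  open import Data.List.Relation.Unary.All using (All; []; _∷_)
  open import Data.Nat using (ℕ; zero; suc; _+_; _*_; _≤_; _<_; _≡ᵇ_; _^_; z≤n; s≤s)
  open import Data.Nat.DivMod using (_%_; [m+kn]%n≡m%n; m<n⇒m%n≡m)
  open import Data.Nat.ListAction using (sum)
  open import Data.Nat.Properties
  open import Data.Nat.Tactic.RingSolver using (solve-∀)
  open import Data.Product using (_×_; _,_)
  open import Relation.Binary.PropositionalEquality
  open Booleans

  base-digit-unique : ∀ B a b X Y → a < B → b < B → a + B * X ≡ b + B * Y → a ≡ b × X ≡ Y
  base-digit-unique B@(suc _) a b X Y a<B b<B eq =
    a≡b , *-cancelˡ-≡ X Y B (+-cancelˡ-≡ a (B * X) (B * Y) (trans eq (cong (_+ B * Y) (sym a≡b))))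
    where
    low : ∀ c Z → c < B → (c + B * Z) % B ≡ c
    low c Z c<B = trans (cong (λ n → (c + n) % B) (*-comm B Z)) (trans ([m+kn]%n≡m%n c Z B) (m<n⇒m%n≡m c<B))
    a≡b : a ≡ b
    a≡b = trans (sym (low a X a<B)) (trans (cong (_% B) eq) (low b Y b<B))

  evalDigits : (ℕ → ℕ) → ℕ → ℕ → ℕ
  evalDigits d B zero    = 0
  evalDigits d B (suc M) = d 0 + B * evalDigits (λ t → d (suc t)) B M

  evalDigits-injective : ∀ B M d d′ → (∀ t → d t < B) → (∀ t → d′ t < B) →
                         evalDigits d B M ≡ evalDigits d′ B M → ∀ t → t < M → d t ≡ d′ t
  evalDigits-injective B (suc M) d d′ d< d′< eq t t<M with base-digit-unique B (d 0) (d′ 0) _ _ (d< 0) (d′< 0) eq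
  evalDigits-injective B (suc M) d d′ d< d′< eq zero    _          | d₀≡ , _  = d₀≡
  evalDigits-injective B (suc M) d d′ d< d′< eq (suc t) (s≤s t<M) | _ , rest≡ =
    evalDigits-injective B M (λ t → d (suc t)) (λ t → d′ (suc t)) (λ t → d< (suc t)) (λ t → d′< (suc t)) rest≡ t t<M

  evalDigits-+ : ∀ B M d d′ → evalDigits (λ t → d t + d′ t) B M ≡ evalDigits d B M + evalDigits d′ B M
  evalDigits-+ B zero    d d′ = refl
  evalDigits-+ B (suc M) d d′ = trans (cong (λ e → d 0 + d′ 0 + B * e) (evalDigits-+ B M _ _))
                                      (interchange (d 0) (d′ 0) B (evalDigits (λ t → d (suc t)) B M) _)
    where
    interchange : ∀ x y B p q → x + y + B * (p + q) ≡ x + B * p + (y + B * q)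
    interchange = solve-∀

  evalDigits-0 : ∀ B M → evalDigits (λ _ → 0) B M ≡ 0
  evalDigits-0 B zero    = refl
  evalDigits-0 B (suc M) = trans (cong (B *_) (evalDigits-0 B M)) (*-zeroʳ B)

  evalDigits-single : ∀ B M s → s < M → evalDigits (λ t → ind (s ≡ᵇ t)) B M ≡ B ^ s
  evalDigits-single B (suc M) zero    _         = trans (cong (λ e → 1 + B * e) (evalDigits-0 B M)) (cong suc (*-zeroʳ B))
  evalDigits-single B (suc M) (suc s) (s≤s s<M) = cong (B *_) (evalDigits-single B M s s<M)

  -- (b , e , l) stands for the monomial q^e r^l if b holds, and for nothing otherwise.
  Monomial : Set
  Monomial = Bool × ℕ × ℕ

  count : List Monomial → ℕ → ℕ → ℕ
  count T i j = sum (map (λ { (b , e , l) → ind (b ∧ (e ≡ᵇ i) ∧ (l ≡ᵇ j)) }) T)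

  evaluate : List Monomial → ℕ → ℕ → ℕ
  evaluate T Q R = sum (map (λ { (b , e , l) → ind b * (Q ^ e * R ^ l) }) T)

  -- Evaluating at q = B ^ K, r = B writes the monomials as digits in base B.
  module _ (K : ℕ) where

    Bounded : Monomial → Set
    Bounded (_ , e , l) = e < K × l < K

    index : Monomial → ℕ
    index (_ , e , l) = l + K * e

    index< : ∀ {x} → Bounded x → index x < K * K
    index< {_ , e , l} (e<K , l<K) =
      <-≤-trans (+-monoˡ-< (K * e) l<K) (≤-trans (≤-reflexive (sym (*-suc K e))) (*-monoʳ-≤ K e<K))

    digitCount : List Monomial → ℕ → ℕ
    digitCount T t = sum (map (λ { (b , e , l) → ind (b ∧ (l + K * e ≡ᵇ t)) }) T)

    digitCount≤length : ∀ T t → digitCount T t ≤ length T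
    digitCount≤length []              t = z≤n
    digitCount≤length ((b , e , l) ∷ T) t = +-mono-≤ (ind≤1 (b ∧ (l + K * e ≡ᵇ t))) (digitCount≤length T t)
      where
      ind≤1 : ∀ c → ind c ≤ 1
      ind≤1 true  = ≤-refl
      ind≤1 false = z≤n

    evaluate≡evalDigits : ∀ B T → All Bounded T → evaluate T (B ^ K) B ≡ evalDigits (digitCount T) B (K * K)
    evaluate≡evalDigits B []                []           = sym (evalDigits-0 B (K * K))
    evaluate≡evalDigits B ((b , e , l) ∷ T) (bd ∷ bds) =
      trans (cong₂ _+_ (monomial b) (evaluate≡evalDigits B T bds)) (sym (evalDigits-+ B (K * K) _ _))
      where
      power : (B ^ K) ^ e * B ^ l ≡ B ^ (l + K * e)
      power = trans (cong (_* B ^ l) (^-*-assoc B K e)) (trans (*-comm (B ^ (K * e)) (B ^ l)) (sym (^-distribˡ-+-* B l (K * e))))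
      monomial : ∀ b → ind b * ((B ^ K) ^ e * B ^ l) ≡ evalDigits (λ t → ind (b ∧ (l + K * e ≡ᵇ t))) B (K * K)
      monomial true  = trans (+-identityʳ _) (trans power (sym (evalDigits-single B (K * K) (l + K * e) (index< {true , e , l} bd))))
      monomial false = sym (evalDigits-0 B (K * K))

    count≡digitCount : ∀ T i j → i < K → j < K → All Bounded T → count T i j ≡ digitCount T (j + K * i)
    count≡digitCount []                i j _   _   _            = refl
    count≡digitCount ((b , e , l) ∷ T) i j i<K j<K ((e<K , l<K) ∷ bds) =
      cong₂ _+_ (cong (λ c → ind (b ∧ c)) same-digits) (count≡digitCount T i j i<K j<K bds)
      where
      same-digits : (e ≡ᵇ i) ∧ (l ≡ᵇ j) ≡ (l + K * e ≡ᵇ j + K * i)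
      same-digits = bool-ext to from
        where
        to : (e ≡ᵇ i) ∧ (l ≡ᵇ j) ≡ true → (l + K * e ≡ᵇ j + K * i) ≡ true
        to h rewrite ≡ᵇ-true⇒≡ e i (∧-elimˡ h) | ≡ᵇ-true⇒≡ l j (∧-elimʳ {e ≡ᵇ i} h) = ≡ᵇ-refl (j + K * i)
        from : (l + K * e ≡ᵇ j + K * i) ≡ true → (e ≡ᵇ i) ∧ (l ≡ᵇ j) ≡ true
        from h with base-digit-unique K l j e i l<K j<K (≡ᵇ-true⇒≡ _ _ h)
        ... | refl , refl = ∧-intro (≡ᵇ-refl e) (≡ᵇ-refl l)

    count-from-evaluate : ∀ B T₁ T₂ → length T₁ < B → length T₂ < B → All Bounded T₁ → All Bounded T₂ →
      evaluate T₁ (B ^ K) B ≡ evaluate T₂ (B ^ K) B → ∀ i j → i < K → j < K → count T₁ i j ≡ count T₂ i j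
    count-from-evaluate B T₁ T₂ T₁<B T₂<B bds₁ bds₂ eval≡ i j i<K j<K =
      trans (count≡digitCount T₁ i j i<K j<K bds₁) (trans digits≡ (sym (count≡digitCount T₂ i j i<K j<K bds₂)))
      where
      digits≡ : digitCount T₁ (j + K * i) ≡ digitCount T₂ (j + K * i)
      digits≡ = evalDigits-injective B (K * K) (digitCount T₁) (digitCount T₂)
                  (λ t → ≤-<-trans (digitCount≤length T₁ t) T₁<B) (λ t → ≤-<-trans (digitCount≤length T₂ t) T₂<B)
                  (trans (sym (evaluate≡evalDigits B T₁ bds₁)) (trans eval≡ (evaluate≡evalDigits B T₂ bds₂)))
                  (j + K * i) (index< {true , i , j} (i<K , j<K))

module SubtreePolynomial where

  open import Data.Bool using (Bool; true; false; _∨_)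
  open import Data.List using (List; []; _∷_; map; length; concatMap)
  open import Data.List.Properties using (map-∘; map-cong; map-concatMap; concatMap-cong; length-map)
  open import Data.List.Relation.Unary.All using (All; universal)
  open import Data.List.Relation.Unary.All.Properties using (map⁺)
  open import Data.Nat using (ℕ; suc; _+_; _^_; _*_; _≤_; _<_; _≡ᵇ_; z≤n; s≤s)
  open import Data.Nat.ListAction using (sum)
  open import Data.Nat.Properties
  open import Data.Product using (_×_; _,_)
  open import Function using (_∘_)
  open import Relation.Binary.PropositionalEquality
  open ≡-Reasoning
  open import Defs
  open Booleans
  open Sums
  open SubtreeWeights using (subtreeWeight)
  open DigitExtraction

  pairs : ℕ → ℕ → List (List Bool × List Bool)
  pairs n m = concatMap (λ vs → map (vs ,_) (allBools m)) (allBools n)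

  map-pairs : ∀ {A : Set} (f : List Bool × List Bool → A) n m →
              map f (pairs n m) ≡ concatMap (λ vs → map (λ es → f (vs , es)) (allBools m)) (allBools n)
  map-pairs f n m = trans (map-concatMap f _ (allBools n)) (concatMap-cong (λ vs → sym (map-∘ (allBools m))) (allBools n))

  monomials : Graph → List Monomial
  monomials G = map (λ { (vs , es) → isSubtree G vs es , eS (selEdges (edges G) es) , ℓS (selEdges (edges G) es) })
                    (pairs (nV G) (length (edges G)))

  subtreeCoeff≡count : ∀ G i j → subtreeCoeff G i j ≡ count (monomials G) i j
  subtreeCoeff≡count G i j = cong sum (sym (trans (sym (map-∘ (pairs (nV G) (length (edges G))))) (map-pairs _ (nV G) (length (edges G)))))

  subtreeWeight≡evaluate : ∀ Q R G → subtreeWeight Q R G ≡ evaluate (monomials G) Q R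
  subtreeWeight≡evaluate Q R G = sym (begin
    sum (map v (map mono (pairs (nV G) m)))      ≡⟨ cong sum (map-∘ (pairs (nV G) m)) ⟨
    sum (map (v ∘ mono) (pairs (nV G) m))
      ≡⟨ sum-map-concatMap (v ∘ mono) (λ vs → map (vs ,_) (allBools m)) (allBools (nV G)) ⟩
    sum (map (λ vs → sum (map (v ∘ mono) (map (vs ,_) (allBools m)))) (allBools (nV G)))
      ≡⟨ cong sum (map-cong (λ vs → cong sum (sym (map-∘ (allBools m)))) (allBools (nV G))) ⟩
    subtreeWeight Q R G                          ∎)
    where
    m = length (edges G)
    mono : List Bool × List Bool → Monomial
    mono (vs , es) = isSubtree G vs es , eS (selEdges (edges G) es) , ℓS (selEdges (edges G) es)
    v : Monomial → ℕ
    v (b , e , l) = ind b * (Q ^ e * R ^ l)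

  length-selEdges : ∀ E es → length (selEdges E es) ≤ length E
  length-selEdges []      es           = z≤n
  length-selEdges (e ∷ E) []           = z≤n
  length-selEdges (e ∷ E) (true  ∷ es) = s≤s (length-selEdges E es)
  length-selEdges (e ∷ E) (false ∷ es) = m≤n⇒m≤1+n (length-selEdges E es)

  ℓS≤eS : ∀ S → ℓS S ≤ eS S
  ℓS≤eS S = sum-ind≤length S
    where
    sum-ind≤length : ∀ xs → sum (map (λ { (u , v) → ind ((deg S u ≡ᵇ 1) ∨ (deg S v ≡ᵇ 1)) }) xs) ≤ length xs
    sum-ind≤length []            = z≤n
    sum-ind≤length ((u , v) ∷ xs) = +-mono-≤ (ind≤1 ((deg S u ≡ᵇ 1) ∨ (deg S v ≡ᵇ 1))) (sum-ind≤length xs)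
      where
      ind≤1 : ∀ b → ind b ≤ 1
      ind≤1 true  = ≤-refl
      ind≤1 false = z≤n

  monomials-bounded : ∀ G K → length (edges G) < K → All (Bounded K) (monomials G)
  monomials-bounded G K m<K = map⁺ (universal bounded (pairs (nV G) (length (edges G))))
    where
    bounded : ∀ ((vs , es) : List Bool × List Bool) →
              Bounded K (isSubtree G vs es , eS (selEdges (edges G) es) , ℓS (selEdges (edges G) es))
    bounded (vs , es) = ≤-<-trans (length-selEdges (edges G) es) m<K
                      , ≤-<-trans (≤-trans (ℓS≤eS (selEdges (edges G) es)) (length-selEdges (edges G) es)) m<K

  sameSubtreePoly-by-evaluation : ∀ G H → nV G ≡ nV H → length (edges G) ≡ length (edges H) →
                                  (∀ Q R → subtreeWeight Q R G ≡ subtreeWeight Q R H) → SameSubtreePoly G H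
  sameSubtreePoly-by-evaluation G H n≡ m≡ weights≡ i j = begin
    subtreeCoeff G i j          ≡⟨ subtreeCoeff≡count G i j ⟩
    count (monomials G) i j     ≡⟨ count-from-evaluate K B (monomials G) (monomials H) ≤-refl lengthH<B
                                     (monomials-bounded G K mG<K) (monomials-bounded H K mH<K) evaluations≡
                                     i j i<K j<K ⟩
    count (monomials H) i j     ≡⟨ subtreeCoeff≡count H i j ⟨
    subtreeCoeff H i j          ∎
    where
    m = length (edges G)
    K = suc (m + (i + j))
    B = suc (length (monomials G))
    mG<K : m < K
    mG<K = s≤s (m≤m+n m (i + j))
    mH<K : length (edges H) < K
    mH<K = subst (_< K) m≡ mG<K
    i<K : i < K
    i<K = s≤s (≤-trans (m≤m+n i j) (m≤n+m (i + j) m))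
    j<K : j < K
    j<K = s≤s (≤-trans (m≤n+m j i) (m≤n+m (i + j) m))
    lengthH<B : length (monomials H) < B
    lengthH<B = s≤s (≤-reflexive (trans (length-map _ (pairs (nV H) (length (edges H))))
                                 (trans (cong₂ (λ n m → length (pairs n m)) (sym n≡) (sym m≡))
                                        (sym (length-map _ (pairs (nV G) m))))))
    evaluations≡ : evaluate (monomials G) (B ^ K) B ≡ evaluate (monomials H) (B ^ K) B
    evaluations≡ = trans (sym (subtreeWeight≡evaluate (B ^ K) B G)) (trans (weights≡ (B ^ K) B) (subtreeWeight≡evaluate (B ^ K) B H))

open import Data.Product using (_,_)
open import Relation.Binary.PropositionalEquality using (refl)
open Tokens
open CatSeqSymmetry
open SubtreePolynomial using (sameSubtreePoly-by-evaluation)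

corollary6p5 : (p : List ℕ) → GapFree p → (a b : ℕ) → 1 ≤ a → 1 ≤ b →
    IsCatSeq (L₁ a b p) × IsCatSeq (L₂ a b p) ×
    SameSubtreePoly (Cat (L₁ a b p)) (Cat (L₂ a b p))
corollary6p5 p gapFree a b 1≤a 1≤b with gapFree⇒tokens p gapFree
... | ts , refl rewrite L₁-tokens a b ts | L₂-tokens a b ts =
  isCatSeq-catSeq a b ts 1≤a 1≤b ,
  isCatSeq-catSeq b a ts 1≤b 1≤a ,
  sameSubtreePoly-by-evaluation (Cat (catSeq a b ts)) (Cat (catSeq b a ts))
    (nV-Cat-catSeq-swap a b ts) (#edges-Cat-catSeq-swap a b ts)
    (λ Q R → subtreeWeight-catSeq-swap Q R a b ts 1≤a 1≤b)
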